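{- Let $f:\mathbb{F}_{2^n}\to\mathbb{Z}_{2^k}$. The following are equivalent: (i) $f$ is nega-$\mathbb{Z}_{2^k}$-bent; (ii) $f(y+z)-f(y)+2^{k-1}\mathrm{Tr}^n_1(zy)$ (as a function of $y$) is balanced for every nonzero $z\in\mathbb{F}_{2^n}$; (iii) the graph $G_f=\{(x,f(x)):x\in\mathbb{F}_{2^n}\}$ is a $(2^n,2^k,2^n,2^{n-k})$-relative difference set in the group $G=(\mathbb{F}_{2^n}\times\mathbb{Z}_{2^k},+_\star)$ relative to $\{0\}\times\mathbb{Z}_{2^k}$, where $(x_1,y_1)+_\star(x_2,y_2)=(x_1+x_2,\,y_1+y_2+2^{k-1}\mathrm{Tr}^n_1(x_1x_2))$.
   Context: $\mathrm{Tr}^n_1$ is the absolute trace $\mathbb{F}_{2^n}\to\mathbb{F}_2$; trace values are regarded as integers $0,1$ in exponents and in $\mathbb{Z}_{2^k}$. Let $\zeta_{2^k}=e^{2\pi\sqrt{ -1}/2^k}$, $i=\sqrt{ -1}$. For $x\in\mathbb{F}_{2^n}$ let $\sigma(1,x)=\sum_{0\le i<j\le n-1}x^{2^i}x^{2^j}\in\mathbb{F}_2$, and for $c\in\mathbb{Z}_{2^k}$ let $\sigma(c,x)=\sigma(1,x)$ if $c$ is odd and $0$ if $c$ is even. A function $f:\mathbb{F}_{2^n}\to\mathbb{Z}_{2^k}$ is nega-$\mathbb{Z}_{2^k}$-bent if $$\mathcal{K}_f(c,u)=\sum_{x\in\mathbb{F}_{2^n}}(-1)^{\mathrm{Tr}^n_1(ux)+\sigma(c,x)}\zeta_{2^k}^{cf(x)}i^{\mathrm{Tr}^n_1(c_0x)}$$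 has absolute value $2^{n/2}$ for all $u\in\mathbb{F}_{2^n}$ and all nonzero $c\in\mathbb{Z}_{2^k}$, where $c_0\in\{0,1\}$, $c_0\equiv c\pmod 2$. A balanced function takes every value of its codomain equally often. For a group $G$ of order $\mu\nu$ with subgroup $N$ of order $\nu$, a subset $R$ of size $\kappa$ is a $(\mu,\nu,\kappa,\lambda)$-relative difference set relative to $N$ if every element of $G\setminus N$ can be written as $r_1-r_2$ (difference in $G$) with $r_1,r_2\in R$ in exactly $\lambda$ ways, and no non-identity element of $N$ can be so written. -}

module Defs where

open import Level using (0ℓ)
open import Data.Bool.Base using (Bool; true; false; if_then_else_)
open import Data.Nat.Base as ℕ using (ℕ; zero; suc; _∸_; _^_; _<ᵇ_; NonZero)
open import Data.Nat.DivMod using (_%_; m%n<n)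
open import Data.Nat.Properties using (m^n≢0)
import Data.Nat.Properties as ℕP
open import Data.Integer.Base as ℤ using (ℤ; +_)
open import Data.Fin.Base using (Fin; toℕ; fromℕ<)
import Data.Fin.Properties as FinP
open import Data.List.Base using (List; []; _∷_; map; foldr; upTo; allFin; length; cartesianProduct; filter)
open import Data.List.Relation.Unary.Unique.Propositional using (Unique)
open import Data.List.Membership.Propositional using () renaming (_∈_ to _∈L_)
open import Data.Product.Base using (_×_; _,_; proj₁; proj₂; ∃)
open import Function.Bundles using (_⤖_; Bijection)
open import Algebra.Core using (Op₁; Op₂)
open import Algebra.Structures using (IsCommutativeRing)
open import Relation.Binary.PropositionalEquality using (_≡_; _≢_)
open import Relation.Binary.Definitions using (DecidableEquality)
open import Relation.Nullary.Decidable.Core using (does)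
open import Data.Product.Properties using (≡-dec)

count : {A : Set} → (A → Bool) → List A → ℕ
count p = foldr (λ x acc → if p x then suc acc else acc) 0

record GF (n : ℕ) : Set₁ where
  field
    F      : Set
    _+_    : Op₂ F
    _*_    : Op₂ F
    -_     : Op₁ F
    0#     : F
    1#     : F
    isCommutativeRing : IsCommutativeRing _≡_ _+_ _*_ -_ 0# 1#
    0≢1    : 0# ≢ 1#
    inverse : ∀ x → x ≢ 0# → ∃ λ y → (x * y) ≡ 1#
    _≟_    : DecidableEquality F
    enum   : Fin (2 ^ n) ⤖ F

  infixl 6 _+_
  infixl 7 _*_

  elems : List F
  elems = map (Bijection.to enum) (allFin (2 ^ n))

  sumF : List F → F
  sumF = foldr _+_ 0#

  frob : ℕ → F → F
  frob zero    x = x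
  frob (suc i) x = frob i x * frob i x

  -- absolute trace Tr^n_1 (x) = Σ_{i<n} x^(2^i), an element of 𝔽_2 ⊆ F
  TrF : F → F
  TrF x = sumF (map (λ i → frob i x) (upTo n))

  -- an element of the prime field 𝔽_2 = {0#,1#} read as the integer 0 or 1
  bit : F → ℕ
  bit a = if does (a ≟ 0#) then 0 else 1

  Tr : F → ℕ
  Tr x = bit (TrF x)

  σ1 : F → ℕ
  σ1 x = bit (sumF (map (λ j → sumF (map (λ i → frob i x * frob j x) (upTo j))) (upTo n)))

modFin : (M : ℕ) → .{{NonZero M}} → ℕ → Fin M
modFin M x = fromℕ< (m%n<n x M)

Zk : ℕ → Set
Zk k = Fin (2 ^ k)

toZk : (k : ℕ) → ℕ → Zk k
toZk k x = modFin (2 ^ k) {{m^n≢0 2 k}} x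

-- The cyclotomic ring ℤ[ζ_{2M}] ≅ ℤ[X]/(X^M + 1) for M = 2^m,
-- represented by coefficient vectors w.r.t. 1, ζ, …, ζ^(M-1).

Cyc : ℕ → Set
Cyc M = Fin M → ℤ

module Cyclo (m : ℕ) where
  M : ℕ
  M = 2 ^ m

  -- order of ζ
  N : ℕ
  N = 2 ^ suc m

  instance
    N≢0 : NonZero N
    N≢0 = m^n≢0 2 (suc m)

  zeroC : Cyc M
  zeroC _ = + 0

  _⊕_ : Cyc M → Cyc M → Cyc M
  (v ⊕ w) j = v j ℤ.+ w j

  scale : ℤ → Cyc M → Cyc M
  scale a v j = a ℤ.* v j

  sumC : List (Cyc M) → Cyc M
  sumC = foldr _⊕_ zeroC

  -- ζ^e, ζ = ζ_N = e^{2πi/N}, using ζ^M = -1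
  ζ^ : ℕ → Cyc M
  ζ^ e j with e % N
  ... | r = if does (r ℕP.≟ toℕ j) then + 1
            else if does (r ℕP.≟ toℕ j ℕ.+ M) then ℤ.- (+ 1) else + 0

  _⊗_ : Cyc M → Cyc M → Cyc M
  v ⊗ w = sumC (map (λ i → sumC (map (λ j → scale (v i ℤ.* w j) (ζ^ (toℕ i ℕ.+ toℕ j))) (allFin M))) (allFin M))

  -- complex conjugation ζ ↦ ζ^{-1} = ζ^{N - 1}
  conj : Cyc M → Cyc M
  conj v = sumC (map (λ i → scale (v i) (ζ^ (N ∸ toℕ i))) (allFin M))

  const : ℤ → Cyc M
  const a j = if does (toℕ j ℕP.≟ 0) then a else + 0

  normSq : Cyc M → Cyc M
  normSq v = v ⊗ conj v

module _ {n : ℕ} (𝔽 : GF n) (k : ℕ) where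
  open GF 𝔽

  -- We work in ℤ[ζ_{2^(k+2)}] (m = k+1, M = 2^(k+1), N = 2^(k+2)), in which
  --   -1 = ζ^(2^(k+1)),  ζ_{2^k} = ζ^4,  i = ζ^(2^k).
  open Cyclo (suc k)

  σ : Zk k → F → ℕ
  σ c x = if does (toℕ c % 2 ℕP.≟ 1) then σ1 x else 0

  c₀ : Zk k → F
  c₀ c = if does (toℕ c % 2 ℕP.≟ 1) then 1# else 0#

  summandExp : (F → Zk k) → Zk k → F → F → ℕ
  summandExp f c u x =
      2 ^ suc k ℕ.* (Tr (u * x) ℕ.+ σ c x)
    ℕ.+ 4 ℕ.* (toℕ c ℕ.* toℕ (f x))
    ℕ.+ 2 ^ k ℕ.* Tr (c₀ c * x)

  𝒦 : (F → Zk k) → Zk k → F → Cyc M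
  𝒦 f c u = sumC (map (λ x → ζ^ (summandExp f c u x)) elems)

  -- |𝒦_f(c,u)| = 2^{n/2}  ⇔  𝒦 · conj 𝒦 = 2^n in ℤ[ζ]
  IsNegaBent : (F → Zk k) → Set
  IsNegaBent f = ∀ (c : Zk k) → toℕ c ≢ 0 → ∀ (u : F) →
                 ∀ j → normSq (𝒦 f c u) j ≡ const (+ (2 ^ n)) j

  IsBalanced : (F → Zk k) → Set
  IsBalanced g = ∀ (a b : Zk k) →
    count (λ y → does (g y FinP.≟ a)) elems ≡ count (λ y → does (g y FinP.≟ b)) elems

  derivFun : (F → Zk k) → F → F → Zk k
  derivFun f z y = toZk k (toℕ (f (y + z)) ℕ.+ (2 ^ k ∸ toℕ (f y)) ℕ.+ 2 ^ (k ∸ 1) ℕ.* Tr (z * y))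

  G : Set
  G = F × Zk k

  _+⋆_ : G → G → G
  (x₁ , y₁) +⋆ (x₂ , y₂) = (x₁ + x₂ , toZk k (toℕ y₁ ℕ.+ toℕ y₂ ℕ.+ 2 ^ (k ∸ 1) ℕ.* Tr (x₁ * x₂)))

  -⋆_ : G → G
  -⋆ (x , y) = (- x , toZk k ((2 ^ k ∸ toℕ y) ℕ.+ (2 ^ k ∸ 2 ^ (k ∸ 1) ℕ.* Tr ((- x) * x))))

  0G : G
  0G = (0# , toZk k 0)

  _≟G_ : DecidableEquality G
  _≟G_ = ≡-dec _≟_ FinP._≟_

  elemsG : List G
  elemsG = cartesianProduct elems (allFin (2 ^ k))

  inN : G → Bool
  inN g = does (proj₁ g ≟ 0#)

  graph : (F → Zk k) → List G
  graph f = map (λ x → (x , f x)) elems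

-- Relative difference sets in a finite group (G, ∙, inv, e) given by
-- a duplicate-free enumeration, a subgroup N (as a boolean predicate),
-- and a subset R (as a duplicate-free list).

module _ {G : Set} (_≟_ : DecidableEquality G) (_∙_ : G → G → G) (inv : G → G) (e : G) where

  diffCount : List G → G → ℕ
  diffCount R g = count (λ p → does ((proj₁ p ∙ inv (proj₂ p)) ≟ g)) (cartesianProduct R R)

  IsRDS : (elemsG : List G) (inN : G → Bool) (R : List G) (μ ν κ lam : ℕ) → Set
  IsRDS elemsG inN R μ ν κ lam =
      Unique elemsG × (∀ g → g ∈L elemsG) × length elemsG ≡ μ ℕ.* ν
    × count inN elemsG ≡ ν
    × Unique R × length R ≡ κ
    × (∀ g → inN g ≡ false → diffCount R g ≡ lam)
    × (∀ g → inN g ≡ true → g ≢ e → diffCount R g ≡ 0)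

-- Let ζ be a primitive 2^(k+2)-th root of unity, so that every summand of 𝒦_f(c,u) is a power
-- of ζ (−1 = ζ^(2^(k+1)), ζ_{2^k} = ζ⁴, i = ζ^(2^k)), and let
--   D_w f(y) = f(y + w) − f(y) + 2^(k−1) Tr(w y).
-- Expanding |𝒦_f(c,u)|² and substituting x = w + y gives, for c ≠ 0,
--   |𝒦_f(c,u)|² = Σ_w (−1)^Tr(u w) · ε_c(w) · Σ_y ζ_{2^k}^(c · D_w f(y))   (ε_c(w) a power of ζ),
-- where the twists (−1)^σ(c,x) and i^Tr(c₀ x) produce the term 2^(k−1) Tr(w y) through the cocycle
--   σ(y + w) = σ(y) + σ(w) + Tr(y) Tr(w) + Tr(y w).
-- If every D_w f (w ≠ 0) is balanced, the inner sums vanish for w ≠ 0 and |𝒦_f(c,u)|² = 2ⁿ.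
-- Conversely, averaging |𝒦_f(c,u)|² = 2ⁿ against (−1)^Tr(u z) over u shows that
-- Σ_y ζ_{2^k}^(c · D_z f(y)) = 0 for every c ≠ 0, and summing over c ∈ ℤ_{2^k} counts the fibres
-- of D_z f, which therefore all have size 2^(n−k).
-- Finally (x₁, f x₁) −⋆ (x₂, f x₂) = (z, D_z f(x₂)) for z = x₁ + x₂, so the number of ways to
-- write (z, a) as a difference of two points of the graph is the size of the fibre of D_z f over a.
module Submission where

open import Algebra.Bundles using (CommutativeMonoid; CommutativeRing)
open import Algebra.Core using (Op₂)
import Algebra.Properties.CommutativeMonoid.Sum as VectorSum
import Algebra.Properties.CommutativeSemigroup as CommutativeSemigroupProperties
import Algebra.Properties.Ring as RingProperties
import Algebra.Properties.Semiring.Exp as SemiringExp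
import Algebra.Properties.Semiring.Mult as SemiringMult
import Algebra.Solver.Ring.NaturalCoefficients.Default as NaturalCoefficientsSolver
open import Algebra.Structures using (IsCommutativeMonoid; IsCommutativeRing)
open import Data.Bool.Base using (Bool; true; false; if_then_else_)
open import Data.Empty using (⊥-elim)
open import Data.Fin.Base using (Fin; zero; suc; toℕ; fromℕ<)
open import Data.Fin.Permutation using (Permutation; permutation)
import Data.Fin.Properties as FinP
open import Data.Integer.Base as ℤ using (ℤ; +_) renaming (_+_ to _+ℤ_; _*_ to _*ℤ_; -_ to -ℤ_)
import Data.Integer.Properties as ℤP
open import Data.List.Base using (List; []; _∷_; map; _++_; foldr; tabulate; allFin; cartesianProduct; upTo; applyUpTo; [_]; length; replicate)
open import Data.List.Membership.Propositional using (_∈_; find; lose)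
import Data.List.Membership.Propositional.Properties as ∈P
import Data.List.Properties as ListP
open import Data.List.Relation.Unary.All using (All; _∷_)
import Data.List.Relation.Unary.All as All
open import Data.List.Relation.Unary.AllPairs using (_∷_)
open import Data.List.Relation.Unary.Any using (here; there)
import Data.List.Relation.Unary.Any as Any
open import Data.List.Relation.Unary.Unique.Propositional using (Unique)
import Data.List.Relation.Unary.Unique.Propositional.Properties as UniqueP
open import Data.Nat.Base as ℕ using (ℕ; zero; suc; _^_; _≤_; z≤n; s≤s; _<_; NonZero; _∸_)
open import Data.Nat.DivMod using (_%_; m%n<n; m<n⇒m%n≡m; %-distribˡ-+; %-distribˡ-*; [m+kn]%n≡m%n; m%n%n≡m%n; [m+n]%n≡m%n; _/_; m≡m%n+[m/n]*n; m/n<m; n%n≡0)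
open import Data.Nat.Induction using (<-rec)
import Data.Nat.Properties as ℕP
open import Data.Nat.Tactic.RingSolver using (solve-∀)
open import Data.Product.Base using (_×_; _,_; proj₁; proj₂; ∃; Σ-syntax)
open import Data.Sum.Base using (_⊎_; inj₁; inj₂)
open import Function.Base using (_∘_)
open import Function.Bundles using (Bijection; _⇔_; mk⇔)
open import Function.Construct.Composition using (_⇔-∘_)
open import Induction.WellFounded using (WfRec)
open import Level using (0ℓ)
open import Relation.Binary.Definitions using (DecidableEquality)
open import Relation.Binary.PropositionalEquality hiding ([_])
open import Relation.Nullary using (yes; no; does; ¬_)
open import Relation.Nullary.Negation using (contradiction)
open import Defs

module ListSum {C : Set} {_∙_ : Op₂ C} {ε : C} (isCommutativeMonoid : IsCommutativeMonoid _≡_ _∙_ ε) where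
  open IsCommutativeMonoid isCommutativeMonoid using (assoc; identityˡ; identityʳ)
  open ≡-Reasoning

  commutativeMonoid : CommutativeMonoid 0ℓ 0ℓ
  commutativeMonoid = record { isCommutativeMonoid = isCommutativeMonoid }

  open CommutativeSemigroupProperties (CommutativeMonoid.commutativeSemigroup commutativeMonoid) using (interchange)
  open VectorSum commutativeMonoid using (sum; sum-cong-≗; sum-permute)

  Σ : {A : Set} → List A → (A → C) → C
  Σ []      v = ε
  Σ (x ∷ l) v = v x ∙ Σ l v

  Σ-cong : {A : Set} (l : List A) {v w : A → C} → (∀ x → v x ≡ w x) → Σ l v ≡ Σ l w
  Σ-cong []      e = refl
  Σ-cong (x ∷ l) e = cong₂ _∙_ (e x) (Σ-cong l e)

  Σ-cong-∈ : {A : Set} (l : List A) {v w : A → C} → (∀ {x} → x ∈ l → v x ≡ w x) → Σ l v ≡ Σ l w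
  Σ-cong-∈ []      e = refl
  Σ-cong-∈ (x ∷ l) e = cong₂ _∙_ (e (here refl)) (Σ-cong-∈ l (e ∘ there))

  Σ-map : {A B : Set} (f : A → B) (l : List A) (v : B → C) → Σ (map f l) v ≡ Σ l (v ∘ f)
  Σ-map f []      v = refl
  Σ-map f (x ∷ l) v = cong (v (f x) ∙_) (Σ-map f l v)

  Σ-++ : {A : Set} (l m : List A) (v : A → C) → Σ (l ++ m) v ≡ Σ l v ∙ Σ m v
  Σ-++ []      m v = sym (identityˡ _)
  Σ-++ (x ∷ l) m v = trans (cong (v x ∙_) (Σ-++ l m v)) (sym (assoc _ _ _))

  Σ-foldr : {A : Set} (l : List A) (v : A → C) → foldr _∙_ ε (map v l) ≡ Σ l v
  Σ-foldr []      v = refl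
  Σ-foldr (x ∷ l) v = cong (v x ∙_) (Σ-foldr l v)

  Σ-ε : {A : Set} (l : List A) → Σ l (λ _ → ε) ≡ ε
  Σ-ε []      = refl
  Σ-ε (x ∷ l) = trans (identityˡ _) (Σ-ε l)

  Σ-distrib : {A : Set} (l : List A) (v w : A → C) → Σ l (λ x → v x ∙ w x) ≡ Σ l v ∙ Σ l w
  Σ-distrib []      v w = sym (identityˡ ε)
  Σ-distrib (x ∷ l) v w = trans (cong ((v x ∙ w x) ∙_) (Σ-distrib l v w)) (interchange _ _ _ _)

  Σ-comm : {A B : Set} (l : List A) (m : List B) (h : A → B → C) →
           Σ l (λ x → Σ m (h x)) ≡ Σ m (λ y → Σ l (λ x → h x y))
  Σ-comm []      m h = sym (Σ-ε m)
  Σ-comm (x ∷ l) m h = trans (cong (Σ m (h x) ∙_) (Σ-comm l m h)) (sym (Σ-distrib m (h x) _))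

  Σ-cartesianProduct : {A B : Set} (l : List A) (m : List B) (h : A × B → C) →
                       Σ (cartesianProduct l m) h ≡ Σ l (λ x → Σ m (λ y → h (x , y)))
  Σ-cartesianProduct []      m h = refl
  Σ-cartesianProduct (x ∷ l) m h =
    trans (Σ-++ (map (x ,_) m) _ h) (cong₂ _∙_ (Σ-map (x ,_) m h) (Σ-cartesianProduct l m h))

  Σ-homomorphism : {A : Set} (φ : C → C) → (∀ a b → φ (a ∙ b) ≡ φ a ∙ φ b) → φ ε ≡ ε →
                   (l : List A) (v : A → C) → φ (Σ l v) ≡ Σ l (φ ∘ v)
  Σ-homomorphism φ φ-∙ φ-ε []      v = φ-ε
  Σ-homomorphism φ φ-∙ φ-ε (x ∷ l) v = trans (φ-∙ _ _) (cong (φ (v x) ∙_) (Σ-homomorphism φ φ-∙ φ-ε l v))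

  Σ-select : {A : Set} (_≟_ : DecidableEquality A) (l : List A) (w : A) (v : A → C) →
             Unique l → w ∈ l → Σ l (λ x → if does (x ≟ w) then v x else ε) ≡ v w
  Σ-select _≟_ (x ∷ l) w v (x∉l ∷ _) (here refl) with x ≟ x
  ... | no x≢x = contradiction refl x≢x
  ... | yes _  = trans (cong (v x ∙_) (trans (Σ-cong-∈ l vanish) (Σ-ε l))) (identityʳ _)
    where
    vanish : ∀ {y} → y ∈ l → (if does (y ≟ x) then v y else ε) ≡ ε
    vanish {y} y∈l with y ≟ x
    ... | no _     = refl
    ... | yes refl = contradiction refl (All.lookup x∉l y∈l)
  Σ-select _≟_ (x ∷ l) w v (x∉l ∷ u) (there w∈l) with x ≟ w
  ... | yes refl = contradiction refl (All.lookup x∉l w∈l)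
  ... | no _     = trans (identityˡ _) (Σ-select _≟_ l w v u w∈l)

  Σ-isolate : {A : Set} (_≟_ : DecidableEquality A) (l : List A) (w : A) (v : A → C) →
              Unique l → w ∈ l → Σ l v ≡ v w ∙ Σ l (λ x → if does (x ≟ w) then ε else v x)
  Σ-isolate {A} _≟_ l w v u w∈l = begin
    Σ l v                      ≡⟨ Σ-cong l split ⟩
    Σ l (λ x → at x ∙ rest x)  ≡⟨ Σ-distrib l at rest ⟩
    Σ l at ∙ Σ l rest          ≡⟨ cong (_∙ Σ l rest) (Σ-select _≟_ l w v u w∈l) ⟩
    v w ∙ Σ l rest             ∎
    where
    at rest : A → C
    at   x = if does (x ≟ w) then v x else ε
    rest x = if does (x ≟ w) then ε else v x
    split : ∀ x → v x ≡ at x ∙ rest x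
    split x with does (x ≟ w)
    ... | true  = sym (identityʳ _)
    ... | false = sym (identityˡ _)

  Σ-tabulate : {A : Set} (n : ℕ) (f : Fin n → A) (v : A → C) → Σ (tabulate f) v ≡ Σ (allFin n) (v ∘ f)
  Σ-tabulate zero    f v = refl
  Σ-tabulate (suc n) f v = cong (v (f zero) ∙_) (trans (Σ-tabulate n (f ∘ suc) v) (sym (Σ-tabulate n suc (v ∘ f))))

  Σ-allFin-suc : (n : ℕ) (v : Fin (suc n) → C) → Σ (allFin (suc n)) v ≡ v zero ∙ Σ (allFin n) (v ∘ suc)
  Σ-allFin-suc n v = cong (v zero ∙_) (Σ-tabulate n suc v)

  Σ-allFin-select-toℕ : ∀ n r (r<n : r < n) (v : Fin n → C) →
                        Σ (allFin n) (λ i → if does (r ℕP.≟ toℕ i) then v i else ε) ≡ v (fromℕ< r<n)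
  Σ-allFin-select-toℕ (suc n) zero    r<n       v =
    trans (Σ-allFin-suc n (λ i → if does (0 ℕP.≟ toℕ i) then v i else ε))
          (trans (cong (v zero ∙_) (Σ-ε (allFin n))) (identityʳ _))
  Σ-allFin-select-toℕ (suc n) (suc r) (s≤s r<n) v =
    trans (Σ-allFin-suc n (λ i → if does (suc r ℕP.≟ toℕ i) then v i else ε))
          (trans (identityˡ _) (Σ-allFin-select-toℕ n r r<n (v ∘ suc)))

  Σ-allFin≡sum : (n : ℕ) (v : Fin n → C) → Σ (allFin n) v ≡ sum v
  Σ-allFin≡sum zero    v = refl
  Σ-allFin≡sum (suc n) v = cong (v zero ∙_) (trans (Σ-tabulate n suc v) (Σ-allFin≡sum n (v ∘ suc)))

  Σ-reindex : {A : Set} (n : ℕ) (to : Fin n → A) (from : A → Fin n) →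
              (∀ i → from (to i) ≡ i) → (∀ x → to (from x) ≡ x) →
              (φ ψ : A → A) → (∀ x → ψ (φ x) ≡ x) → (∀ x → φ (ψ x) ≡ x) →
              (v : A → C) → Σ (map to (allFin n)) (v ∘ φ) ≡ Σ (map to (allFin n)) v
  Σ-reindex n to from from∘to to∘from φ ψ ψ∘φ φ∘ψ v = begin
    Σ (map to (allFin n)) (v ∘ φ)     ≡⟨ Σ-map to (allFin n) _ ⟩
    Σ (allFin n) (v ∘ φ ∘ to)         ≡⟨ Σ-allFin≡sum n _ ⟩
    sum (v ∘ φ ∘ to)                  ≡⟨ sum-cong-≗ (λ i → cong v (sym (to∘from (φ (to i))))) ⟩
    sum (v ∘ to ∘ π⃗)                  ≡⟨ sum-permute (v ∘ to) π ⟨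
    sum (v ∘ to)                      ≡⟨ Σ-allFin≡sum n _ ⟨
    Σ (allFin n) (v ∘ to)             ≡⟨ Σ-map to (allFin n) _ ⟨
    Σ (map to (allFin n)) v           ∎
    where
    π⃗ π⃖ : Fin n → Fin n
    π⃗ i = from (φ (to i))
    π⃖ i = from (ψ (to i))
    π : Permutation n n
    π = permutation π⃗ π⃖
      (λ i → trans (cong (from ∘ φ) (to∘from (ψ (to i)))) (trans (cong from (φ∘ψ (to i))) (from∘to i)))
      (λ i → trans (cong (from ∘ ψ) (to∘from (φ (to i)))) (trans (cong from (ψ∘φ (to i))) (from∘to i)))

  Σ-applyUpTo : (f : ℕ → ℕ) (m : ℕ) (v : ℕ → C) → Σ (applyUpTo f m) v ≡ Σ (upTo m) (v ∘ f)
  Σ-applyUpTo f zero    v = refl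
  Σ-applyUpTo f (suc m) v =
    cong (v (f 0) ∙_) (trans (Σ-applyUpTo (f ∘ suc) m v) (sym (Σ-applyUpTo suc m (v ∘ f))))

  Σ-upTo-suc : (m : ℕ) (v : ℕ → C) → Σ (upTo (suc m)) v ≡ v 0 ∙ Σ (upTo m) (v ∘ suc)
  Σ-upTo-suc m v = cong (v 0 ∙_) (Σ-applyUpTo suc m v)

  Σ-upTo-∷ʳ : (m : ℕ) (v : ℕ → C) → Σ (upTo (suc m)) v ≡ Σ (upTo m) v ∙ v m
  Σ-upTo-∷ʳ m v = begin
    Σ (upTo (suc m)) v          ≡⟨ cong (λ l → Σ l v) (ListP.upTo-∷ʳ m) ⟨
    Σ (upTo m ++ [ m ]) v       ≡⟨ Σ-++ (upTo m) [ m ] v ⟩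
    Σ (upTo m) v ∙ (v m ∙ ε)    ≡⟨ cong (Σ (upTo m) v ∙_) (identityʳ (v m)) ⟩
    Σ (upTo m) v ∙ v m          ∎

  Σ-allFin-toℕ : (n : ℕ) (v : ℕ → C) → Σ (allFin n) (v ∘ toℕ) ≡ Σ (upTo n) v
  Σ-allFin-toℕ zero    v = refl
  Σ-allFin-toℕ (suc n) v = cong (v 0 ∙_)
    (trans (Σ-tabulate n suc (v ∘ toℕ)) (trans (Σ-allFin-toℕ n (v ∘ suc)) (sym (Σ-applyUpTo suc n v))))

  Σ-upTo-+ : (a b : ℕ) (v : ℕ → C) → Σ (upTo (a ℕ.+ b)) v ≡ Σ (upTo a) v ∙ Σ (upTo b) (λ x → v (a ℕ.+ x))
  Σ-upTo-+ a zero    v = trans (cong (λ t → Σ (upTo t) v) (ℕP.+-identityʳ a)) (sym (identityʳ _))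
  Σ-upTo-+ a (suc b) v = begin
    Σ (upTo (a ℕ.+ suc b)) v                                      ≡⟨ cong (λ t → Σ (upTo t) v) (ℕP.+-suc a b) ⟩
    Σ (upTo (suc (a ℕ.+ b))) v                                    ≡⟨ Σ-upTo-∷ʳ (a ℕ.+ b) v ⟩
    Σ (upTo (a ℕ.+ b)) v ∙ v (a ℕ.+ b)                            ≡⟨ cong (_∙ v (a ℕ.+ b)) (Σ-upTo-+ a b v) ⟩
    (Σ (upTo a) v ∙ Σ (upTo b) (λ x → v (a ℕ.+ x))) ∙ v (a ℕ.+ b) ≡⟨ assoc _ _ _ ⟩
    Σ (upTo a) v ∙ (Σ (upTo b) (λ x → v (a ℕ.+ x)) ∙ v (a ℕ.+ b))
                                                                  ≡⟨ cong (Σ (upTo a) v ∙_) (Σ-upTo-∷ʳ b (λ x → v (a ℕ.+ x))) ⟨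
    Σ (upTo a) v ∙ Σ (upTo (suc b)) (λ x → v (a ℕ.+ x))           ∎

  Σ-upTo-* : (p r : ℕ) (v : ℕ → C) → Σ (upTo (p ℕ.* r)) v ≡ Σ (upTo p) (λ j → Σ (upTo r) (λ b → v (j ℕ.* r ℕ.+ b)))
  Σ-upTo-* zero    r v = refl
  Σ-upTo-* (suc p) r v = begin
    Σ (upTo (r ℕ.+ p ℕ.* r)) v
      ≡⟨ Σ-upTo-+ r (p ℕ.* r) v ⟩
    Σ (upTo r) v ∙ Σ (upTo (p ℕ.* r)) (λ x → v (r ℕ.+ x))
      ≡⟨ cong (Σ (upTo r) v ∙_) (Σ-upTo-* p r (λ x → v (r ℕ.+ x))) ⟩
    Σ (upTo r) v ∙ Σ (upTo p) (λ j → Σ (upTo r) (λ b → v (r ℕ.+ (j ℕ.* r ℕ.+ b))))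
      ≡⟨ cong (Σ (upTo r) v ∙_) (Σ-cong (upTo p) (λ j → Σ-cong (upTo r) (λ b → cong v (sym (ℕP.+-assoc r (j ℕ.* r) b))))) ⟩
    Σ (upTo r) v ∙ Σ (upTo p) (λ j → Σ (upTo r) (λ b → v (suc j ℕ.* r ℕ.+ b)))
      ≡⟨ Σ-upTo-suc p _ ⟨
    Σ (upTo (suc p)) (λ j → Σ (upTo r) (λ b → v (j ℕ.* r ℕ.+ b))) ∎

module ℤΣ = ListSum ℤP.+-0-isCommutativeMonoid
module ℕΣ = ListSum ℕP.+-0-isCommutativeMonoid

indicator : Bool → ℕ
indicator b = if b then 1 else 0

count≡Σ-indicator : ∀ {A : Set} (p : A → Bool) (l : List A) → count p l ≡ ℕΣ.Σ l (λ x → indicator (p x))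
count≡Σ-indicator p []      = refl
count≡Σ-indicator p (x ∷ l) with p x
... | true  = cong suc (count≡Σ-indicator p l)
... | false = count≡Σ-indicator p l

count-none : ∀ {A : Set} (p : A → Bool) (l : List A) → (∀ x → p x ≡ false) → count p l ≡ 0
count-none p []      none = refl
count-none p (x ∷ l) none rewrite none x = count-none p l none

ℕΣ-const : ∀ {A : Set} (l : List A) c → ℕΣ.Σ l (λ _ → c) ≡ length l ℕ.* c
ℕΣ-const []      c = refl
ℕΣ-const (x ∷ l) c = cong (c ℕ.+_) (ℕΣ-const l c)

length≡Σ1 : ∀ {A : Set} (l : List A) → length l ≡ ℕΣ.Σ l (λ _ → 1)
length≡Σ1 l = trans (sym (ℕP.*-identityʳ (length l))) (sym (ℕΣ-const l 1))

a+n*a≡[1+n]*a : ∀ n a → a +ℤ + n *ℤ a ≡ + suc n *ℤ a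
a+n*a≡[1+n]*a n a = sym (trans (ℤP.*-distribʳ-+ a (+ 1) (+ n)) (cong (_+ℤ (+ n *ℤ a)) (ℤP.*-identityˡ a)))

ℤΣ-const : ∀ {A : Set} (l : List A) (a : ℤ) → ℤΣ.Σ l (λ _ → a) ≡ + length l *ℤ a
ℤΣ-const []      a = refl
ℤΣ-const (x ∷ l) a = trans (cong (a +ℤ_) (ℤΣ-const l a)) (a+n*a≡[1+n]*a (length l) a)

ℤΣ-indicator : ∀ {A : Set} (l : List A) (p : A → Bool) (a : ℤ) → ℤΣ.Σ l (λ y → if p y then a else + 0) ≡ + count p l *ℤ a
ℤΣ-indicator []      p a = refl
ℤΣ-indicator (x ∷ l) p a with p x
... | true  = trans (cong (a +ℤ_) (ℤΣ-indicator l p a)) (a+n*a≡[1+n]*a (count p l) a)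
... | false = trans (ℤP.+-identityˡ _) (ℤΣ-indicator l p a)

ℤΣ-neg : ∀ {A : Set} (l : List A) (v : A → ℤ) → ℤΣ.Σ l (λ x → -ℤ v x) ≡ -ℤ ℤΣ.Σ l v
ℤΣ-neg l v = sym (ℤΣ.Σ-homomorphism -ℤ_ ℤP.neg-distrib-+ refl l v)

ℤΣ-*ˡ : ∀ {A : Set} (l : List A) (v : A → ℤ) c → ℤΣ.Σ l (λ x → c *ℤ v x) ≡ c *ℤ ℤΣ.Σ l v
ℤΣ-*ˡ l v c = sym (ℤΣ.Σ-homomorphism (c *ℤ_) (ℤP.*-distribˡ-+ c) (ℤP.*-zeroʳ c) l v)

ℤΣ-*ʳ : ∀ {A : Set} (l : List A) (v : A → ℤ) c → ℤΣ.Σ l (λ x → v x *ℤ c) ≡ ℤΣ.Σ l v *ℤ c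
ℤΣ-*ʳ l v c = sym (ℤΣ.Σ-homomorphism (_*ℤ c) (λ a b → ℤP.*-distribʳ-+ c a b) (ℤP.*-zeroˡ c) l v)

does-≟-sym : ∀ {A : Set} (_≟_ : DecidableEquality A) (a b : A) → does (a ≟ b) ≡ does (b ≟ a)
does-≟-sym _≟_ a b with a ≟ b | b ≟ a
... | yes _   | yes _   = refl
... | no _    | no _    = refl
... | yes a≡b | no b≢a  = contradiction (sym a≡b) b≢a
... | no a≢b  | yes b≡a = contradiction (sym b≡a) a≢b

fibre : ∀ {A : Set} {K : ℕ} → List A → (A → Fin K) → Fin K → ℕ
fibre l g b = count (λ y → does (g y FinP.≟ b)) l

fibre-∷ : ∀ {A : Set} {K : ℕ} x (l : List A) (g : A → Fin K) b →
          fibre (x ∷ l) g b ≡ indicator (does (b FinP.≟ g x)) ℕ.+ fibre l g b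
fibre-∷ x l g b rewrite does-≟-sym FinP._≟_ b (g x) with does (g x FinP.≟ b)
... | true  = refl
... | false = refl

ℤΣ-fibres : ∀ {A : Set} {K : ℕ} (l : List A) (g : A → Fin K) (h : Fin K → ℤ) →
            ℤΣ.Σ l (λ y → h (g y)) ≡ ℤΣ.Σ (allFin K) (λ b → + fibre l g b *ℤ h b)
ℤΣ-fibres {K = K} []      g h = sym (trans (ℤΣ.Σ-cong (allFin K) (λ b → ℤP.*-zeroˡ (h b))) (ℤΣ.Σ-ε (allFin K)))
ℤΣ-fibres {K = K} (x ∷ l) g h = begin
  h (g x) +ℤ ℤΣ.Σ l (λ y → h (g y))
    ≡⟨ cong₂ _+ℤ_ (sym (ℤΣ.Σ-select FinP._≟_ (allFin K) (g x) h (UniqueP.allFin⁺ K) (∈P.∈-allFin (g x)))) (ℤΣ-fibres l g h) ⟩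
  ℤΣ.Σ (allFin K) (λ b → if does (b FinP.≟ g x) then h b else + 0) +ℤ ℤΣ.Σ (allFin K) (λ b → + fibre l g b *ℤ h b)
    ≡⟨ ℤΣ.Σ-distrib (allFin K) _ _ ⟨
  ℤΣ.Σ (allFin K) (λ b → (if does (b FinP.≟ g x) then h b else + 0) +ℤ + fibre l g b *ℤ h b)
    ≡⟨ ℤΣ.Σ-cong (allFin K) (λ b → trans (add-fibre b) (cong (λ m → + m *ℤ h b) (sym (fibre-∷ x l g b)))) ⟩
  ℤΣ.Σ (allFin K) (λ b → + fibre (x ∷ l) g b *ℤ h b)
    ∎
  where
  open ≡-Reasoning
  add-fibre : ∀ b → (if does (b FinP.≟ g x) then h b else + 0) +ℤ + fibre l g b *ℤ h b
                  ≡ + (indicator (does (b FinP.≟ g x)) ℕ.+ fibre l g b) *ℤ h b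
  add-fibre b with does (b FinP.≟ g x)
  ... | true  = a+n*a≡[1+n]*a (fibre l g b) (h b)
  ... | false = ℤP.+-identityˡ _

Σ-fibre-sizes : ∀ {A : Set} {K : ℕ} (l : List A) (g : A → Fin K) → ℕΣ.Σ (allFin K) (fibre l g) ≡ length l
Σ-fibre-sizes {K = K} []      g = ℕΣ.Σ-ε (allFin K)
Σ-fibre-sizes {K = K} (x ∷ l) g = begin
  ℕΣ.Σ (allFin K) (fibre (x ∷ l) g)
    ≡⟨ ℕΣ.Σ-cong (allFin K) (fibre-∷ x l g) ⟩
  ℕΣ.Σ (allFin K) (λ b → indicator (does (b FinP.≟ g x)) ℕ.+ fibre l g b)
    ≡⟨ ℕΣ.Σ-distrib (allFin K) _ _ ⟩
  ℕΣ.Σ (allFin K) (λ b → if does (b FinP.≟ g x) then 1 else 0) ℕ.+ ℕΣ.Σ (allFin K) (fibre l g)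
    ≡⟨ cong₂ ℕ._+_ (ℕΣ.Σ-select FinP._≟_ (allFin K) (g x) (λ _ → 1) (UniqueP.allFin⁺ K) (∈P.∈-allFin (g x))) (Σ-fibre-sizes l g) ⟩
  suc (length l)
    ∎
  where open ≡-Reasoning

x≡-x⇒x≡0 : ∀ (x : ℤ) → x ≡ -ℤ x → x ≡ + 0
x≡-x⇒x≡0 (+ zero)     _ = refl
x≡-x⇒x≡0 (+ suc _)    ()
x≡-x⇒x≡0 (ℤ.-[1+ _ ]) ()

≡ᵇ-refl : ∀ r → (r ℕ.≡ᵇ r) ≡ true
≡ᵇ-refl zero    = refl
≡ᵇ-refl (suc r) = ≡ᵇ-refl r

≡ᵇ-≢ : ∀ r x → r ≢ x → (r ℕ.≡ᵇ x) ≡ false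
≡ᵇ-≢ zero    zero    0≢0 = ⊥-elim (0≢0 refl)
≡ᵇ-≢ zero    (suc x) _   = refl
≡ᵇ-≢ (suc r) zero    _   = refl
≡ᵇ-≢ (suc r) (suc x) r≢x = ≡ᵇ-≢ r x (r≢x ∘ cong suc)

parity : ∀ c → c % 2 ≡ 0 ⊎ c % 2 ≡ 1
parity c with c % 2 | m%n<n c 2
... | 0           | _ = inj₁ refl
... | 1           | _ = inj₂ refl
... | suc (suc _) | s≤s (s≤s ())

2-adic-decomposition : ∀ c → 0 < c → Σ[ s ∈ ℕ ] Σ[ o ∈ ℕ ] c ≡ 2 ^ s ℕ.* (2 ℕ.* o ℕ.+ 1)
2-adic-decomposition = <-rec _ decompose
  where
  odd : ∀ h → 1 ℕ.+ h ℕ.* 2 ≡ 1 ℕ.* (2 ℕ.* h ℕ.+ 1)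
  odd = solve-∀
  double : ∀ p o → p ℕ.* (2 ℕ.* o ℕ.+ 1) ℕ.* 2 ≡ (2 ℕ.* p) ℕ.* (2 ℕ.* o ℕ.+ 1)
  double = solve-∀
  half-positive : ∀ c h → c ≡ 0 ℕ.+ h ℕ.* 2 → 0 < c → 0 < h
  half-positive c zero    c≡0 0<c = ⊥-elim (ℕP.<-irrefl (sym c≡0) 0<c)
  half-positive c (suc h) _   _   = s≤s z≤n
  decompose : ∀ c → WfRec _<_ (λ c → 0 < c → Σ[ s ∈ ℕ ] Σ[ o ∈ ℕ ] c ≡ 2 ^ s ℕ.* (2 ℕ.* o ℕ.+ 1)) c →
              0 < c → Σ[ s ∈ ℕ ] Σ[ o ∈ ℕ ] c ≡ 2 ^ s ℕ.* (2 ℕ.* o ℕ.+ 1)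
  decompose c rec 0<c with c % 2 | m%n<n c 2 | m≡m%n+[m/n]*n c 2
  ... | 1 | _ | c≡1+h*2 = 0 , c / 2 , trans c≡1+h*2 (odd (c / 2))
  ... | 0 | _ | c≡h*2 with rec (m/n<m c 2 {{ℕ.>-nonZero 0<c}} (s≤s (s≤s z≤n))) (half-positive c (c / 2) c≡h*2 0<c)
  ...   | s , o , h≡ = suc s , o , trans c≡h*2 (trans (cong (ℕ._* 2) h≡) (double (2 ^ s) o))
  decompose c rec 0<c | suc (suc _) | s≤s (s≤s ()) | _

open CommutativeSemigroupProperties ℕP.+-commutativeSemigroup using () renaming (x∙yz≈y∙xz to +-left-swap)

module Congruence (d : ℕ) .{{_ : NonZero d}} where
  infix 4 _≡ₘ_
  _≡ₘ_ : ℕ → ℕ → Set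
  a ≡ₘ b = a % d ≡ b % d

  ≡⇒≡ₘ : ∀ {a b} → a ≡ b → a ≡ₘ b
  ≡⇒≡ₘ refl = refl

  transₘ : ∀ {a b c} → a ≡ₘ b → b ≡ₘ c → a ≡ₘ c
  transₘ = trans

  symₘ : ∀ {a b} → a ≡ₘ b → b ≡ₘ a
  symₘ = sym

  +-congₘ : ∀ {a a′ b b′} → a ≡ₘ a′ → b ≡ₘ b′ → a ℕ.+ b ≡ₘ a′ ℕ.+ b′
  +-congₘ {a} {a′} {b} {b′} a≡a′ b≡b′ =
    trans (%-distribˡ-+ a b d) (trans (cong₂ (λ x y → (x ℕ.+ y) % d) a≡a′ b≡b′) (sym (%-distribˡ-+ a′ b′ d)))

  *-congˡₘ : ∀ c {a a′} → a ≡ₘ a′ → c ℕ.* a ≡ₘ c ℕ.* a′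
  *-congˡₘ c {a} {a′} a≡a′ =
    trans (%-distribˡ-* c a d) (trans (cong (λ x → ((c % d) ℕ.* x) % d) a≡a′) (sym (%-distribˡ-* c a′ d)))

  +-multipleₘ : ∀ a k → a ℕ.+ k ℕ.* d ≡ₘ a
  +-multipleₘ a k = [m+kn]%n≡m%n a k d

  %-≡ₘ : ∀ a → a % d ≡ₘ a
  %-≡ₘ a = m%n%n≡m%n a d

  inverseₘ-unique : ∀ a b i → a ℕ.+ i ≡ₘ 0 → b ℕ.+ i ≡ₘ 0 → a ≡ₘ b
  inverseₘ-unique a b i a+i≡0 b+i≡0 = begin
    a % d                    ≡⟨ cong (_% d) (ℕP.+-identityʳ a) ⟨
    (a ℕ.+ 0) % d            ≡⟨ +-congₘ {a} {a} refl b+i≡0 ⟨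
    (a ℕ.+ (b ℕ.+ i)) % d    ≡⟨ cong (_% d) (+-left-swap a b i) ⟩
    (b ℕ.+ (a ℕ.+ i)) % d    ≡⟨ +-congₘ {b} {b} refl a+i≡0 ⟩
    (b ℕ.+ 0) % d            ≡⟨ cong (_% d) (ℕP.+-identityʳ b) ⟩
    b % d                    ∎
    where open ≡-Reasoning

module FiniteField {n : ℕ} (𝔽 : GF n) where
  open GF 𝔽 public
  open IsCommutativeRing isCommutativeRing public
    using (+-assoc; +-comm; +-identityˡ; +-identityʳ; -‿inverseˡ; -‿inverseʳ;
           *-assoc; *-comm; *-identityˡ; *-identityʳ; distribˡ; distribʳ; zeroˡ; zeroʳ;
           +-isCommutativeMonoid; *-isCommutativeMonoid)
  open ≡-Reasoning

  commutativeRing : CommutativeRing 0ℓ 0ℓ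
  commutativeRing = record { isCommutativeRing = isCommutativeRing }

  open CommutativeRing commutativeRing using (ring; semiring; commutativeSemiring)
  open RingProperties ring public using (+-cancelˡ)
  open SemiringMult semiring using (×1-homo-*) renaming (_×_ to _×ᶠ_)
  open SemiringExp semiring public using () renaming (_^_ to _^ᶠ_)
  open SemiringExp semiring using (^-homo-*)
  open NaturalCoefficientsSolver commutativeSemiring public using (solve; _:=_; _:+_; _:*_)

  module FΣ = ListSum +-isCommutativeMonoid
  module FΠ = ListSum *-isCommutativeMonoid

  q : ℕ
  q = 2 ^ n

  to : Fin q → F
  to = Bijection.to enum

  from : F → Fin q
  from x = proj₁ (Bijection.surjective enum x)

  to∘from : ∀ x → to (from x) ≡ x
  to∘from x = proj₂ (Bijection.surjective enum x) refl

  from∘to : ∀ i → from (to i) ≡ i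
  from∘to i = Bijection.injective enum (to∘from (to i))

  elems-unique : Unique elems
  elems-unique = UniqueP.map⁺ (Bijection.injective enum) (UniqueP.allFin⁺ q)

  ∈-elems : ∀ x → x ∈ elems
  ∈-elems x = subst (_∈ elems) (to∘from x) (∈P.∈-map⁺ to (∈P.∈-allFin (from x)))

  length-elems : length elems ≡ q
  length-elems = trans (ListP.length-map to (allFin q)) (ListP.length-tabulate {n = q} (λ i → i))

  module ElemsSum {C : Set} {_∙_ : Op₂ C} {ε : C} (isCM : IsCommutativeMonoid _≡_ _∙_ ε) where
    open ListSum isCM

    Σ-elems-bijection : (φ ψ : F → F) → (∀ x → ψ (φ x) ≡ x) → (∀ x → φ (ψ x) ≡ x) →
                        (v : F → C) → Σ elems (v ∘ φ) ≡ Σ elems v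
    Σ-elems-bijection = Σ-reindex q to from from∘to to∘from

    Σ-elems-translate : ∀ a (v : F → C) → Σ elems (λ x → v (x + a)) ≡ Σ elems v
    Σ-elems-translate a = Σ-elems-bijection (_+ a) (_+ - a)
      (λ x → trans (+-assoc _ _ _) (trans (cong (_+_ x) (-‿inverseʳ a)) (+-identityʳ x)))
      (λ x → trans (+-assoc _ _ _) (trans (cong (_+_ x) (-‿inverseˡ a)) (+-identityʳ x)))

  *-cancelˡ-≢0 : ∀ a b c → a ≢ 0# → a * b ≡ a * c → b ≡ c
  *-cancelˡ-≢0 a b c a≢0 ab≡ac = begin
    b              ≡⟨ *-identityˡ b ⟨
    1# * b         ≡⟨ cong (_* b) a⁻¹a≡1 ⟨
    (a⁻¹ * a) * b  ≡⟨ *-assoc _ _ _ ⟩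
    a⁻¹ * (a * b)  ≡⟨ cong (a⁻¹ *_) ab≡ac ⟩
    a⁻¹ * (a * c)  ≡⟨ *-assoc _ _ _ ⟨
    (a⁻¹ * a) * c  ≡⟨ cong (_* c) a⁻¹a≡1 ⟩
    1# * c         ≡⟨ *-identityˡ c ⟩
    c              ∎
    where
    a⁻¹ : F
    a⁻¹ = proj₁ (inverse a a≢0)
    a⁻¹a≡1 : a⁻¹ * a ≡ 1#
    a⁻¹a≡1 = trans (*-comm a⁻¹ a) (proj₂ (inverse a a≢0))

  *-zero-divisor : ∀ a b → a * b ≡ 0# → a ≡ 0# ⊎ b ≡ 0#
  *-zero-divisor a b ab≡0 with a ≟ 0#
  ... | yes a≡0 = inj₁ a≡0
  ... | no a≢0  = inj₂ (*-cancelˡ-≢0 a b 0# a≢0 (trans ab≡0 (sym (zeroʳ a))))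

  *-≢0 : ∀ a b → a ≢ 0# → b ≢ 0# → a * b ≢ 0#
  *-≢0 a b a≢0 b≢0 ab≡0 with *-zero-divisor a b ab≡0
  ... | inj₁ a≡0 = a≢0 a≡0
  ... | inj₂ b≡0 = b≢0 b≡0

  ^ᶠ-≡0 : ∀ t m → t ^ᶠ m ≡ 0# → t ≡ 0#
  ^ᶠ-≡0 t zero    1≡0 = ⊥-elim (0≢1 (sym 1≡0))
  ^ᶠ-≡0 t (suc m) e with *-zero-divisor t (t ^ᶠ m) e
  ... | inj₁ t≡0  = t≡0
  ... | inj₂ tᵐ≡0 = ^ᶠ-≡0 t m tᵐ≡0

  Σ-const : ∀ {A : Set} (l : List A) x → FΣ.Σ l (λ _ → x) ≡ length l ×ᶠ x
  Σ-const []      x = refl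
  Σ-const (y ∷ l) x = cong (_+_ x) (Σ-const l x)

  2^m×1≡[1+1]^m : ∀ m → (2 ^ m) ×ᶠ 1# ≡ (1# + 1#) ^ᶠ m
  2^m×1≡[1+1]^m zero    = +-identityʳ 1#
  2^m×1≡[1+1]^m (suc m) = begin
    (2 ℕ.* 2 ^ m) ×ᶠ 1#           ≡⟨ ×1-homo-* 2 (2 ^ m) ⟩
    (2 ×ᶠ 1#) * ((2 ^ m) ×ᶠ 1#)   ≡⟨ cong₂ _*_ (cong (_+_ 1#) (+-identityʳ 1#)) (2^m×1≡[1+1]^m m) ⟩
    (1# + 1#) ^ᶠ suc m            ∎

  -- Translation by 1 permutes F, so q · 1 = Σₓ ((x + 1) - x) = 0, i.e. (1 + 1)ⁿ = 0.
  characteristic-2 : 1# + 1# ≡ 0#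
  characteristic-2 = ^ᶠ-≡0 (1# + 1#) n (begin
    (1# + 1#) ^ᶠ n               ≡⟨ 2^m×1≡[1+1]^m n ⟨
    q ×ᶠ 1#                      ≡⟨ cong (_×ᶠ 1#) length-elems ⟨
    length elems ×ᶠ 1#           ≡⟨ Σ-const elems 1# ⟨
    FΣ.Σ elems (λ _ → 1#)        ≡⟨ +-cancelˡ (FΣ.Σ elems (λ x → x)) _ _ Σx+Σ1≡Σx+0 ⟩
    0#                           ∎)
    where
    Σx+Σ1≡Σx+0 : FΣ.Σ elems (λ x → x) + FΣ.Σ elems (λ _ → 1#) ≡ FΣ.Σ elems (λ x → x) + 0#
    Σx+Σ1≡Σx+0 = begin
      FΣ.Σ elems (λ x → x) + FΣ.Σ elems (λ _ → 1#)  ≡⟨ FΣ.Σ-distrib elems (λ x → x) (λ _ → 1#) ⟨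
      FΣ.Σ elems (λ x → x + 1#)                      ≡⟨ ElemsSum.Σ-elems-translate +-isCommutativeMonoid 1# (λ x → x) ⟩
      FΣ.Σ elems (λ x → x)                           ≡⟨ +-identityʳ _ ⟨
      FΣ.Σ elems (λ x → x) + 0#                      ∎

  x+x≡0 : ∀ x → x + x ≡ 0#
  x+x≡0 x = begin
    x + x                ≡⟨ cong₂ _+_ (*-identityʳ x) (*-identityʳ x) ⟨
    x * 1# + x * 1#      ≡⟨ distribˡ x 1# 1# ⟨
    x * (1# + 1#)        ≡⟨ cong (x *_) characteristic-2 ⟩
    x * 0#               ≡⟨ zeroʳ x ⟩
    0#                   ∎

  -x≡x : ∀ x → - x ≡ x
  -x≡x x = +-cancelˡ x (- x) x (trans (-‿inverseʳ x) (sym (x+x≡0 x)))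

  x+y≡0⇒x≡y : ∀ x y → x + y ≡ 0# → x ≡ y
  x+y≡0⇒x≡y x y x+y≡0 = +-cancelˡ y x y (trans (+-comm y x) (trans x+y≡0 (sym (x+x≡0 y))))

  [x+a]+a≡x : ∀ a x → (x + a) + a ≡ x
  [x+a]+a≡x a x = trans (+-assoc x a a) (trans (cong (_+_ x) (x+x≡0 a)) (+-identityʳ x))

  x+[x+z]≡z : ∀ x z → x + (x + z) ≡ z
  x+[x+z]≡z x z = trans (sym (+-assoc x x z)) (trans (cong (_+ z) (x+x≡0 x)) (+-identityˡ z))

  private
    nonzeroPart : F → F
    nonzeroPart x = if does (x ≟ 0#) then 1# else x

    nonzeroPart-≢0 : ∀ x → nonzeroPart x ≢ 0#
    nonzeroPart-≢0 x with x ≟ 0#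
    ... | yes _   = λ 1≡0 → 0≢1 (sym 1≡0)
    ... | no x≢0  = x≢0

  FΠ-const : ∀ {A : Set} (l : List A) x → FΠ.Σ l (λ _ → x) ≡ x ^ᶠ length l
  FΠ-const []      x = refl
  FΠ-const (y ∷ l) x = cong (x *_) (FΠ-const l x)

  FΠ-≢0 : ∀ {A : Set} (l : List A) (v : A → F) → (∀ x → v x ≢ 0#) → FΠ.Σ l v ≢ 0#
  FΠ-≢0 []      v v≢0 = λ 1≡0 → 0≢1 (sym 1≡0)
  FΠ-≢0 (x ∷ l) v v≢0 = *-≢0 _ _ (v≢0 x) (FΠ-≢0 l v v≢0)

  -- x ↦ a x permutes F ∖ {0}, so a^(q-1) · Π_{x≠0} x = Π_{x≠0} (a x) = Π_{x≠0} x.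
  fermat-≢0 : ∀ a → a ≢ 0# → a ^ᶠ q ≡ a
  fermat-≢0 a a≢0 = begin
    a ^ᶠ q                 ≡⟨ cong (a ^ᶠ_) length-elems ⟨
    a ^ᶠ length elems      ≡⟨ FΠ-const elems a ⟨
    FΠ.Σ elems (λ _ → a)   ≡⟨ FΠ.Σ-isolate _≟_ elems 0# (λ _ → a) elems-unique (∈-elems 0#) ⟩
    a * FΠ.Σ elems h       ≡⟨ cong (a *_) Πh≡1 ⟩
    a * 1#                 ≡⟨ *-identityʳ a ⟩
    a                      ∎
    where
    h : F → F
    h x = if does (x ≟ 0#) then 1# else a
    a⁻¹ : F
    a⁻¹ = proj₁ (inverse a a≢0)
    aa⁻¹≡1 : a * a⁻¹ ≡ 1#
    aa⁻¹≡1 = proj₂ (inverse a a≢0)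
    nonzeroPart-a* : ∀ x → nonzeroPart (a * x) ≡ h x * nonzeroPart x
    nonzeroPart-a* x with x ≟ 0# | (a * x) ≟ 0#
    ... | yes refl | yes _     = sym (*-identityˡ 1#)
    ... | yes refl | no a0≢0   = contradiction (zeroʳ a) a0≢0
    ... | no x≢0   | yes ax≡0  = contradiction ax≡0 (*-≢0 a x a≢0 x≢0)
    ... | no _     | no _      = refl
    Π-a* : FΠ.Σ elems (λ x → nonzeroPart (a * x)) ≡ FΠ.Σ elems nonzeroPart
    Π-a* = ElemsSum.Σ-elems-bijection *-isCommutativeMonoid (a *_) (a⁻¹ *_)
      (λ x → trans (sym (*-assoc _ _ _)) (trans (cong (_* x) (trans (*-comm a⁻¹ a) aa⁻¹≡1)) (*-identityˡ x)))
      (λ x → trans (sym (*-assoc _ _ _)) (trans (cong (_* x) aa⁻¹≡1) (*-identityˡ x)))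
      nonzeroPart
    Πh≡1 : FΠ.Σ elems h ≡ 1#
    Πh≡1 = *-cancelˡ-≢0 (FΠ.Σ elems nonzeroPart) _ _ (FΠ-≢0 elems nonzeroPart nonzeroPart-≢0) (begin
      FΠ.Σ elems nonzeroPart * FΠ.Σ elems h         ≡⟨ *-comm _ _ ⟩
      FΠ.Σ elems h * FΠ.Σ elems nonzeroPart         ≡⟨ FΠ.Σ-distrib elems h nonzeroPart ⟨
      FΠ.Σ elems (λ x → h x * nonzeroPart x)        ≡⟨ FΠ.Σ-cong elems nonzeroPart-a* ⟨
      FΠ.Σ elems (λ x → nonzeroPart (a * x))        ≡⟨ Π-a* ⟩
      FΠ.Σ elems nonzeroPart                        ≡⟨ *-identityʳ _ ⟨
      FΠ.Σ elems nonzeroPart * 1#                   ∎)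

  fermat : ∀ a → a ^ᶠ q ≡ a
  fermat a with a ≟ 0#
  ... | no a≢0   = fermat-≢0 a a≢0
  ... | yes refl = trans (cong (0# ^ᶠ_) (sym (ℕP.suc-pred q {{ℕP.m^n≢0 2 n}}))) (zeroˡ _)

  square : F → F
  square x = x * x

  square-+ : ∀ a b → square (a + b) ≡ square a + square b
  square-+ a b = begin
    (a + b) * (a + b)                       ≡⟨ solve 2 (λ a b → (a :+ b) :* (a :+ b) := a :* a :+ (a :* b :+ a :* b) :+ b :* b) refl a b ⟩
    a * a + (a * b + a * b) + b * b         ≡⟨ cong (λ t → a * a + t + b * b) (x+x≡0 (a * b)) ⟩
    a * a + 0# + b * b                      ≡⟨ cong (_+ b * b) (+-identityʳ (a * a)) ⟩
    a * a + b * b                           ∎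

  square-* : ∀ a b → square (a * b) ≡ square a * square b
  square-* = solve 2 (λ a b → (a :* b) :* (a :* b) := (a :* a) :* (b :* b)) refl

  square-0 : square 0# ≡ 0#
  square-0 = zeroˡ 0#

  frob-+ : ∀ i a b → frob i (a + b) ≡ frob i a + frob i b
  frob-+ zero    a b = refl
  frob-+ (suc i) a b = trans (cong square (frob-+ i a b)) (square-+ _ _)

  frob-* : ∀ i a b → frob i (a * b) ≡ frob i a * frob i b
  frob-* zero    a b = refl
  frob-* (suc i) a b = trans (cong square (frob-* i a b)) (square-* _ _)

  frob-0 : ∀ i → frob i 0# ≡ 0#
  frob-0 zero    = refl
  frob-0 (suc i) = trans (cong square (frob-0 i)) square-0

  frob≡^ᶠ : ∀ i x → frob i x ≡ x ^ᶠ (2 ^ i)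
  frob≡^ᶠ zero    x = sym (*-identityʳ x)
  frob≡^ᶠ (suc i) x = begin
    frob i x * frob i x                 ≡⟨ cong₂ _*_ (frob≡^ᶠ i x) (frob≡^ᶠ i x) ⟩
    x ^ᶠ (2 ^ i) * x ^ᶠ (2 ^ i)         ≡⟨ ^-homo-* x (2 ^ i) (2 ^ i) ⟨
    x ^ᶠ (2 ^ i ℕ.+ 2 ^ i)              ≡⟨ cong (λ t → x ^ᶠ (2 ^ i ℕ.+ t)) (ℕP.+-identityʳ (2 ^ i)) ⟨
    x ^ᶠ (2 ^ suc i)                    ∎

  frob-n : ∀ x → frob n x ≡ x
  frob-n x = trans (frob≡^ᶠ n x) (fermat x)

  TrF≡Σ : ∀ x → TrF x ≡ FΣ.Σ (upTo n) (λ i → frob i x)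
  TrF≡Σ x = FΣ.Σ-foldr (upTo n) (λ i → frob i x)

  TrF-+ : ∀ a b → TrF (a + b) ≡ TrF a + TrF b
  TrF-+ a b = begin
    TrF (a + b)                                        ≡⟨ TrF≡Σ _ ⟩
    FΣ.Σ (upTo n) (λ i → frob i (a + b))               ≡⟨ FΣ.Σ-cong (upTo n) (λ i → frob-+ i a b) ⟩
    FΣ.Σ (upTo n) (λ i → frob i a + frob i b)          ≡⟨ FΣ.Σ-distrib (upTo n) _ _ ⟩
    FΣ.Σ (upTo n) (λ i → frob i a) + FΣ.Σ (upTo n) (λ i → frob i b)
                                                       ≡⟨ cong₂ _+_ (TrF≡Σ a) (TrF≡Σ b) ⟨
    TrF a + TrF b                                      ∎

  TrF-0 : TrF 0# ≡ 0#
  TrF-0 = trans (TrF≡Σ 0#) (trans (FΣ.Σ-cong (upTo n) frob-0) (FΣ.Σ-ε (upTo n)))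

  -- Squaring shifts the Frobenius orbit x, x², …, x^(2^(n-1)) by one, and x^(2^n) = x.
  square-TrF : ∀ x → square (TrF x) ≡ TrF x
  square-TrF x = +-cancelˡ x _ _ (begin
    x + square (TrF x)                            ≡⟨ cong (λ t → x + square t) (TrF≡Σ x) ⟩
    x + square (FΣ.Σ (upTo n) a)                  ≡⟨ cong (_+_ x) (FΣ.Σ-homomorphism square square-+ square-0 (upTo n) a) ⟩
    x + FΣ.Σ (upTo n) (a ∘ suc)                   ≡⟨ FΣ.Σ-upTo-suc n a ⟨
    FΣ.Σ (upTo (suc n)) a                         ≡⟨ FΣ.Σ-upTo-∷ʳ n a ⟩
    FΣ.Σ (upTo n) a + frob n x                    ≡⟨ cong₂ _+_ (TrF≡Σ x) (sym (frob-n x)) ⟨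
    TrF x + x                                     ≡⟨ +-comm _ _ ⟩
    x + TrF x                                     ∎)
    where
    a : ℕ → F
    a i = frob i x

  IsBit : F → Set
  IsBit t = t ≡ 0# ⊎ t ≡ 1#

  idempotent⇒IsBit : ∀ t → square t ≡ t → IsBit t
  idempotent⇒IsBit t t²≡t
    with *-zero-divisor t (t + 1#) (trans (distribˡ t t 1#) (trans (cong₂ _+_ t²≡t (*-identityʳ t)) (x+x≡0 t)))
  ... | inj₁ t≡0   = inj₁ t≡0
  ... | inj₂ t+1≡0 = inj₂ (x+y≡0⇒x≡y t 1# t+1≡0)

  TrF-IsBit : ∀ x → IsBit (TrF x)
  TrF-IsBit x = idempotent⇒IsBit (TrF x) (square-TrF x)

  bit-0 : bit 0# ≡ 0
  bit-0 with 0# ≟ 0#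
  ... | yes _   = refl
  ... | no 0≢0  = contradiction refl 0≢0

  bit-1 : bit 1# ≡ 1
  bit-1 with 1# ≟ 0#
  ... | yes 1≡0 = contradiction (sym 1≡0) 0≢1
  ... | no _    = refl

  bit-+ : ∀ s t → IsBit s → IsBit t →
          IsBit (s + t) × bit (s + t) ℕ.+ 2 ℕ.* (bit s ℕ.* bit t) ≡ bit s ℕ.+ bit t
  bit-+ s t (inj₁ refl) (inj₁ refl) rewrite +-identityˡ 0# | bit-0         = inj₁ refl , refl
  bit-+ s t (inj₁ refl) (inj₂ refl) rewrite +-identityˡ 1# | bit-0 | bit-1 = inj₂ refl , refl
  bit-+ s t (inj₂ refl) (inj₁ refl) rewrite +-identityʳ 1# | bit-0 | bit-1 = inj₂ refl , refl
  bit-+ s t (inj₂ refl) (inj₂ refl) rewrite x+x≡0 1#       | bit-0 | bit-1 = inj₁ refl , refl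

  m·bit-+ : ∀ m s t → IsBit s → IsBit t → m ℕ.* bit (s + t) ℕ.+ (2 ℕ.* m) ℕ.* (bit s ℕ.* bit t) ≡ m ℕ.* bit s ℕ.+ m ℕ.* bit t
  m·bit-+ m s t s-bit t-bit = begin
    m ℕ.* bit (s + t) ℕ.+ (2 ℕ.* m) ℕ.* (bit s ℕ.* bit t)   ≡⟨ factor m (bit (s + t)) (bit s ℕ.* bit t) ⟩
    m ℕ.* (bit (s + t) ℕ.+ 2 ℕ.* (bit s ℕ.* bit t))         ≡⟨ cong (m ℕ.*_) (proj₂ (bit-+ s t s-bit t-bit)) ⟩
    m ℕ.* (bit s ℕ.+ bit t)                                 ≡⟨ ℕP.*-distribˡ-+ m (bit s) (bit t) ⟩
    m ℕ.* bit s ℕ.+ m ℕ.* bit t                             ∎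
    where
    factor : ∀ m x p → m ℕ.* x ℕ.+ (2 ℕ.* m) ℕ.* p ≡ m ℕ.* (x ℕ.+ 2 ℕ.* p)
    factor = solve-∀

  bit-* : ∀ s t → IsBit s → IsBit t → IsBit (s * t) × bit (s * t) ≡ bit s ℕ.* bit t
  bit-* s t (inj₁ refl) (inj₁ refl) rewrite zeroˡ 0#       | bit-0         = inj₁ refl , refl
  bit-* s t (inj₁ refl) (inj₂ refl) rewrite zeroˡ 1#       | bit-0         = inj₁ refl , refl
  bit-* s t (inj₂ refl) (inj₁ refl) rewrite zeroʳ 1#       | bit-0 | bit-1 = inj₁ refl , refl
  bit-* s t (inj₂ refl) (inj₂ refl) rewrite *-identityˡ 1# | bit-1         = inj₂ refl , refl

  bit≤1 : ∀ s → bit s ℕ.≤ 1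
  bit≤1 s with does (s ≟ 0#)
  ... | true  = ℕ.z≤n
  ... | false = ℕ.s≤s ℕ.z≤n

  e₁ : (ℕ → F) → ℕ → F
  e₁ a m = FΣ.Σ (upTo m) a

  e₂ : (ℕ → F) → ℕ → F
  e₂ a m = FΣ.Σ (upTo m) (λ j → FΣ.Σ (upTo j) (λ i → a i * a j))

  crossPairs : (ℕ → F) → (ℕ → F) → ℕ → F
  crossPairs a b m = FΣ.Σ (upTo m) (λ j → FΣ.Σ (upTo j) (λ i → a i * b j + b i * a j))

  dot : (ℕ → F) → (ℕ → F) → ℕ → F
  dot a b m = FΣ.Σ (upTo m) (λ i → a i * b i)

  FΣ-*ʳ : ∀ {A : Set} (l : List A) (v : A → F) c → FΣ.Σ l (λ i → v i * c) ≡ FΣ.Σ l v * c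
  FΣ-*ʳ l v c = sym (FΣ.Σ-homomorphism (_* c) (λ x y → distribʳ c x y) (zeroˡ c) l v)

  FΣ-*ˡ : ∀ {A : Set} (l : List A) (v : A → F) c → FΣ.Σ l (λ i → c * v i) ≡ c * FΣ.Σ l v
  FΣ-*ˡ l v c = sym (FΣ.Σ-homomorphism (c *_) (λ x y → distribˡ c x y) (zeroʳ c) l v)

  e₂-cong : ∀ a b m → (∀ i → a i ≡ b i) → e₂ a m ≡ e₂ b m
  e₂-cong a b m a≗b = FΣ.Σ-cong (upTo m) (λ j → FΣ.Σ-cong (upTo j) (λ i → cong₂ _*_ (a≗b i) (a≗b j)))

  e₂-∷ʳ : ∀ a m → e₂ a (suc m) ≡ e₂ a m + e₁ a m * a m
  e₂-∷ʳ a m = trans (FΣ.Σ-upTo-∷ʳ m _) (cong (_+_ (e₂ a m)) (FΣ-*ʳ (upTo m) a (a m)))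

  e₂-suc : ∀ a m → e₂ a (suc m) ≡ a 0 * e₁ (a ∘ suc) m + e₂ (a ∘ suc) m
  e₂-suc a m = begin
    e₂ a (suc m)                                                                 ≡⟨ FΣ.Σ-upTo-suc m _ ⟩
    0# + FΣ.Σ (upTo m) (λ j → FΣ.Σ (upTo (suc j)) (λ i → a i * a (suc j)))       ≡⟨ +-identityˡ _ ⟩
    FΣ.Σ (upTo m) (λ j → FΣ.Σ (upTo (suc j)) (λ i → a i * a (suc j)))
      ≡⟨ FΣ.Σ-cong (upTo m) (λ j → FΣ.Σ-upTo-suc j (λ i → a i * a (suc j))) ⟩
    FΣ.Σ (upTo m) (λ j → a 0 * a (suc j) + FΣ.Σ (upTo j) (λ i → a (suc i) * a (suc j)))
      ≡⟨ FΣ.Σ-distrib (upTo m) _ _ ⟩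
    FΣ.Σ (upTo m) (λ j → a 0 * a (suc j)) + e₂ (a ∘ suc) m
      ≡⟨ cong (_+ e₂ (a ∘ suc) m) (FΣ-*ˡ (upTo m) (a ∘ suc) (a 0)) ⟩
    a 0 * e₁ (a ∘ suc) m + e₂ (a ∘ suc) m                                        ∎

  square-e₂ : ∀ a m → square (e₂ a m) ≡ e₂ (square ∘ a) m
  square-e₂ a m = trans (FΣ.Σ-homomorphism square square-+ square-0 (upTo m) _)
    (FΣ.Σ-cong (upTo m) (λ j → trans (FΣ.Σ-homomorphism square square-+ square-0 (upTo j) _)
                                     (FΣ.Σ-cong (upTo j) (λ i → square-* (a i) (a j)))))

  e₁*e₁ : ∀ a b m → e₁ a m * e₁ b m ≡ crossPairs a b m + dot a b m
  e₁*e₁ a b zero    = trans (zeroˡ 0#) (sym (+-identityˡ 0#))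
  e₁*e₁ a b (suc m) = begin
    e₁ a (suc m) * e₁ b (suc m)                     ≡⟨ cong₂ _*_ (FΣ.Σ-upTo-∷ʳ m a) (FΣ.Σ-upTo-∷ʳ m b) ⟩
    (A + a m) * (B + b m)
      ≡⟨ solve 4 (λ A B am bm → (A :+ am) :* (B :+ bm) := A :* B :+ (A :* bm :+ B :* am) :+ am :* bm) refl A B (a m) (b m) ⟩
    A * B + (A * b m + B * a m) + a m * b m         ≡⟨ cong (λ t → t + (A * b m + B * a m) + a m * b m) (e₁*e₁ a b m) ⟩
    (Cr + Dt) + (A * b m + B * a m) + a m * b m
      ≡⟨ solve 4 (λ C D X Y → (C :+ D) :+ X :+ Y := (C :+ X) :+ (D :+ Y)) refl Cr Dt (A * b m + B * a m) (a m * b m) ⟩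
    (Cr + (A * b m + B * a m)) + (Dt + a m * b m)   ≡⟨ cong₂ _+_ (cong (_+_ Cr) (sym newCross)) (sym (FΣ.Σ-upTo-∷ʳ m _)) ⟩
    (Cr + FΣ.Σ (upTo m) (λ i → a i * b m + b i * a m)) + dot a b (suc m)
                                                    ≡⟨ cong (_+ dot a b (suc m)) (sym (FΣ.Σ-upTo-∷ʳ m _)) ⟩
    crossPairs a b (suc m) + dot a b (suc m)        ∎
    where
    A : F
    A = e₁ a m
    B : F
    B = e₁ b m
    Cr : F
    Cr = crossPairs a b m
    Dt : F
    Dt = dot a b m
    newCross : FΣ.Σ (upTo m) (λ i → a i * b m + b i * a m) ≡ A * b m + B * a m
    newCross = trans (FΣ.Σ-distrib (upTo m) _ _) (cong₂ _+_ (FΣ-*ʳ (upTo m) a (b m)) (FΣ-*ʳ (upTo m) b (a m)))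

  e₂-+ : ∀ a b m → e₂ (λ i → a i + b i) m ≡ e₂ a m + e₂ b m + crossPairs a b m
  e₂-+ a b m = begin
    e₂ (λ i → a i + b i) m
      ≡⟨ FΣ.Σ-cong (upTo m) (λ j → FΣ.Σ-cong (upTo j) (λ i → expand (a i) (b i) (a j) (b j))) ⟩
    FΣ.Σ (upTo m) (λ j → FΣ.Σ (upTo j) (λ i → a i * a j + b i * b j + (a i * b j + b i * a j)))
      ≡⟨ FΣ.Σ-cong (upTo m) (λ j → trans (FΣ.Σ-distrib (upTo j) _ _)
                                         (cong (_+ FΣ.Σ (upTo j) (λ i → a i * b j + b i * a j)) (FΣ.Σ-distrib (upTo j) _ _))) ⟩
    FΣ.Σ (upTo m) (λ j → FΣ.Σ (upTo j) (λ i → a i * a j) + FΣ.Σ (upTo j) (λ i → b i * b j)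
                         + FΣ.Σ (upTo j) (λ i → a i * b j + b i * a j))
      ≡⟨ trans (FΣ.Σ-distrib (upTo m) _ _) (cong (_+ crossPairs a b m) (FΣ.Σ-distrib (upTo m) _ _)) ⟩
    e₂ a m + e₂ b m + crossPairs a b m ∎
    where
    expand : ∀ ai bi aj bj → (ai + bi) * (aj + bj) ≡ ai * aj + bi * bj + (ai * bj + bi * aj)
    expand = solve 4 (λ ai bi aj bj → (ai :+ bi) :* (aj :+ bj) := ai :* aj :+ bi :* bj :+ (ai :* bj :+ bi :* aj)) refl

  σF : F → F
  σF x = sumF (map (λ j → sumF (map (λ i → frob i x * frob j x) (upTo j))) (upTo n))

  σF≡e₂ : ∀ x → σF x ≡ e₂ (λ i → frob i x) n
  σF≡e₂ x = trans
    (cong (foldr _+_ 0#) (ListP.map-cong (λ j → FΣ.Σ-foldr (upTo j) (λ i → frob i x * frob j x)) (upTo n)))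
    (FΣ.Σ-foldr (upTo n) _)

  -- σ(x)² = e₂(x², …, x^(2^n)); peeling the first or the last of x, x², …, x^(2^n) = x off
  -- e₂(x, …, x^(2^n)) gives σ(x)² + x · Tr x = σ(x) + Tr x · x.
  square-σF : ∀ x → square (σF x) ≡ σF x
  square-σF x = begin
    square (σF x)                                          ≡⟨ cong square (σF≡e₂ x) ⟩
    square (e₂ a n)                                        ≡⟨ square-e₂ a n ⟩
    e₂ (a ∘ suc) n                                         ≡⟨ +-identityˡ _ ⟨
    0# + e₂ (a ∘ suc) n                                    ≡⟨ cong (_+ e₂ (a ∘ suc) n) (x+x≡0 (x * t)) ⟨
    (x * t + x * t) + e₂ (a ∘ suc) n                       ≡⟨ +-assoc _ _ _ ⟩
    x * t + (x * t + e₂ (a ∘ suc) n)                       ≡⟨ cong (λ s → x * t + (x * s + e₂ (a ∘ suc) n)) e₁-shift ⟨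
    x * t + (x * e₁ (a ∘ suc) n + e₂ (a ∘ suc) n)          ≡⟨ cong (_+_ (x * t)) (e₂-suc a n) ⟨
    x * t + e₂ a (suc n)                                   ≡⟨ cong (_+_ (x * t)) (e₂-∷ʳ a n) ⟩
    x * t + (e₂ a n + t * a n)                             ≡⟨ cong (λ s → x * t + (e₂ a n + t * s)) (frob-n x) ⟩
    x * t + (e₂ a n + t * x)
      ≡⟨ solve 3 (λ x t e → x :* t :+ (e :+ t :* x) := (x :* t :+ x :* t) :+ e) refl x t (e₂ a n) ⟩
    (x * t + x * t) + e₂ a n                               ≡⟨ cong (_+ e₂ a n) (x+x≡0 _) ⟩
    0# + e₂ a n                                            ≡⟨ +-identityˡ _ ⟩
    e₂ a n                                                 ≡⟨ σF≡e₂ x ⟨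
    σF x                                                   ∎
    where
    a : ℕ → F
    a i = frob i x
    t : F
    t = e₁ a n
    e₁-shift : e₁ (a ∘ suc) n ≡ t
    e₁-shift = +-cancelˡ x _ _ (begin
      x + e₁ (a ∘ suc) n   ≡⟨ FΣ.Σ-upTo-suc n a ⟨
      e₁ a (suc n)         ≡⟨ FΣ.Σ-upTo-∷ʳ n a ⟩
      t + a n              ≡⟨ cong (_+_ t) (frob-n x) ⟩
      t + x                ≡⟨ +-comm _ _ ⟩
      x + t                ∎)

  σF-IsBit : ∀ x → IsBit (σF x)
  σF-IsBit x = idempotent⇒IsBit _ (square-σF x)

  -- The failure of σ to be additive: e₂(a + b) - e₂ a - e₂ b = e₁ a · e₁ b - Σ aᵢbᵢ.
  σF-+ : ∀ y z → σF (y + z) ≡ σF y + σF z + (TrF y * TrF z + TrF (y * z))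
  σF-+ y z = begin
    σF (y + z)                                   ≡⟨ σF≡e₂ (y + z) ⟩
    e₂ (λ i → frob i (y + z)) n                  ≡⟨ e₂-cong _ _ n (λ i → frob-+ i y z) ⟩
    e₂ (λ i → a i + b i) n                       ≡⟨ e₂-+ a b n ⟩
    e₂ a n + e₂ b n + crossPairs a b n           ≡⟨ cong₂ (λ u v → u + v + crossPairs a b n) (σF≡e₂ y) (σF≡e₂ z) ⟨
    σF y + σF z + crossPairs a b n               ≡⟨ cong (_+_ (σF y + σF z)) cross≡ ⟩
    σF y + σF z + (TrF y * TrF z + TrF (y * z))  ∎
    where
    a b : ℕ → F
    a i = frob i y
    b i = frob i z
    dot≡ : dot a b n ≡ TrF (y * z)
    dot≡ = trans (FΣ.Σ-cong (upTo n) (λ i → sym (frob-* i y z))) (sym (TrF≡Σ (y * z)))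
    cross≡ : crossPairs a b n ≡ TrF y * TrF z + TrF (y * z)
    cross≡ = begin
      crossPairs a b n                                      ≡⟨ +-identityʳ _ ⟨
      crossPairs a b n + 0#                                 ≡⟨ cong (_+_ (crossPairs a b n)) (x+x≡0 (dot a b n)) ⟨
      crossPairs a b n + (dot a b n + dot a b n)            ≡⟨ +-assoc _ _ _ ⟨
      (crossPairs a b n + dot a b n) + dot a b n            ≡⟨ cong₂ _+_ (sym (e₁*e₁ a b n)) dot≡ ⟩
      e₁ a n * e₁ b n + TrF (y * z)                         ≡⟨ cong (_+ TrF (y * z)) (cong₂ _*_ (TrF≡Σ y) (TrF≡Σ z)) ⟨
      TrF y * TrF z + TrF (y * z)                           ∎

module TraceNonzero {n : ℕ} (𝔽 : GF n) where
  open FiniteField 𝔽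
  open ≡-Reasoning

  Poly : Set
  Poly = List F

  eval : Poly → F → F
  eval []      x = 0#
  eval (a ∷ p) x = a + x * eval p x

  -- Synthetic division by X + r (= X - r in characteristic 2).
  deflate : F → Poly → Poly
  deflate r []            = []
  deflate r (a ∷ [])      = []
  deflate r (a ∷ (b ∷ p)) = eval (b ∷ p) r ∷ deflate r (b ∷ p)

  eval-deflate : ∀ r p x → eval p x ≡ eval p r + (x + r) * eval (deflate r p) x
  eval-deflate r [] x = sym (trans (cong (_+_ 0#) (zeroʳ _)) (+-identityˡ 0#))
  eval-deflate r (a ∷ []) x = begin
    a + x * 0#                       ≡⟨ cong (_+_ a) (zeroʳ x) ⟩
    a + 0#                           ≡⟨ +-identityʳ _ ⟨
    a + 0# + 0#                      ≡⟨ cong₂ (λ u v → a + u + v) (zeroʳ r) (zeroʳ (x + r)) ⟨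
    a + r * 0# + (x + r) * 0#        ∎
  eval-deflate r (a ∷ (b ∷ p)) x = begin
    a + x * P x                                       ≡⟨ cong (λ t → a + x * t) (eval-deflate r (b ∷ p) x) ⟩
    a + x * (P r + (x + r) * Q)                       ≡⟨ +-identityʳ _ ⟨
    a + x * (P r + (x + r) * Q) + 0#                  ≡⟨ cong (_+_ (a + x * (P r + (x + r) * Q))) (x+x≡0 (r * P r)) ⟨
    a + x * (P r + (x + r) * Q) + (r * P r + r * P r)
      ≡⟨ solve 5 (λ a x r Pr Q → a :+ x :* (Pr :+ (x :+ r) :* Q) :+ (r :* Pr :+ r :* Pr)
                                 := (a :+ r :* Pr) :+ (x :+ r) :* (Pr :+ x :* Q)) refl a x r (P r) Q ⟩
    (a + r * P r) + (x + r) * (P r + x * Q)           ∎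
    where
    P : F → F
    P = eval (b ∷ p)
    Q : F
    Q = eval (deflate r (b ∷ p)) x

  deflate-++-leading : ∀ (l : Poly) a c r → Σ[ l′ ∈ Poly ] Σ[ c′ ∈ F ]
    (deflate r ((a ∷ l) ++ [ c ]) ≡ l′ ++ [ c′ ] × length l′ ≡ length l × c′ ≡ c)
  deflate-++-leading []      a c r = [] , eval [ c ] r , refl , refl , trans (cong (_+_ c) (zeroʳ r)) (+-identityʳ c)
  deflate-++-leading (b ∷ l) a c r with deflate-++-leading l b c r
  ... | l′ , c′ , e , len , c′≡c = eval ((b ∷ l) ++ [ c ]) r ∷ l′ , c′ , cong (_ ∷_) e , cong suc len , c′≡c

  too-many-roots : ∀ d (l : Poly) c → length l ≡ d → c ≢ 0# → (rs : List F) → Unique rs → suc d ≤ length rs →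
                   ¬ All (λ r → eval (l ++ [ c ]) r ≡ 0#) rs
  too-many-roots zero [] c _ c≢0 (r ∷ rs) _ _ (root ∷ _) =
    c≢0 (trans (sym (trans (cong (_+_ c) (zeroʳ r)) (+-identityʳ c))) root)
  too-many-roots (suc d) (a ∷ l) c len c≢0 (r ∷ rs) (r∉rs ∷ u) (s≤s d<rs) (root ∷ roots)
    with deflate-++-leading l a c r
  ... | l′ , c′ , e , len′ , c′≡c =
    too-many-roots d l′ c′ (trans len′ (ℕP.suc-injective len)) (λ c′≡0 → c≢0 (trans (sym c′≡c) c′≡0)) rs u d<rs
      (All.zipWith (λ (r≢r′ , root′) → deflated-root _ r≢r′ root′) (r∉rs , roots))
    where
    p : Poly
    p = (a ∷ l) ++ [ c ]
    deflated-root : ∀ r′ → r ≢ r′ → eval p r′ ≡ 0# → eval (l′ ++ [ c′ ]) r′ ≡ 0#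
    deflated-root r′ r≢r′ root′ with *-zero-divisor (r′ + r) (eval (deflate r p) r′) (begin
      (r′ + r) * eval (deflate r p) r′                ≡⟨ +-identityˡ _ ⟨
      0# + (r′ + r) * eval (deflate r p) r′           ≡⟨ cong (_+ (r′ + r) * eval (deflate r p) r′) root ⟨
      eval p r + (r′ + r) * eval (deflate r p) r′     ≡⟨ eval-deflate r p r′ ⟨
      eval p r′                                       ≡⟨ root′ ⟩
      0#                                              ∎)
    ... | inj₁ r′+r≡0 = contradiction (sym (x+y≡0⇒x≡y r′ r r′+r≡0)) r≢r′
    ... | inj₂ root″  = trans (cong (λ t → eval t r′) (sym e)) root″

  eval-++ : ∀ l m x → eval (l ++ m) x ≡ eval l x + x ^ᶠ length l * eval m x
  eval-++ []      m x = sym (trans (+-identityˡ _) (*-identityˡ _))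
  eval-++ (a ∷ l) m x = begin
    a + x * eval (l ++ m) x                              ≡⟨ cong (λ t → a + x * t) (eval-++ l m x) ⟩
    a + x * (eval l x + x ^ᶠ length l * eval m x)
      ≡⟨ solve 5 (λ a x L P M → a :+ x :* (L :+ P :* M) := (a :+ x :* L) :+ (x :* P) :* M) refl
                 a x (eval l x) (x ^ᶠ length l) (eval m x) ⟩
    (a + x * eval l x) + (x * x ^ᶠ length l) * eval m x  ∎

  eval-zeros : ∀ k x → eval (replicate k 0#) x ≡ 0#
  eval-zeros zero    x = refl
  eval-zeros (suc k) x = trans (+-identityˡ _) (trans (cong (x *_) (eval-zeros k x)) (zeroʳ x))

  padTo : ℕ → Poly → Poly
  padTo d l = l ++ replicate (d ℕ.∸ length l) 0#

  eval-padTo : ∀ d l x → eval (padTo d l) x ≡ eval l x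
  eval-padTo d l x = begin
    eval (padTo d l) x                                          ≡⟨ eval-++ l _ x ⟩
    eval l x + x ^ᶠ length l * eval (replicate (d ℕ.∸ length l) 0#) x
                                                                ≡⟨ cong (λ t → eval l x + x ^ᶠ length l * t) (eval-zeros (d ℕ.∸ length l) x) ⟩
    eval l x + x ^ᶠ length l * 0#                               ≡⟨ cong (_+_ (eval l x)) (zeroʳ _) ⟩
    eval l x + 0#                                               ≡⟨ +-identityʳ _ ⟩
    eval l x                                                    ∎

  length-padTo : ∀ d l → length l ≤ d → length (padTo d l) ≡ d
  length-padTo d l l≤d =
    trans (ListP.length-++ l) (trans (cong (length l ℕ.+_) (ListP.length-replicate (d ℕ.∸ length l))) (ℕP.m+[n∸m]≡n l≤d))

  -- Coefficients of X + X² + X⁴ + ⋯ + X^(2^(j-1)).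
  tracePoly : ℕ → Poly
  tracePoly zero    = []
  tracePoly (suc j) = padTo (2 ^ j) (tracePoly j) ++ [ 1# ]

  2^j+1≤2^[1+j] : ∀ j → 2 ^ j ℕ.+ 1 ≤ 2 ^ suc j
  2^j+1≤2^[1+j] j = ℕP.+-monoʳ-≤ (2 ^ j) (ℕP.≤-trans (ℕP.m^n>0 2 j) (ℕP.m≤m+n (2 ^ j) 0))

  length-tracePoly : ∀ j → length (tracePoly j) ≤ 2 ^ j
  length-tracePoly zero    = z≤n
  length-tracePoly (suc j) = ℕP.≤-trans (ℕP.≤-reflexive length≡) (2^j+1≤2^[1+j] j)
    where
    length≡ : length (padTo (2 ^ j) (tracePoly j) ++ [ 1# ]) ≡ 2 ^ j ℕ.+ 1
    length≡ = trans (ListP.length-++ (padTo (2 ^ j) (tracePoly j)))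
                    (cong (ℕ._+ 1) (length-padTo (2 ^ j) (tracePoly j) (length-tracePoly j)))

  eval-tracePoly : ∀ j x → eval (tracePoly j) x ≡ FΣ.Σ (upTo j) (λ i → frob i x)
  eval-tracePoly zero    x = refl
  eval-tracePoly (suc j) x = begin
    eval (padTo (2 ^ j) (tracePoly j) ++ [ 1# ]) x                                  ≡⟨ eval-++ (padTo (2 ^ j) (tracePoly j)) [ 1# ] x ⟩
    eval (padTo (2 ^ j) (tracePoly j)) x + x ^ᶠ length (padTo (2 ^ j) (tracePoly j)) * (1# + x * 0#)
      ≡⟨ cong₂ (λ u v → u + x ^ᶠ v * (1# + x * 0#)) (eval-padTo (2 ^ j) (tracePoly j) x)
                                                   (length-padTo (2 ^ j) (tracePoly j) (length-tracePoly j)) ⟩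
    eval (tracePoly j) x + x ^ᶠ (2 ^ j) * (1# + x * 0#)
      ≡⟨ cong₂ (λ u v → u + x ^ᶠ (2 ^ j) * v) (eval-tracePoly j x) (trans (cong (_+_ 1#) (zeroʳ x)) (+-identityʳ 1#)) ⟩
    FΣ.Σ (upTo j) (λ i → frob i x) + x ^ᶠ (2 ^ j) * 1#
      ≡⟨ cong (_+_ (FΣ.Σ (upTo j) (λ i → frob i x))) (trans (*-identityʳ _) (sym (frob≡^ᶠ j x))) ⟩
    FΣ.Σ (upTo j) (λ i → frob i x) + frob j x                                       ≡⟨ FΣ.Σ-upTo-∷ʳ j _ ⟨
    FΣ.Σ (upTo (suc j)) (λ i → frob i x)                                            ∎

  n≢0 : n ≢ 0
  n≢0 refl = 0≢1 (trans (sym (to∘from 0#)) (trans (cong to (Fin1-irrelevant (from 0#) (from 1#))) (to∘from 1#)))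
    where
    Fin1-irrelevant : (i j : Fin 1) → i ≡ j
    Fin1-irrelevant zero zero = refl

  ∃n≡suc : ∃ λ m → n ≡ suc m
  ∃n≡suc = ℕ.pred n , sym (ℕP.suc-pred n {{ℕ.≢-nonZero n≢0}})

  -- Tr is a polynomial of degree 2^(n-1) < q, so it cannot vanish on all of F.
  TrF-not-identically-0 : ¬ (∀ x → TrF x ≡ 0#)
  TrF-not-identically-0 TrF≡0 with ∃n≡suc
  ... | m , n≡1+m = too-many-roots (2 ^ m) (padTo (2 ^ m) (tracePoly m)) 1#
      (length-padTo (2 ^ m) (tracePoly m) (length-tracePoly m)) (λ 1≡0 → 0≢1 (sym 1≡0)) elems elems-unique
      enough-elements (All.tabulate (λ {x} _ → root x))
    where
    enough-elements : suc (2 ^ m) ≤ length elems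
    enough-elements = subst (suc (2 ^ m) ≤_) (trans (cong (2 ^_) (sym n≡1+m)) (sym length-elems))
                            (subst (_≤ 2 ^ suc m) (ℕP.+-comm (2 ^ m) 1) (2^j+1≤2^[1+j] m))
    root : ∀ x → eval (tracePoly (suc m)) x ≡ 0#
    root x = begin
      eval (tracePoly (suc m)) x              ≡⟨ eval-tracePoly (suc m) x ⟩
      FΣ.Σ (upTo (suc m)) (λ i → frob i x)    ≡⟨ cong (λ j → FΣ.Σ (upTo j) (λ i → frob i x)) n≡1+m ⟨
      FΣ.Σ (upTo n) (λ i → frob i x)          ≡⟨ TrF≡Σ x ⟨
      TrF x                                   ≡⟨ TrF≡0 x ⟩
      0#                                      ∎

  ∃TrF≡1 : ∃ λ x → TrF x ≡ 1#
  ∃TrF≡1 with Any.any? (λ x → TrF x ≟ 1#) elems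
  ... | yes some = let (x , _ , TrFx≡1) = find some in x , TrFx≡1
  ... | no none  = ⊥-elim (TrF-not-identically-0 (λ x → TrF≢1⇒≡0 x (TrF-IsBit x)))
    where
    TrF≢1⇒≡0 : ∀ x → IsBit (TrF x) → TrF x ≡ 0#
    TrF≢1⇒≡0 x (inj₁ TrFx≡0) = TrFx≡0
    TrF≢1⇒≡0 x (inj₂ TrFx≡1) = ⊥-elim (none (lose (∈-elems x) TrFx≡1))

  ∃TrF[u*z]≡1 : ∀ z → z ≢ 0# → ∃ λ u → TrF (u * z) ≡ 1#
  ∃TrF[u*z]≡1 z z≢0 with inverse z z≢0 | ∃TrF≡1
  ... | z⁻¹ , zz⁻¹≡1 | x , TrFx≡1 = x * z⁻¹ , trans (cong TrF x*z⁻¹*z≡x) TrFx≡1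
    where
    x*z⁻¹*z≡x : x * z⁻¹ * z ≡ x
    x*z⁻¹*z≡x = trans (*-assoc _ _ _) (trans (cong (x *_) (trans (*-comm z⁻¹ z) zz⁻¹≡1)) (*-identityʳ x))

module CyclotomicArithmetic (m : ℕ) where
  open Cyclo m public
  open Congruence N public
  open ≡-Reasoning

  infix 4 _≈_
  _≈_ : Cyc M → Cyc M → Set
  v ≈ w = ∀ t → v t ≡ w t

  N≡M+M : N ≡ M ℕ.+ M
  N≡M+M = cong (M ℕ.+_) (ℕP.+-identityʳ M)

  sumC-apply : ∀ {A : Set} (l : List A) (f : A → Cyc M) t → sumC (map f l) t ≡ ℤΣ.Σ l (λ x → f x t)
  sumC-apply []      f t = refl
  sumC-apply (x ∷ l) f t = cong (f x t +ℤ_) (sumC-apply l f t)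

  sumC-cong : ∀ {A : Set} (l : List A) (f g : A → Cyc M) → (∀ x → f x ≈ g x) → sumC (map f l) ≈ sumC (map g l)
  sumC-cong l f g f≈g t = trans (sumC-apply l f t) (trans (ℤΣ.Σ-cong l (λ x → f≈g x t)) (sym (sumC-apply l g t)))

  ⊗-apply : ∀ v w t →
            (v ⊗ w) t ≡ ℤΣ.Σ (allFin M) (λ i → ℤΣ.Σ (allFin M) (λ j → (v i *ℤ w j) *ℤ ζ^ (toℕ i ℕ.+ toℕ j) t))
  ⊗-apply v w t = trans (sumC-apply (allFin M) _ t) (ℤΣ.Σ-cong (allFin M) (λ i → sumC-apply (allFin M) _ t))

  ⊗-cong : ∀ {v v′ w w′} → v ≈ v′ → w ≈ w′ → (v ⊗ w) ≈ (v′ ⊗ w′)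
  ⊗-cong {v} {v′} {w} {w′} v≈v′ w≈w′ t = trans (⊗-apply v w t) (trans
    (ℤΣ.Σ-cong (allFin M) (λ i → ℤΣ.Σ-cong (allFin M) (λ j →
      cong₂ (λ a b → (a *ℤ b) *ℤ ζ^ (toℕ i ℕ.+ toℕ j) t) (v≈v′ i) (w≈w′ j))))
    (sym (⊗-apply v′ w′ t)))

  conj-apply : ∀ v t → conj v t ≡ ℤΣ.Σ (allFin M) (λ i → v i *ℤ ζ^ (N ∸ toℕ i) t)
  conj-apply v t = sumC-apply (allFin M) _ t

  ζ^-cong : ∀ a b → a ≡ₘ b → ζ^ a ≈ ζ^ b
  ζ^-cong a b a≡b j = ζ^a≡ζ^b
    where
    ζ^a≡ζ^b : ζ^ a j ≡ ζ^ b j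
    ζ^a≡ζ^b rewrite a≡b = refl

  ζ^-coefficient : ℕ → Fin M → ℤ
  ζ^-coefficient r j = if does (r ℕP.≟ toℕ j) then + 1
                       else if does (r ℕP.≟ toℕ j ℕ.+ M) then ℤ.- (+ 1) else + 0

  unit : ℕ → Fin M → ℤ
  unit r j = if does (r ℕP.≟ toℕ j) then + 1 else + 0

  ζ^-coefficient-low : ∀ r j → r < M → ζ^-coefficient r j ≡ unit r j
  ζ^-coefficient-low r j r<M with r ℕP.≟ toℕ j
  ... | yes refl rewrite ≡ᵇ-refl r = refl
  ... | no r≢j rewrite ≡ᵇ-≢ r (toℕ j) r≢j with r ℕP.≟ toℕ j ℕ.+ M
  ...   | yes r≡j+M = ⊥-elim (ℕP.<⇒≱ r<M (subst (M ≤_) (sym r≡j+M) (ℕP.m≤n+m M (toℕ j))))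
  ...   | no r≢j+M rewrite ≡ᵇ-≢ r (toℕ j ℕ.+ M) r≢j+M = refl

  ζ^-coefficient-high : ∀ r j → ζ^-coefficient (M ℕ.+ r) j ≡ -ℤ unit r j
  ζ^-coefficient-high r j with (M ℕ.+ r) ℕP.≟ toℕ j
  ... | yes M+r≡j = ⊥-elim (ℕP.<⇒≱ (FinP.toℕ<n j) (subst (M ≤_) M+r≡j (ℕP.m≤m+n M r)))
  ... | no M+r≢j rewrite ≡ᵇ-≢ (M ℕ.+ r) (toℕ j) M+r≢j with (M ℕ.+ r) ℕP.≟ toℕ j ℕ.+ M | r ℕP.≟ toℕ j
  ...   | yes e | yes refl rewrite ≡ᵇ-refl r | e | ≡ᵇ-refl (toℕ j ℕ.+ M) = refl
  ...   | yes e | no r≢j   = ⊥-elim (r≢j (ℕP.+-cancelˡ-≡ M r (toℕ j) (trans e (ℕP.+-comm (toℕ j) M))))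
  ...   | no ne | yes refl = ⊥-elim (ne (ℕP.+-comm M r))
  ...   | no ne | no ne′ rewrite ≡ᵇ-≢ _ _ ne | ≡ᵇ-≢ _ _ ne′ = refl

  data Residue (r : ℕ) : Set where
    low  : r < M → Residue r
    high : ∀ r′ → r′ < M → r ≡ M ℕ.+ r′ → Residue r

  residue : ∀ r → r < N → Residue r
  residue r r<N with r ℕP.<? M
  ... | yes r<M = low r<M
  ... | no r≮M  = high (r ∸ M) (ℕP.+-cancelˡ-< M (r ∸ M) M r<M+M) (sym M+[r∸M]≡r)
    where
    M+[r∸M]≡r : M ℕ.+ (r ∸ M) ≡ r
    M+[r∸M]≡r = ℕP.m+[n∸m]≡n (ℕP.≮⇒≥ r≮M)
    r<M+M : M ℕ.+ (r ∸ M) < M ℕ.+ M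
    r<M+M = subst₂ _<_ (sym M+[r∸M]≡r) N≡M+M r<N

  Σ-unit : ∀ r (r<M : r < M) (X : Fin M → ℤ) → ℤΣ.Σ (allFin M) (λ i → unit r i *ℤ X i) ≡ X (fromℕ< r<M)
  Σ-unit r r<M X = trans (ℤΣ.Σ-cong (allFin M) unit*X) (ℤΣ.Σ-allFin-select-toℕ M r r<M X)
    where
    unit*X : ∀ i → unit r i *ℤ X i ≡ (if does (r ℕP.≟ toℕ i) then X i else + 0)
    unit*X i with does (r ℕP.≟ toℕ i)
    ... | true  = ℤP.*-identityˡ (X i)
    ... | false = refl

  -- The coefficient vector of ζ^a is ±(a unit vector), so pairing it with any φ satisfying
  -- φ (M + x) = - φ x evaluates φ at a mod N.
  Σ-ζ^-antiperiodic : ∀ a (φ : ℕ → ℤ) → (∀ x → φ (M ℕ.+ x) ≡ -ℤ φ x) →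
                      ℤΣ.Σ (allFin M) (λ i → ζ^ a i *ℤ φ (toℕ i)) ≡ φ (a % N)
  Σ-ζ^-antiperiodic a φ anti with residue (a % N) (m%n<n a N)
  ... | low r<M = begin
    ℤΣ.Σ (allFin M) (λ i → ζ^ a i *ℤ φ (toℕ i))
      ≡⟨ ℤΣ.Σ-cong (allFin M) (λ i → cong (_*ℤ φ (toℕ i)) (ζ^-coefficient-low (a % N) i r<M)) ⟩
    ℤΣ.Σ (allFin M) (λ i → unit (a % N) i *ℤ φ (toℕ i))  ≡⟨ Σ-unit (a % N) r<M (φ ∘ toℕ) ⟩
    φ (toℕ (fromℕ< r<M))                                 ≡⟨ cong φ (FinP.toℕ-fromℕ< r<M) ⟩
    φ (a % N)                                            ∎
  ... | high r′ r′<M a%N≡M+r′ = begin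
    ℤΣ.Σ (allFin M) (λ i → ζ^ a i *ℤ φ (toℕ i))
      ≡⟨ ℤΣ.Σ-cong (allFin M) (λ i → cong (_*ℤ φ (toℕ i))
           (trans (cong (λ x → ζ^-coefficient x i) a%N≡M+r′) (ζ^-coefficient-high r′ i))) ⟩
    ℤΣ.Σ (allFin M) (λ i → -ℤ unit r′ i *ℤ φ (toℕ i))
      ≡⟨ ℤΣ.Σ-cong (allFin M) (λ i → sym (ℤP.neg-distribˡ-* (unit r′ i) (φ (toℕ i)))) ⟩
    ℤΣ.Σ (allFin M) (λ i → -ℤ (unit r′ i *ℤ φ (toℕ i)))  ≡⟨ ℤΣ-neg (allFin M) _ ⟩
    -ℤ ℤΣ.Σ (allFin M) (λ i → unit r′ i *ℤ φ (toℕ i))    ≡⟨ cong -ℤ_ (Σ-unit r′ r′<M (φ ∘ toℕ)) ⟩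
    -ℤ φ (toℕ (fromℕ< r′<M))                             ≡⟨ cong (λ x → -ℤ φ x) (FinP.toℕ-fromℕ< r′<M) ⟩
    -ℤ φ r′                                              ≡⟨ anti r′ ⟨
    φ (M ℕ.+ r′)                                        ≡⟨ cong φ a%N≡M+r′ ⟨
    φ (a % N)                                           ∎

  ζ^-M+ : ∀ e → ζ^ (M ℕ.+ e) ≈ (λ t → -ℤ ζ^ e t)
  ζ^-M+ e t with residue (e % N) (m%n<n e N)
  ... | low r<M = begin
    ζ^ (M ℕ.+ e) t                        ≡⟨ ζ^-cong (M ℕ.+ e) (M ℕ.+ e % N) (+-congₘ {M} {M} refl (symₘ (%-≡ₘ e))) t ⟩
    ζ^-coefficient ((M ℕ.+ e % N) % N) t  ≡⟨ cong (λ x → ζ^-coefficient x t) (m<n⇒m%n≡m M+r<N) ⟩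
    ζ^-coefficient (M ℕ.+ e % N) t        ≡⟨ ζ^-coefficient-high (e % N) t ⟩
    -ℤ unit (e % N) t                      ≡⟨ cong -ℤ_ (ζ^-coefficient-low (e % N) t r<M) ⟨
    -ℤ ζ^ e t                              ∎
    where
    M+r<N : M ℕ.+ e % N < N
    M+r<N = subst (M ℕ.+ e % N <_) (sym N≡M+M) (ℕP.+-monoʳ-< M r<M)
  ... | high r′ r′<M e%N≡M+r′ = begin
    ζ^ (M ℕ.+ e) t                   ≡⟨ ζ^-cong (M ℕ.+ e) r′ M+e≡r′ t ⟩
    ζ^-coefficient (r′ % N) t        ≡⟨ cong (λ x → ζ^-coefficient x t) (m<n⇒m%n≡m r′<N) ⟩
    ζ^-coefficient r′ t              ≡⟨ ζ^-coefficient-low r′ t r′<M ⟩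
    unit r′ t                        ≡⟨ ℤP.neg-involutive _ ⟨
    -ℤ -ℤ unit r′ t                    ≡⟨ cong -ℤ_ (ζ^-coefficient-high r′ t) ⟨
    -ℤ ζ^-coefficient (M ℕ.+ r′) t    ≡⟨ cong (λ x → -ℤ ζ^-coefficient x t) e%N≡M+r′ ⟨
    -ℤ ζ^ e t                         ∎
    where
    r′<N : r′ < N
    r′<N = ℕP.<-≤-trans r′<M (subst (M ≤_) (sym N≡M+M) (ℕP.m≤m+n M M))
    M+[M+r]≡r+N : ∀ M r → M ℕ.+ (M ℕ.+ r) ≡ r ℕ.+ (M ℕ.+ (M ℕ.+ 0))
    M+[M+r]≡r+N = solve-∀
    M+e≡r′ : M ℕ.+ e ≡ₘ r′
    M+e≡r′ = transₘ (+-congₘ {M} {M} refl (symₘ (%-≡ₘ e)))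
             (transₘ (≡⇒≡ₘ (trans (cong (M ℕ.+_) e%N≡M+r′) (M+[M+r]≡r+N M r′)))
                     ([m+n]%n≡m%n r′ N))

  -- (N - 1) · e represents -e; it keeps all exponents in ℕ.
  negExp : ℕ → ℕ
  negExp e = (N ∸ 1) ℕ.* e

  negExp-inverse : ∀ e → negExp e ℕ.+ e ≡ₘ 0
  negExp-inverse e = transₘ (≡⇒≡ₘ (begin
    (N ∸ 1) ℕ.* e ℕ.+ e          ≡⟨ cong ((N ∸ 1) ℕ.* e ℕ.+_) (ℕP.*-identityˡ e) ⟨
    (N ∸ 1) ℕ.* e ℕ.+ 1 ℕ.* e    ≡⟨ ℕP.*-distribʳ-+ e (N ∸ 1) 1 ⟨
    ((N ∸ 1) ℕ.+ 1) ℕ.* e        ≡⟨ cong (ℕ._* e) (ℕP.m∸n+n≡m (ℕP.m^n>0 2 (suc m))) ⟩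
    N ℕ.* e                      ≡⟨ ℕP.*-comm N e ⟩
    e ℕ.* N                      ∎)) (+-multipleₘ 0 e)

  negExp-+ : ∀ a b → negExp (a ℕ.+ b) ≡ negExp a ℕ.+ negExp b
  negExp-+ a b = ℕP.*-distribˡ-+ (N ∸ 1) a b

  negExp-cancel : ∀ X Y Z → X ≡ₘ Y ℕ.+ Z → X ℕ.+ negExp Z ≡ₘ Y
  negExp-cancel X Y Z X≡Y+Z = transₘ (+-congₘ {X} {Y ℕ.+ Z} {negExp Z} X≡Y+Z refl)
    (transₘ (≡⇒≡ₘ (ℕP.+-assoc Y Z (negExp Z)))
      (transₘ (+-congₘ {Y} {Y} refl (transₘ (≡⇒≡ₘ (ℕP.+-comm Z (negExp Z))) (negExp-inverse Z)))
              (≡⇒≡ₘ (ℕP.+-identityʳ Y))))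

  ζ^⊗-apply : ∀ a w t → (ζ^ a ⊗ w) t ≡ ℤΣ.Σ (allFin M) (λ j → w j *ℤ ζ^ (a ℕ.+ toℕ j) t)
  ζ^⊗-apply a w t = begin
    (ζ^ a ⊗ w) t
      ≡⟨ ⊗-apply (ζ^ a) w t ⟩
    ℤΣ.Σ (allFin M) (λ i → ℤΣ.Σ (allFin M) (λ j → (ζ^ a i *ℤ w j) *ℤ ζ^ (toℕ i ℕ.+ toℕ j) t))
      ≡⟨ ℤΣ.Σ-cong (allFin M) (λ i → trans (ℤΣ.Σ-cong (allFin M) (λ j → ℤP.*-assoc (ζ^ a i) (w j) _))
                                           (ℤΣ-*ˡ (allFin M) _ (ζ^ a i))) ⟩
    ℤΣ.Σ (allFin M) (λ i → ζ^ a i *ℤ φ (toℕ i))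
      ≡⟨ Σ-ζ^-antiperiodic a φ φ-antiperiodic ⟩
    φ (a % N)
      ≡⟨ ℤΣ.Σ-cong (allFin M) (λ j → cong (w j *ℤ_)
           (ζ^-cong (a % N ℕ.+ toℕ j) (a ℕ.+ toℕ j) (+-congₘ {a % N} {a} (%-≡ₘ a) refl) t)) ⟩
    ℤΣ.Σ (allFin M) (λ j → w j *ℤ ζ^ (a ℕ.+ toℕ j) t)
      ∎
    where
    φ : ℕ → ℤ
    φ x = ℤΣ.Σ (allFin M) (λ j → w j *ℤ ζ^ (x ℕ.+ toℕ j) t)
    φ-antiperiodic : ∀ x → φ (M ℕ.+ x) ≡ -ℤ φ x
    φ-antiperiodic x = trans
      (ℤΣ.Σ-cong (allFin M) (λ j → trans (cong (λ e → w j *ℤ ζ^ e t) (ℕP.+-assoc M x (toℕ j)))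
        (trans (cong (w j *ℤ_) (ζ^-M+ (x ℕ.+ toℕ j) t)) (sym (ℤP.neg-distribʳ-* (w j) _)))))
      (ℤΣ-neg (allFin M) _)

  ζ^⊗ζ^ : ∀ a b → (ζ^ a ⊗ ζ^ b) ≈ ζ^ (a ℕ.+ b)
  ζ^⊗ζ^ a b t = begin
    (ζ^ a ⊗ ζ^ b) t                                     ≡⟨ ζ^⊗-apply a (ζ^ b) t ⟩
    ℤΣ.Σ (allFin M) (λ j → ζ^ b j *ℤ ζ^ (a ℕ.+ toℕ j) t) ≡⟨ Σ-ζ^-antiperiodic b φ φ-antiperiodic ⟩
    ζ^ (a ℕ.+ b % N) t                                  ≡⟨ ζ^-cong (a ℕ.+ b % N) (a ℕ.+ b) (+-congₘ {a} {a} refl (%-≡ₘ b)) t ⟩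
    ζ^ (a ℕ.+ b) t                                      ∎
    where
    φ : ℕ → ℤ
    φ x = ζ^ (a ℕ.+ x) t
    φ-antiperiodic : ∀ x → φ (M ℕ.+ x) ≡ -ℤ φ x
    φ-antiperiodic x =
      trans (cong (λ e → ζ^ e t) (+-left-swap a M x)) (ζ^-M+ (a ℕ.+ x) t)

  conj-ζ^ : ∀ a → conj (ζ^ a) ≈ ζ^ (negExp a)
  conj-ζ^ a t = begin
    conj (ζ^ a) t                                          ≡⟨ conj-apply (ζ^ a) t ⟩
    ℤΣ.Σ (allFin M) (λ i → ζ^ a i *ℤ ζ^ (N ∸ toℕ i) t)     ≡⟨ ℤΣ.Σ-cong (allFin M) (λ i → cong (ζ^ a i *ℤ_) (N∸i≡negExp i)) ⟩
    ℤΣ.Σ (allFin M) (λ i → ζ^ a i *ℤ φ (toℕ i))            ≡⟨ Σ-ζ^-antiperiodic a φ φ-antiperiodic ⟩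
    φ (a % N)                                              ≡⟨ ζ^-cong (negExp (a % N)) (negExp a) (*-congˡₘ (N ∸ 1) (%-≡ₘ a)) t ⟩
    ζ^ (negExp a) t                                        ∎
    where
    φ : ℕ → ℤ
    φ x = ζ^ (negExp x) t
    N∸i≡negExp : ∀ (i : Fin M) → ζ^ (N ∸ toℕ i) t ≡ φ (toℕ i)
    N∸i≡negExp i = ζ^-cong (N ∸ toℕ i) (negExp (toℕ i))
      (inverseₘ-unique (N ∸ toℕ i) (negExp (toℕ i)) (toℕ i)
        (transₘ (≡⇒≡ₘ (trans (ℕP.m∸n+n≡m i≤N) (sym (ℕP.+-identityʳ N)))) (+-multipleₘ 0 1))
        (negExp-inverse (toℕ i))) t
      where
      i≤N : toℕ i ≤ N
      i≤N = ℕP.<⇒≤ (ℕP.<-≤-trans (FinP.toℕ<n i) (subst (M ≤_) (sym N≡M+M) (ℕP.m≤m+n M M)))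
    negExp-M : negExp M ≡ₘ M
    negExp-M = inverseₘ-unique (negExp M) M M (negExp-inverse M)
      (transₘ (≡⇒≡ₘ (trans (sym N≡M+M) (sym (ℕP.*-identityˡ N)))) (+-multipleₘ 0 1))
    φ-antiperiodic : ∀ x → φ (M ℕ.+ x) ≡ -ℤ φ x
    φ-antiperiodic x = trans
      (ζ^-cong (negExp (M ℕ.+ x)) (M ℕ.+ negExp x) (transₘ (≡⇒≡ₘ (negExp-+ M x)) (+-congₘ {negExp M} {M} negExp-M refl)) t)
      (ζ^-M+ (negExp x) t)

  ⊗-sumʳ : ∀ {A : Set} v (l : List A) (f : A → Cyc M) → (v ⊗ sumC (map f l)) ≈ sumC (map (λ x → v ⊗ f x) l)
  ⊗-sumʳ v l f t = begin
    (v ⊗ sumC (map f l)) t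
      ≡⟨ ⊗-apply v (sumC (map f l)) t ⟩
    ℤΣ.Σ (allFin M) (λ i → ℤΣ.Σ (allFin M) (λ j → (v i *ℤ sumC (map f l) j) *ℤ ζ^ (toℕ i ℕ.+ toℕ j) t))
      ≡⟨ ℤΣ.Σ-cong (allFin M) (λ i → ℤΣ.Σ-cong (allFin M) (λ j → distribute i j)) ⟩
    ℤΣ.Σ (allFin M) (λ i → ℤΣ.Σ (allFin M) (λ j → ℤΣ.Σ l (λ x → (v i *ℤ f x j) *ℤ ζ^ (toℕ i ℕ.+ toℕ j) t)))
      ≡⟨ ℤΣ.Σ-cong (allFin M) (λ i → ℤΣ.Σ-comm (allFin M) l _) ⟩
    ℤΣ.Σ (allFin M) (λ i → ℤΣ.Σ l (λ x → ℤΣ.Σ (allFin M) (λ j → (v i *ℤ f x j) *ℤ ζ^ (toℕ i ℕ.+ toℕ j) t)))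
      ≡⟨ ℤΣ.Σ-comm (allFin M) l _ ⟩
    ℤΣ.Σ l (λ x → ℤΣ.Σ (allFin M) (λ i → ℤΣ.Σ (allFin M) (λ j → (v i *ℤ f x j) *ℤ ζ^ (toℕ i ℕ.+ toℕ j) t)))
      ≡⟨ ℤΣ.Σ-cong l (λ x → sym (⊗-apply v (f x) t)) ⟩
    ℤΣ.Σ l (λ x → (v ⊗ f x) t)
      ≡⟨ sumC-apply l _ t ⟨
    sumC (map (λ x → v ⊗ f x) l) t
      ∎
    where
    distribute : ∀ i j → (v i *ℤ sumC (map f l) j) *ℤ ζ^ (toℕ i ℕ.+ toℕ j) t
                       ≡ ℤΣ.Σ l (λ x → (v i *ℤ f x j) *ℤ ζ^ (toℕ i ℕ.+ toℕ j) t)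
    distribute i j = trans (cong (λ s → (v i *ℤ s) *ℤ ζ^ (toℕ i ℕ.+ toℕ j) t) (sumC-apply l f j))
      (trans (cong (_*ℤ ζ^ (toℕ i ℕ.+ toℕ j) t) (sym (ℤΣ-*ˡ l (λ x → f x j) (v i)))) (sym (ℤΣ-*ʳ l _ _)))

  ⊗-sumˡ : ∀ {A : Set} w (l : List A) (f : A → Cyc M) → (sumC (map f l) ⊗ w) ≈ sumC (map (λ x → f x ⊗ w) l)
  ⊗-sumˡ w l f t = begin
    (sumC (map f l) ⊗ w) t
      ≡⟨ ⊗-apply (sumC (map f l)) w t ⟩
    ℤΣ.Σ (allFin M) (λ i → ℤΣ.Σ (allFin M) (λ j → (sumC (map f l) i *ℤ w j) *ℤ ζ^ (toℕ i ℕ.+ toℕ j) t))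
      ≡⟨ ℤΣ.Σ-cong (allFin M) (λ i → ℤΣ.Σ-cong (allFin M) (λ j → distribute i j)) ⟩
    ℤΣ.Σ (allFin M) (λ i → ℤΣ.Σ (allFin M) (λ j → ℤΣ.Σ l (λ x → (f x i *ℤ w j) *ℤ ζ^ (toℕ i ℕ.+ toℕ j) t)))
      ≡⟨ ℤΣ.Σ-cong (allFin M) (λ i → ℤΣ.Σ-comm (allFin M) l _) ⟩
    ℤΣ.Σ (allFin M) (λ i → ℤΣ.Σ l (λ x → ℤΣ.Σ (allFin M) (λ j → (f x i *ℤ w j) *ℤ ζ^ (toℕ i ℕ.+ toℕ j) t)))
      ≡⟨ ℤΣ.Σ-comm (allFin M) l _ ⟩
    ℤΣ.Σ l (λ x → ℤΣ.Σ (allFin M) (λ i → ℤΣ.Σ (allFin M) (λ j → (f x i *ℤ w j) *ℤ ζ^ (toℕ i ℕ.+ toℕ j) t)))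
      ≡⟨ ℤΣ.Σ-cong l (λ x → sym (⊗-apply (f x) w t)) ⟩
    ℤΣ.Σ l (λ x → (f x ⊗ w) t)
      ≡⟨ sumC-apply l _ t ⟨
    sumC (map (λ x → f x ⊗ w) l) t
      ∎
    where
    distribute : ∀ i j → (sumC (map f l) i *ℤ w j) *ℤ ζ^ (toℕ i ℕ.+ toℕ j) t
                       ≡ ℤΣ.Σ l (λ x → (f x i *ℤ w j) *ℤ ζ^ (toℕ i ℕ.+ toℕ j) t)
    distribute i j = trans (cong (λ s → (s *ℤ w j) *ℤ ζ^ (toℕ i ℕ.+ toℕ j) t) (sumC-apply l f i))
      (trans (cong (_*ℤ ζ^ (toℕ i ℕ.+ toℕ j) t) (sym (ℤΣ-*ʳ l (λ x → f x i) (w j)))) (sym (ℤΣ-*ʳ l _ _)))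

  conj-sum : ∀ {A : Set} (l : List A) (f : A → Cyc M) → conj (sumC (map f l)) ≈ sumC (map (λ x → conj (f x)) l)
  conj-sum l f t = begin
    conj (sumC (map f l)) t
      ≡⟨ conj-apply (sumC (map f l)) t ⟩
    ℤΣ.Σ (allFin M) (λ i → sumC (map f l) i *ℤ ζ^ (N ∸ toℕ i) t)
      ≡⟨ ℤΣ.Σ-cong (allFin M) (λ i → trans (cong (_*ℤ ζ^ (N ∸ toℕ i) t) (sumC-apply l f i)) (sym (ℤΣ-*ʳ l _ _))) ⟩
    ℤΣ.Σ (allFin M) (λ i → ℤΣ.Σ l (λ x → f x i *ℤ ζ^ (N ∸ toℕ i) t))
      ≡⟨ ℤΣ.Σ-comm (allFin M) l _ ⟩
    ℤΣ.Σ l (λ x → ℤΣ.Σ (allFin M) (λ i → f x i *ℤ ζ^ (N ∸ toℕ i) t))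
      ≡⟨ ℤΣ.Σ-cong l (λ x → sym (conj-apply (f x) t)) ⟩
    ℤΣ.Σ l (λ x → conj (f x) t)
      ≡⟨ sumC-apply l _ t ⟨
    sumC (map (λ x → conj (f x)) l) t
      ∎

  ζSum : ∀ {A : Set} → List A → (A → ℕ) → Cyc M
  ζSum l e = sumC (map (λ x → ζ^ (e x)) l)

  ζSum-apply : ∀ {A : Set} (l : List A) (e : A → ℕ) t → ζSum l e t ≡ ℤΣ.Σ l (λ x → ζ^ (e x) t)
  ζSum-apply l e t = sumC-apply l _ t

  ζSum-cong : ∀ {A : Set} (l : List A) (e e′ : A → ℕ) → (∀ x → e x ≡ₘ e′ x) → ζSum l e ≈ ζSum l e′
  ζSum-cong l e e′ e≡e′ = sumC-cong l _ _ (λ x → ζ^-cong (e x) (e′ x) (e≡e′ x))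

  ζ^⊗ζSum : ∀ {A : Set} a (l : List A) (e : A → ℕ) → (ζ^ a ⊗ ζSum l e) ≈ ζSum l (λ x → a ℕ.+ e x)
  ζ^⊗ζSum a l e t = trans (⊗-sumʳ (ζ^ a) l _ t) (sumC-cong l _ _ (λ x → ζ^⊗ζ^ a (e x)) t)

  normSq-ζSum : ∀ {A : Set} (l : List A) (e : A → ℕ) →
                normSq (ζSum l e) ≈ sumC (map (λ x → ζSum l (λ y → e x ℕ.+ negExp (e y))) l)
  normSq-ζSum l e t = begin
    (ζSum l e ⊗ conj (ζSum l e)) t
      ≡⟨ ⊗-cong {ζSum l e} (λ _ → refl) (λ s → trans (conj-sum l _ s) (sumC-cong l _ _ (λ y → conj-ζ^ (e y)) s)) t ⟩
    (ζSum l e ⊗ ζSum l (negExp ∘ e)) t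
      ≡⟨ ⊗-sumˡ _ l _ t ⟩
    sumC (map (λ x → ζ^ (e x) ⊗ ζSum l (negExp ∘ e)) l) t
      ≡⟨ sumC-cong l _ _ (λ x → ζ^⊗ζSum (e x) l (negExp ∘ e)) t ⟩
    sumC (map (λ x → ζSum l (λ y → e x ℕ.+ negExp (e y))) l) t
      ∎

  ζ^⊗zeroC : ∀ a → (ζ^ a ⊗ zeroC) ≈ zeroC
  ζ^⊗zeroC a t = trans (ζ^⊗-apply a zeroC t) (ℤΣ.Σ-ε (allFin M))

  ζSum-vanish-shift : ∀ {A : Set} (l : List A) (e : A → ℕ) C → ζSum l (λ y → C ℕ.+ e y) ≈ zeroC →
                      ∀ a → ζSum l (λ y → a ℕ.+ e y) ≈ zeroC
  ζSum-vanish-shift l e C vanish a t = begin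
    ζSum l (λ y → a ℕ.+ e y) t                           ≡⟨ ζSum-cong l _ _ shift t ⟩
    ζSum l (λ y → (a ℕ.+ negExp C) ℕ.+ (C ℕ.+ e y)) t    ≡⟨ ζ^⊗ζSum (a ℕ.+ negExp C) l (λ y → C ℕ.+ e y) t ⟨
    (ζ^ (a ℕ.+ negExp C) ⊗ ζSum l (λ y → C ℕ.+ e y)) t   ≡⟨ ⊗-cong {ζ^ (a ℕ.+ negExp C)} (λ _ → refl) vanish t ⟩
    (ζ^ (a ℕ.+ negExp C) ⊗ zeroC) t                      ≡⟨ ζ^⊗zeroC _ t ⟩
    + 0                                                  ∎
    where
    reassociate : ∀ a b c d → (a ℕ.+ b) ℕ.+ (c ℕ.+ d) ≡ (a ℕ.+ (b ℕ.+ c)) ℕ.+ d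
    reassociate = solve-∀
    shift : ∀ y → a ℕ.+ e y ≡ₘ (a ℕ.+ negExp C) ℕ.+ (C ℕ.+ e y)
    shift y = symₘ (transₘ
      (≡⇒≡ₘ (reassociate a (negExp C) C (e y)))
      (+-congₘ {a ℕ.+ (negExp C ℕ.+ C)} {a}
        (transₘ (+-congₘ {a} {a} refl (negExp-inverse C)) (≡⇒≡ₘ (ℕP.+-identityʳ a))) refl))

  ζ^⊗const : ∀ a c → (ζ^ a ⊗ const c) ≈ scale c (ζ^ a)
  ζ^⊗const a c t = begin
    (ζ^ a ⊗ const c) t
      ≡⟨ ζ^⊗-apply a (const c) t ⟩
    ℤΣ.Σ (allFin M) (λ j → const c j *ℤ ζ^ (a ℕ.+ toℕ j) t)
      ≡⟨ ℤΣ.Σ-cong (allFin M) const*ζ^ ⟩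
    ℤΣ.Σ (allFin M) (λ j → if does (0 ℕP.≟ toℕ j) then c *ℤ ζ^ (a ℕ.+ toℕ j) t else + 0)
      ≡⟨ ℤΣ.Σ-allFin-select-toℕ M 0 (ℕP.m^n>0 2 m) _ ⟩
    c *ℤ ζ^ (a ℕ.+ toℕ (fromℕ< (ℕP.m^n>0 2 m))) t
      ≡⟨ cong (λ x → c *ℤ ζ^ (a ℕ.+ x) t) (FinP.toℕ-fromℕ< (ℕP.m^n>0 2 m)) ⟩
    c *ℤ ζ^ (a ℕ.+ 0) t
      ≡⟨ cong (λ x → c *ℤ ζ^ x t) (ℕP.+-identityʳ a) ⟩
    scale c (ζ^ a) t
      ∎
    where
    const*ζ^ : ∀ j → const c j *ℤ ζ^ (a ℕ.+ toℕ j) t ≡ (if does (0 ℕP.≟ toℕ j) then c *ℤ ζ^ (a ℕ.+ toℕ j) t else + 0)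
    const*ζ^ j with toℕ j
    ... | zero  = refl
    ... | suc _ = ℤP.*-zeroˡ (ζ^ (a ℕ.+ toℕ j) t)

  ζ^0≈1 : ζ^ 0 ≈ const (+ 1)
  ζ^0≈1 t = trans (cong (λ r → ζ^-coefficient r t) (m<n⇒m%n≡m (ℕP.m^n>0 2 (suc m))))
                  (trans (ζ^-coefficient-low 0 t (ℕP.m^n>0 2 m)) unit0≡const1)
    where
    unit0≡const1 : unit 0 t ≡ const (+ 1) t
    unit0≡const1 with toℕ t
    ... | zero  = refl
    ... | suc _ = refl

  -- If ζ^(s L) = -1, the terms b and b + L of each block of length 2L cancel.
  Σ-ζ^-arithmetic-vanish : ∀ (s L : ℕ) → s ℕ.* L ≡ₘ M → ∀ A P t →
                           ℤΣ.Σ (upTo (P ℕ.* (L ℕ.+ L))) (λ b → ζ^ (A ℕ.+ s ℕ.* b) t) ≡ + 0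
  Σ-ζ^-arithmetic-vanish s L sL≡M A P t = begin
    ℤΣ.Σ (upTo (P ℕ.* (L ℕ.+ L))) g                                     ≡⟨ ℤΣ.Σ-upTo-* P (L ℕ.+ L) g ⟩
    ℤΣ.Σ (upTo P) (λ j → ℤΣ.Σ (upTo (L ℕ.+ L)) (λ b → g (j ℕ.* (L ℕ.+ L) ℕ.+ b)))  ≡⟨ ℤΣ.Σ-cong (upTo P) block-vanishes ⟩
    ℤΣ.Σ (upTo P) (λ j → + 0)                                           ≡⟨ ℤΣ.Σ-ε (upTo P) ⟩
    + 0                                                                 ∎
    where
    g : ℕ → ℤ
    g b = ζ^ (A ℕ.+ s ℕ.* b) t
    block-vanishes : ∀ j → ℤΣ.Σ (upTo (L ℕ.+ L)) (λ b → g (j ℕ.* (L ℕ.+ L) ℕ.+ b)) ≡ + 0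
    block-vanishes j = begin
      ℤΣ.Σ (upTo (L ℕ.+ L)) h                              ≡⟨ ℤΣ.Σ-upTo-+ L L h ⟩
      ℤΣ.Σ (upTo L) h +ℤ ℤΣ.Σ (upTo L) (λ b → h (L ℕ.+ b))
        ≡⟨ cong (ℤΣ.Σ (upTo L) h +ℤ_) (trans (ℤΣ.Σ-cong (upTo L) h-antiperiodic) (ℤΣ-neg (upTo L) h)) ⟩
      ℤΣ.Σ (upTo L) h +ℤ -ℤ ℤΣ.Σ (upTo L) h                  ≡⟨ ℤP.+-inverseʳ (ℤΣ.Σ (upTo L) h) ⟩
      + 0                                                  ∎
      where
      h : ℕ → ℤ
      h b = g (j ℕ.* (L ℕ.+ L) ℕ.+ b)
      rearrange : ∀ A s j Q L b → A ℕ.+ s ℕ.* (j ℕ.* Q ℕ.+ (L ℕ.+ b)) ≡ s ℕ.* L ℕ.+ (A ℕ.+ s ℕ.* (j ℕ.* Q ℕ.+ b))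
      rearrange = solve-∀
      h-antiperiodic : ∀ b → h (L ℕ.+ b) ≡ -ℤ h b
      h-antiperiodic b = trans (ζ^-cong _ (M ℕ.+ (A ℕ.+ s ℕ.* (j ℕ.* (L ℕ.+ L) ℕ.+ b)))
        (transₘ (≡⇒≡ₘ (rearrange A s j (L ℕ.+ L) L b))
                (+-congₘ {s ℕ.* L} {M} sL≡M refl)) t)
        (ζ^-M+ _ t)

module CharacterSums (k : ℕ) where
  open CyclotomicArithmetic (suc k)

  K : ℕ
  K = 2 ^ k

  -- ζ⁴ is a primitive K-th root of unity: with c = 2^s·odd, ζ^(4c·2^(k-s-1)) = -1.
  Σ-ζ^[A+4cb]≡0 : ∀ c → 0 < c → c < K → ∀ A t → ℤΣ.Σ (upTo K) (λ b → ζ^ (A ℕ.+ (4 ℕ.* c) ℕ.* b) t) ≡ + 0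
  Σ-ζ^[A+4cb]≡0 c 0<c c<K A t with 2-adic-decomposition c 0<c
  ... | s , o , c≡2ˢ[2o+1] = subst (λ X → ℤΣ.Σ (upTo X) (λ b → ζ^ (A ℕ.+ (4 ℕ.* c) ℕ.* b) t) ≡ + 0) (sym K≡2ˢ[2ᵉ+2ᵉ])
                      (Σ-ζ^-arithmetic-vanish (4 ℕ.* c) (2 ^ e) 4c2ᵉ≡M A (2 ^ s) t)
    where
    s<k : s < k
    s<k with k ℕP.≤? s
    ... | no k≰s  = ℕP.≰⇒> k≰s
    ... | yes k≤s = ⊥-elim (ℕP.<⇒≱ c<K (ℕP.≤-trans (ℕP.^-monoʳ-≤ 2 k≤s)
                      (subst (2 ^ s ≤_) (sym c≡2ˢ[2o+1]) (ℕP.m≤m*n (2 ^ s) (2 ℕ.* o ℕ.+ 1) {{ℕ.>-nonZero (ℕP.m≤n+m 1 (2 ℕ.* o))}}))))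
    e : ℕ
    e = k ∸ suc s
    k≡s+1+e : k ≡ s ℕ.+ suc e
    k≡s+1+e = trans (sym (ℕP.m+[n∸m]≡n s<k)) (sym (ℕP.+-suc s e))
    K≡2ˢ[2ᵉ+2ᵉ] : K ≡ 2 ^ s ℕ.* (2 ^ e ℕ.+ 2 ^ e)
    K≡2ˢ[2ᵉ+2ᵉ] = trans (cong (2 ^_) k≡s+1+e)
                 (trans (ℕP.^-distribˡ-+-* 2 s (suc e)) (cong (λ x → 2 ^ s ℕ.* (2 ^ e ℕ.+ x)) (ℕP.+-identityʳ (2 ^ e))))
    M≡4·2ˢ·2ᵉ : M ≡ 4 ℕ.* 2 ^ s ℕ.* 2 ^ e
    M≡4·2ˢ·2ᵉ = begin
      2 ^ suc k                 ≡⟨ cong (λ x → 2 ^ suc x) k≡s+1+e ⟩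
      2 ^ suc (s ℕ.+ suc e)     ≡⟨ cong (2 ^_) (cong suc (ℕP.+-suc s e)) ⟩
      2 ^ (2 ℕ.+ (s ℕ.+ e))     ≡⟨ ℕP.^-distribˡ-+-* 2 2 (s ℕ.+ e) ⟩
      4 ℕ.* 2 ^ (s ℕ.+ e)       ≡⟨ cong (4 ℕ.*_) (ℕP.^-distribˡ-+-* 2 s e) ⟩
      4 ℕ.* (2 ^ s ℕ.* 2 ^ e)   ≡⟨ ℕP.*-assoc 4 (2 ^ s) (2 ^ e) ⟨
      4 ℕ.* 2 ^ s ℕ.* 2 ^ e     ∎
      where open ≡-Reasoning
    expand : ∀ p q o → 4 ℕ.* (p ℕ.* (2 ℕ.* o ℕ.+ 1)) ℕ.* q ≡ 4 ℕ.* p ℕ.* q ℕ.+ o ℕ.* (2 ℕ.* (4 ℕ.* p ℕ.* q))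
    expand = solve-∀
    4c2ᵉ≡M : (4 ℕ.* c) ℕ.* 2 ^ e ≡ₘ M
    4c2ᵉ≡M = transₘ (≡⇒≡ₘ (trans (cong (λ x → 4 ℕ.* x ℕ.* 2 ^ e) c≡2ˢ[2o+1]) (trans (expand (2 ^ s) (2 ^ e) o)
                (cong (λ x → x ℕ.+ o ℕ.* (2 ℕ.* x)) (sym M≡4·2ˢ·2ᵉ)))))
             (+-multipleₘ M o)

module NegaBentExponents {n : ℕ} (𝔽 : GF n) (k : ℕ) (k≥1 : 1 ≤ k) where
  open FiniteField 𝔽
  open CyclotomicArithmetic (suc k)
  open CharacterSums k using (K)
  open ≡-Reasoning

  instance
    K≢0 : NonZero K
    K≢0 = ℕP.m^n≢0 2 k

  M·bit-+ : ∀ s t → IsBit s → IsBit t → M ℕ.* bit (s + t) ≡ₘ M ℕ.* bit s ℕ.+ M ℕ.* bit t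
  M·bit-+ s t s-bit t-bit = transₘ (symₘ (+-multipleₘ _ (bit s ℕ.* bit t)))
    (≡⇒≡ₘ (trans (cong (M ℕ.* bit (s + t) ℕ.+_) (ℕP.*-comm (bit s ℕ.* bit t) N)) (m·bit-+ M s t s-bit t-bit)))

  M·Tr-+ : ∀ a b → M ℕ.* Tr (a + b) ≡ₘ M ℕ.* Tr a ℕ.+ M ℕ.* Tr b
  M·Tr-+ a b = subst (λ X → M ℕ.* bit X ≡ₘ M ℕ.* Tr a ℕ.+ M ℕ.* Tr b) (sym (TrF-+ a b))
                     (M·bit-+ (TrF a) (TrF b) (TrF-IsBit a) (TrF-IsBit b))

  M·σ1-+ : ∀ y w → M ℕ.* σ1 (y + w) ≡ₘ M ℕ.* σ1 y ℕ.+ M ℕ.* σ1 w ℕ.+ (M ℕ.* (Tr y ℕ.* Tr w) ℕ.+ M ℕ.* Tr (y * w))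
  M·σ1-+ y w = begin
    (M ℕ.* σ1 (y + w)) % N
      ≡⟨ cong (λ X → (M ℕ.* bit X) % N) (σF-+ y w) ⟩
    (M ℕ.* bit (σF y + σF w + (TrF y * TrF w + TrF (y * w)))) % N
      ≡⟨ M·bit-+ _ _ (proj₁ (bit-+ _ _ (σF-IsBit y) (σF-IsBit w))) (proj₁ (bit-+ _ _ TrTr-bit (TrF-IsBit (y * w)))) ⟩
    (M ℕ.* bit (σF y + σF w) ℕ.+ M ℕ.* bit (TrF y * TrF w + TrF (y * w))) % N
      ≡⟨ +-congₘ {M ℕ.* bit (σF y + σF w)} (M·bit-+ _ _ (σF-IsBit y) (σF-IsBit w)) (M·bit-+ _ _ TrTr-bit (TrF-IsBit (y * w))) ⟩
    (M ℕ.* σ1 y ℕ.+ M ℕ.* σ1 w ℕ.+ (M ℕ.* bit (TrF y * TrF w) ℕ.+ M ℕ.* Tr (y * w))) % N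
      ≡⟨ cong (λ X → (M ℕ.* σ1 y ℕ.+ M ℕ.* σ1 w ℕ.+ (M ℕ.* X ℕ.+ M ℕ.* Tr (y * w))) % N)
              (proj₂ (bit-* _ _ (TrF-IsBit y) (TrF-IsBit w))) ⟩
    (M ℕ.* σ1 y ℕ.+ M ℕ.* σ1 w ℕ.+ (M ℕ.* (Tr y ℕ.* Tr w) ℕ.+ M ℕ.* Tr (y * w))) % N
      ∎
    where
    TrTr-bit : IsBit (TrF y * TrF w)
    TrTr-bit = proj₁ (bit-* _ _ (TrF-IsBit y) (TrF-IsBit w))

  σ1-0 : σ1 0# ≡ 0
  σ1-0 = begin
    bit (σF 0#)                                ≡⟨ cong bit (σF≡e₂ 0#) ⟩
    bit (e₂ (λ i → frob i 0#) n)               ≡⟨ cong bit (e₂-cong _ _ n frob-0) ⟩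
    bit (e₂ (λ _ → 0#) n)
      ≡⟨ cong bit (FΣ.Σ-cong (upTo n) (λ j → trans (FΣ.Σ-cong (upTo j) (λ _ → zeroˡ 0#)) (FΣ.Σ-ε (upTo j)))) ⟩
    bit (FΣ.Σ (upTo n) (λ _ → 0#))             ≡⟨ cong bit (FΣ.Σ-ε (upTo n)) ⟩
    bit 0#                                     ≡⟨ bit-0 ⟩
    0                                          ∎

  Tr-0 : Tr 0# ≡ 0
  Tr-0 = trans (cong bit TrF-0) bit-0

  odd·M≡M : ∀ c → c % 2 ≡ 1 → ∀ t → c ℕ.* M ℕ.* t ≡ₘ M ℕ.* t
  odd·M≡M c c%2≡1 t = transₘ (≡⇒≡ₘ (begin
    c ℕ.* M ℕ.* t                            ≡⟨ cong (λ x → x ℕ.* M ℕ.* t) (trans (m≡m%n+[m/n]*n c 2) (cong (ℕ._+ c / 2 ℕ.* 2) c%2≡1)) ⟩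
    (1 ℕ.+ c / 2 ℕ.* 2) ℕ.* M ℕ.* t          ≡⟨ expand (c / 2) M t ⟩
    M ℕ.* t ℕ.+ c / 2 ℕ.* t ℕ.* N            ∎)) (+-multipleₘ (M ℕ.* t) (c / 2 ℕ.* t))
    where
    expand : ∀ h M t → (1 ℕ.+ h ℕ.* 2) ℕ.* M ℕ.* t ≡ M ℕ.* t ℕ.+ h ℕ.* t ℕ.* (2 ℕ.* M)
    expand = solve-∀

  even·M≡0 : ∀ c → c % 2 ≡ 0 → ∀ t → c ℕ.* M ℕ.* t ≡ₘ 0
  even·M≡0 c c%2≡0 t = transₘ (≡⇒≡ₘ (begin
    c ℕ.* M ℕ.* t                            ≡⟨ cong (λ x → x ℕ.* M ℕ.* t) (trans (m≡m%n+[m/n]*n c 2) (cong (ℕ._+ c / 2 ℕ.* 2) c%2≡0)) ⟩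
    (0 ℕ.+ c / 2 ℕ.* 2) ℕ.* M ℕ.* t          ≡⟨ expand (c / 2) M t ⟩
    0 ℕ.+ c / 2 ℕ.* t ℕ.* N                  ∎)) (+-multipleₘ 0 (c / 2 ℕ.* t))
    where
    expand : ∀ h M t → (0 ℕ.+ h ℕ.* 2) ℕ.* M ℕ.* t ≡ 0 ℕ.+ h ℕ.* t ℕ.* (2 ℕ.* M)
    expand = solve-∀

  σ-odd : ∀ (c : Zk k) x → toℕ c % 2 ≡ 1 → σ 𝔽 k c x ≡ σ1 x
  σ-odd c x c-odd rewrite c-odd = refl

  σ-even : ∀ (c : Zk k) x → toℕ c % 2 ≡ 0 → σ 𝔽 k c x ≡ 0
  σ-even c x c-even rewrite c-even = refl

  c₀-odd : ∀ (c : Zk k) → toℕ c % 2 ≡ 1 → c₀ 𝔽 k c ≡ 1#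
  c₀-odd c c-odd rewrite c-odd = refl

  c₀-even : ∀ (c : Zk k) → toℕ c % 2 ≡ 0 → c₀ 𝔽 k c ≡ 0#
  c₀-even c c-even rewrite c-even = refl

  -- Exponent of the factor (-1)^σ(c,w) · i^Tr(c₀ w) of 𝒦 in ℤ[ζ_N]: -1 = ζ^M and i = ζ^K.
  negaExp : Zk k → F → ℕ
  negaExp c w = M ℕ.* σ 𝔽 k c w ℕ.+ K ℕ.* Tr (c₀ 𝔽 k c * w)

  negaExp-cocycle-even : ∀ (c : Zk k) y w → toℕ c % 2 ≡ 0 →
                         negaExp c (y + w) ≡ₘ negaExp c w ℕ.+ negaExp c y ℕ.+ toℕ c ℕ.* M ℕ.* Tr (w * y)
  negaExp-cocycle-even c y w c-even
    rewrite σ-even c (y + w) c-even | σ-even c y c-even | σ-even c w c-even | c₀-even c c-even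
          | zeroˡ (y + w) | zeroˡ y | zeroˡ w | Tr-0
    = symₘ (transₘ (+-congₘ {M ℕ.* 0 ℕ.+ K ℕ.* 0 ℕ.+ (M ℕ.* 0 ℕ.+ K ℕ.* 0)} refl (even·M≡0 (toℕ c) c-even (Tr (w * y))))
                   (≡⇒≡ₘ (vanish M K)))
    where
    vanish : ∀ M K → M ℕ.* 0 ℕ.+ K ℕ.* 0 ℕ.+ (M ℕ.* 0 ℕ.+ K ℕ.* 0) ℕ.+ 0 ≡ M ℕ.* 0 ℕ.+ K ℕ.* 0
    vanish = solve-∀

  -- For odd c: σ(y + w) = σ y + σ w + Tr y Tr w + Tr (y w), and the carry in K · (Tr y + Tr w)
  -- cancels M · Tr y Tr w.
  negaExp-cocycle-odd : ∀ (c : Zk k) y w → toℕ c % 2 ≡ 1 →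
                        negaExp c (y + w) ≡ₘ negaExp c w ℕ.+ negaExp c y ℕ.+ toℕ c ℕ.* M ℕ.* Tr (w * y)
  negaExp-cocycle-odd c y w c-odd
    rewrite σ-odd c (y + w) c-odd | σ-odd c y c-odd | σ-odd c w c-odd | c₀-odd c c-odd
          | *-identityˡ (y + w) | *-identityˡ y | *-identityˡ w = begin
    (M ℕ.* σ1 (y + w) ℕ.+ K ℕ.* Tr (y + w)) % N
      ≡⟨ +-congₘ {M ℕ.* σ1 (y + w)} (M·σ1-+ y w) (refl {x = (K ℕ.* Tr (y + w)) % N}) ⟩
    (M ℕ.* σ1 y ℕ.+ M ℕ.* σ1 w ℕ.+ (M ℕ.* (Tr y ℕ.* Tr w) ℕ.+ M ℕ.* Tr (y * w)) ℕ.+ K ℕ.* Tr (y + w)) % N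
      ≡⟨ cong (_% N) (regroup M K (σ1 y) (σ1 w) (Tr y) (Tr w) (Tr (y * w)) (Tr (y + w)) carry) ⟩
    (M ℕ.* σ1 w ℕ.+ K ℕ.* Tr w ℕ.+ (M ℕ.* σ1 y ℕ.+ K ℕ.* Tr y) ℕ.+ M ℕ.* Tr (y * w)) % N
      ≡⟨ +-congₘ {M ℕ.* σ1 w ℕ.+ K ℕ.* Tr w ℕ.+ (M ℕ.* σ1 y ℕ.+ K ℕ.* Tr y)} refl
           (transₘ (≡⇒≡ₘ (cong (λ x → M ℕ.* Tr x) (*-comm y w))) (symₘ (odd·M≡M (toℕ c) c-odd (Tr (w * y))))) ⟩
    (M ℕ.* σ1 w ℕ.+ K ℕ.* Tr w ℕ.+ (M ℕ.* σ1 y ℕ.+ K ℕ.* Tr y) ℕ.+ toℕ c ℕ.* M ℕ.* Tr (w * y)) % N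
      ∎
    where
    carry : K ℕ.* Tr (y + w) ℕ.+ M ℕ.* (Tr y ℕ.* Tr w) ≡ K ℕ.* Tr y ℕ.+ K ℕ.* Tr w
    carry = subst (λ X → K ℕ.* bit X ℕ.+ M ℕ.* (Tr y ℕ.* Tr w) ≡ K ℕ.* Tr y ℕ.+ K ℕ.* Tr w) (sym (TrF-+ y w))
                  (m·bit-+ K (TrF y) (TrF w) (TrF-IsBit y) (TrF-IsBit w))
    regroup : ∀ M K sy sw ty tw tyw tsum → K ℕ.* tsum ℕ.+ M ℕ.* (ty ℕ.* tw) ≡ K ℕ.* ty ℕ.+ K ℕ.* tw →
              M ℕ.* sy ℕ.+ M ℕ.* sw ℕ.+ (M ℕ.* (ty ℕ.* tw) ℕ.+ M ℕ.* tyw) ℕ.+ K ℕ.* tsum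
              ≡ M ℕ.* sw ℕ.+ K ℕ.* tw ℕ.+ (M ℕ.* sy ℕ.+ K ℕ.* ty) ℕ.+ M ℕ.* tyw
    regroup M K sy sw ty tw tyw tsum carry′ = begin
      M ℕ.* sy ℕ.+ M ℕ.* sw ℕ.+ (M ℕ.* (ty ℕ.* tw) ℕ.+ M ℕ.* tyw) ℕ.+ K ℕ.* tsum
        ≡⟨ r₁ M K sy sw ty tw tyw tsum ⟩
      M ℕ.* sy ℕ.+ M ℕ.* sw ℕ.+ M ℕ.* tyw ℕ.+ (K ℕ.* tsum ℕ.+ M ℕ.* (ty ℕ.* tw))
        ≡⟨ cong (M ℕ.* sy ℕ.+ M ℕ.* sw ℕ.+ M ℕ.* tyw ℕ.+_) carry′ ⟩
      M ℕ.* sy ℕ.+ M ℕ.* sw ℕ.+ M ℕ.* tyw ℕ.+ (K ℕ.* ty ℕ.+ K ℕ.* tw)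
        ≡⟨ r₂ M K sy sw ty tw tyw ⟩
      M ℕ.* sw ℕ.+ K ℕ.* tw ℕ.+ (M ℕ.* sy ℕ.+ K ℕ.* ty) ℕ.+ M ℕ.* tyw
        ∎
      where
      r₁ : ∀ M K sy sw ty tw tyw tsum → M ℕ.* sy ℕ.+ M ℕ.* sw ℕ.+ (M ℕ.* (ty ℕ.* tw) ℕ.+ M ℕ.* tyw) ℕ.+ K ℕ.* tsum
           ≡ M ℕ.* sy ℕ.+ M ℕ.* sw ℕ.+ M ℕ.* tyw ℕ.+ (K ℕ.* tsum ℕ.+ M ℕ.* (ty ℕ.* tw))
      r₁ = solve-∀
      r₂ : ∀ M K sy sw ty tw tyw → M ℕ.* sy ℕ.+ M ℕ.* sw ℕ.+ M ℕ.* tyw ℕ.+ (K ℕ.* ty ℕ.+ K ℕ.* tw)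
           ≡ M ℕ.* sw ℕ.+ K ℕ.* tw ℕ.+ (M ℕ.* sy ℕ.+ K ℕ.* ty) ℕ.+ M ℕ.* tyw
      r₂ = solve-∀

  negaExp-cocycle : ∀ (c : Zk k) y w → negaExp c (y + w) ≡ₘ negaExp c w ℕ.+ negaExp c y ℕ.+ toℕ c ℕ.* M ℕ.* Tr (w * y)
  negaExp-cocycle c y w with parity (toℕ c)
  ... | inj₁ c-even = negaExp-cocycle-even c y w c-even
  ... | inj₂ c-odd  = negaExp-cocycle-odd c y w c-odd

  bodyExp : (F → Zk k) → Zk k → F → ℕ
  bodyExp f c x = negaExp c x ℕ.+ 4 ℕ.* (toℕ c ℕ.* toℕ (f x))

  summandExp-split : ∀ f c u x → summandExp 𝔽 k f c u x ≡ M ℕ.* Tr (u * x) ℕ.+ bodyExp f c x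
  summandExp-split f c u x = regroup M K (Tr (u * x)) (σ 𝔽 k c x) (4 ℕ.* (toℕ c ℕ.* toℕ (f x))) (Tr (c₀ 𝔽 k c * x))
    where
    regroup : ∀ M K a s p t → M ℕ.* (a ℕ.+ s) ℕ.+ p ℕ.+ K ℕ.* t ≡ M ℕ.* a ℕ.+ ((M ℕ.* s ℕ.+ K ℕ.* t) ℕ.+ p)
    regroup = solve-∀

  negExp-M· : ∀ t → negExp (M ℕ.* t) ≡ₘ M ℕ.* t
  negExp-M· t = inverseₘ-unique (negExp (M ℕ.* t)) (M ℕ.* t) (M ℕ.* t) (negExp-inverse (M ℕ.* t))
     (transₘ (≡⇒≡ₘ (double M t)) (+-multipleₘ 0 t))
    where
    double : ∀ M t → M ℕ.* t ℕ.+ M ℕ.* t ≡ 0 ℕ.+ t ℕ.* (2 ℕ.* M)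
    double = solve-∀

  summandExp-difference : ∀ f c u x y →
    summandExp 𝔽 k f c u x ℕ.+ negExp (summandExp 𝔽 k f c u y) ≡ₘ M ℕ.* Tr (u * (x + y)) ℕ.+ (bodyExp f c x ℕ.+ negExp (bodyExp f c y))
  summandExp-difference f c u x y = begin
    (summandExp 𝔽 k f c u x ℕ.+ negExp (summandExp 𝔽 k f c u y)) % N
      ≡⟨ cong₂ (λ a b → (a ℕ.+ negExp b) % N) (summandExp-split f c u x) (summandExp-split f c u y) ⟩
    (Mux ℕ.+ bodyExp f c x ℕ.+ negExp (Muy ℕ.+ bodyExp f c y)) % N
      ≡⟨ cong (λ z → (Mux ℕ.+ bodyExp f c x ℕ.+ z) % N) (negExp-+ Muy (bodyExp f c y)) ⟩
    (Mux ℕ.+ bodyExp f c x ℕ.+ (negExp Muy ℕ.+ negExp (bodyExp f c y))) % N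
      ≡⟨ +-congₘ {Mux ℕ.+ bodyExp f c x} refl (+-congₘ {negExp Muy} (negExp-M· (Tr (u * y))) (refl {x = negExp (bodyExp f c y) % N})) ⟩
    (Mux ℕ.+ bodyExp f c x ℕ.+ (Muy ℕ.+ negExp (bodyExp f c y))) % N
      ≡⟨ cong (_% N) (interchange Mux (bodyExp f c x) Muy (negExp (bodyExp f c y))) ⟩
    (Mux ℕ.+ Muy ℕ.+ (bodyExp f c x ℕ.+ negExp (bodyExp f c y))) % N
      ≡⟨ +-congₘ {Mux ℕ.+ Muy} (symₘ (transₘ (≡⇒≡ₘ (cong (λ z → M ℕ.* Tr z) (distribˡ u x y))) (M·Tr-+ (u * x) (u * y)))) refl ⟩
    (M ℕ.* Tr (u * (x + y)) ℕ.+ (bodyExp f c x ℕ.+ negExp (bodyExp f c y))) % N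
      ∎
    where
    Mux : ℕ
    Mux = M ℕ.* Tr (u * x)
    Muy : ℕ
    Muy = M ℕ.* Tr (u * y)
    interchange : ∀ a b c d → a ℕ.+ b ℕ.+ (c ℕ.+ d) ≡ a ℕ.+ c ℕ.+ (b ℕ.+ d)
    interchange = solve-∀

  4·2^[k∸1]≡M : 4 ℕ.* 2 ^ (k ∸ 1) ≡ M
  4·2^[k∸1]≡M = trans (quadruple (2 ^ (k ∸ 1))) (cong (λ x → 2 ^ suc x) (ℕP.m+[n∸m]≡n k≥1))
    where
    quadruple : ∀ x → 4 ℕ.* x ≡ 2 ℕ.* (2 ℕ.* x)
    quadruple = solve-∀

  deriv : (F → Zk k) → F → F → ℕ
  deriv f w y = toℕ (derivFun 𝔽 k f w y)

  deriv≡ : ∀ f w y → deriv f w y ≡ (toℕ (f (y + w)) ℕ.+ (K ∸ toℕ (f y)) ℕ.+ 2 ^ (k ∸ 1) ℕ.* Tr (w * y)) % K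
  deriv≡ f w y = FinP.toℕ-fromℕ< _

  -- ζ⁴ has order K, so exponents 4 c X only matter modulo K in X.
  4c[X%K]≡4cX : ∀ (c X : ℕ) → 4 ℕ.* (c ℕ.* (X % K)) ≡ₘ 4 ℕ.* (c ℕ.* X)
  4c[X%K]≡4cX c X = symₘ (transₘ
    (≡⇒≡ₘ (trans (cong (λ z → 4 ℕ.* (c ℕ.* z)) (m≡m%n+[m/n]*n X K)) (expand c (X % K) (X / K) K)))
    (+-multipleₘ _ (c ℕ.* (X / K))))
    where
    expand : ∀ c r q K → 4 ℕ.* (c ℕ.* (r ℕ.+ q ℕ.* K)) ≡ 4 ℕ.* (c ℕ.* r) ℕ.+ c ℕ.* q ℕ.* (2 ℕ.* (2 ℕ.* K))
    expand = solve-∀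

  bodyExp-shift : ∀ f c y w → bodyExp f c (y + w) ≡ₘ negaExp c w ℕ.+ 4 ℕ.* (toℕ c ℕ.* deriv f w y) ℕ.+ bodyExp f c y
  bodyExp-shift f c y w = begin
    (negaExp c (y + w) ℕ.+ 4 ℕ.* (cn ℕ.* fyw)) % N
      ≡⟨ +-congₘ {negaExp c (y + w)} (negaExp-cocycle c y w) (refl {x = (4 ℕ.* (cn ℕ.* fyw)) % N}) ⟩
    (negaExp c w ℕ.+ negaExp c y ℕ.+ cn ℕ.* M ℕ.* Tw ℕ.+ 4 ℕ.* (cn ℕ.* fyw)) % N
      ≡⟨ +-multipleₘ _ cn ⟨
    (negaExp c w ℕ.+ negaExp c y ℕ.+ cn ℕ.* M ℕ.* Tw ℕ.+ 4 ℕ.* (cn ℕ.* fyw) ℕ.+ cn ℕ.* N) % N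
      ≡⟨ cong (_% N) expand ⟨
    (negaExp c w ℕ.+ 4 ℕ.* (cn ℕ.* X) ℕ.+ bodyExp f c y) % N
      ≡⟨ +-congₘ {negaExp c w ℕ.+ 4 ℕ.* (cn ℕ.* X)} (+-congₘ {negaExp c w} refl (symₘ (4c[X%K]≡4cX cn X))) refl ⟩
    (negaExp c w ℕ.+ 4 ℕ.* (cn ℕ.* (X % K)) ℕ.+ bodyExp f c y) % N
      ≡⟨ cong (λ z → (negaExp c w ℕ.+ 4 ℕ.* (cn ℕ.* z) ℕ.+ bodyExp f c y) % N) (deriv≡ f w y) ⟨
    (negaExp c w ℕ.+ 4 ℕ.* (cn ℕ.* deriv f w y) ℕ.+ bodyExp f c y) % N
      ∎
    where
    cn : ℕ
    cn = toℕ c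
    fyw : ℕ
    fyw = toℕ (f (y + w))
    fy : ℕ
    fy = toℕ (f y)
    Tw : ℕ
    Tw = Tr (w * y)
    X : ℕ
    X = fyw ℕ.+ (K ∸ fy) ℕ.+ 2 ^ (k ∸ 1) ℕ.* Tw
    K∸fy+fy≡K : (K ∸ fy) ℕ.+ fy ≡ K
    K∸fy+fy≡K = ℕP.m∸n+n≡m (ℕP.<⇒≤ (FinP.toℕ<n (f y)))
    regroup : ∀ cn fyw a fy h Tw Cw Cy → Cw ℕ.+ 4 ℕ.* (cn ℕ.* (fyw ℕ.+ a ℕ.+ h ℕ.* Tw)) ℕ.+ (Cy ℕ.+ 4 ℕ.* (cn ℕ.* fy))
              ≡ Cw ℕ.+ Cy ℕ.+ cn ℕ.* (4 ℕ.* h) ℕ.* Tw ℕ.+ 4 ℕ.* (cn ℕ.* fyw) ℕ.+ cn ℕ.* (2 ℕ.* (2 ℕ.* (a ℕ.+ fy)))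
    regroup = solve-∀
    expand : negaExp c w ℕ.+ 4 ℕ.* (cn ℕ.* X) ℕ.+ bodyExp f c y
             ≡ negaExp c w ℕ.+ negaExp c y ℕ.+ cn ℕ.* M ℕ.* Tw ℕ.+ 4 ℕ.* (cn ℕ.* fyw) ℕ.+ cn ℕ.* N
    expand = trans (regroup cn fyw (K ∸ fy) fy (2 ^ (k ∸ 1)) Tw (negaExp c w) (negaExp c y))
      (cong₂ (λ u v → negaExp c w ℕ.+ negaExp c y ℕ.+ cn ℕ.* u ℕ.* Tw ℕ.+ 4 ℕ.* (cn ℕ.* fyw) ℕ.+ cn ℕ.* (2 ℕ.* (2 ℕ.* v)))
             4·2^[k∸1]≡M K∸fy+fy≡K)

  bodyExp-difference : ∀ f c y w → bodyExp f c (y + w) ℕ.+ negExp (bodyExp f c y) ≡ₘ negaExp c w ℕ.+ 4 ℕ.* (toℕ c ℕ.* deriv f w y)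
  bodyExp-difference f c y w = negExp-cancel _ _ _ (bodyExp-shift f c y w)

module NegaBentCharacterisation {n : ℕ} (𝔽 : GF n) (k : ℕ) (k≥1 : 1 ≤ k) where
  open FiniteField 𝔽
  open TraceNonzero 𝔽 using (∃TrF[u*z]≡1)
  open CyclotomicArithmetic (suc k)
  open CharacterSums k using (K; Σ-ζ^[A+4cb]≡0)
  open NegaBentExponents 𝔽 k k≥1
  open ≡-Reasoning

  instance
    q≢0 : NonZero q
    q≢0 = ℕP.m^n≢0 2 n

  DerivativesBalanced : (F → Zk k) → Set
  DerivativesBalanced f = ∀ z → z ≢ 0# → IsBalanced 𝔽 k (derivFun 𝔽 k f z)

  -- Translating u by some u₀ with Tr (u₀ w) = 1 negates every term, since ζ^M = -1.
  trace-orthogonality-≢0 : ∀ A w → w ≢ 0# → ∀ t → ℤΣ.Σ elems (λ u → ζ^ (A ℕ.+ M ℕ.* Tr (u * w)) t) ≡ + 0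
  trace-orthogonality-≢0 A w w≢0 t with ∃TrF[u*z]≡1 w w≢0
  ... | u₀ , TrF[u₀w]≡1 = x≡-x⇒x≡0 (ℤΣ.Σ elems g) (begin
    ℤΣ.Σ elems g                    ≡⟨ ElemsSum.Σ-elems-translate ℤP.+-0-isCommutativeMonoid u₀ g ⟨
    ℤΣ.Σ elems (λ u → g (u + u₀))   ≡⟨ ℤΣ.Σ-cong elems g[u+u₀]≡-gu ⟩
    ℤΣ.Σ elems (λ u → -ℤ g u)       ≡⟨ ℤΣ-neg elems g ⟩
    -ℤ ℤΣ.Σ elems g                 ∎)
    where
    g : F → ℤ
    g u = ζ^ (A ℕ.+ M ℕ.* Tr (u * w)) t
    rearrange : ∀ A M a → A ℕ.+ (M ℕ.* a ℕ.+ M ℕ.* 1) ≡ M ℕ.+ (A ℕ.+ M ℕ.* a)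
    rearrange = solve-∀
    shifted : ∀ u → A ℕ.+ M ℕ.* Tr ((u + u₀) * w) ≡ₘ M ℕ.+ (A ℕ.+ M ℕ.* Tr (u * w))
    shifted u = begin
      (A ℕ.+ M ℕ.* Tr ((u + u₀) * w)) % N                  ≡⟨ cong (λ z → (A ℕ.+ M ℕ.* Tr z) % N) (distribʳ w u u₀) ⟩
      (A ℕ.+ M ℕ.* Tr (u * w + u₀ * w)) % N                ≡⟨ +-congₘ {A} {A} refl (M·Tr-+ (u * w) (u₀ * w)) ⟩
      (A ℕ.+ (M ℕ.* Tr (u * w) ℕ.+ M ℕ.* Tr (u₀ * w))) % N ≡⟨ cong (λ z → (A ℕ.+ (M ℕ.* Tr (u * w) ℕ.+ M ℕ.* bit z)) % N) TrF[u₀w]≡1 ⟩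
      (A ℕ.+ (M ℕ.* Tr (u * w) ℕ.+ M ℕ.* bit 1#)) % N      ≡⟨ cong (λ z → (A ℕ.+ (M ℕ.* Tr (u * w) ℕ.+ M ℕ.* z)) % N) bit-1 ⟩
      (A ℕ.+ (M ℕ.* Tr (u * w) ℕ.+ M ℕ.* 1)) % N           ≡⟨ cong (_% N) (rearrange A M (Tr (u * w))) ⟩
      (M ℕ.+ (A ℕ.+ M ℕ.* Tr (u * w))) % N                 ∎
    g[u+u₀]≡-gu : ∀ u → g (u + u₀) ≡ -ℤ g u
    g[u+u₀]≡-gu u = trans (ζ^-cong _ _ (shifted u) t) (ζ^-M+ _ t)

  trace-orthogonality-0 : ∀ A t → ℤΣ.Σ elems (λ u → ζ^ (A ℕ.+ M ℕ.* Tr (u * 0#)) t) ≡ + q *ℤ ζ^ A t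
  trace-orthogonality-0 A t = begin
    ℤΣ.Σ elems (λ u → ζ^ (A ℕ.+ M ℕ.* Tr (u * 0#)) t)   ≡⟨ ℤΣ.Σ-cong elems (λ u → cong (λ z → ζ^ z t) (A+M·Tr[u0]≡A u)) ⟩
    ℤΣ.Σ elems (λ _ → ζ^ A t)                           ≡⟨ ℤΣ-const elems _ ⟩
    + length elems *ℤ ζ^ A t                            ≡⟨ cong (λ z → + z *ℤ ζ^ A t) length-elems ⟩
    + q *ℤ ζ^ A t                                       ∎
    where
    A+M·Tr[u0]≡A : ∀ u → A ℕ.+ M ℕ.* Tr (u * 0#) ≡ A
    A+M·Tr[u0]≡A u = trans (cong (λ z → A ℕ.+ M ℕ.* Tr z) (zeroʳ u))
                     (trans (cong (λ z → A ℕ.+ M ℕ.* z) Tr-0) (trans (cong (A ℕ.+_) (ℕP.*-zeroʳ M)) (ℕP.+-identityʳ A)))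

  trace-orthogonality : ∀ A w t → ℤΣ.Σ elems (λ u → ζ^ (A ℕ.+ M ℕ.* Tr (u * w)) t) ≡ (if does (w ≟ 0#) then + q *ℤ ζ^ A t else + 0)
  trace-orthogonality A w t with w ≟ 0#
  ... | yes refl = trace-orthogonality-0 A t
  ... | no w≢0   = trace-orthogonality-≢0 A w w≢0 t

  [x+w≟0]≡[x≟w] : ∀ x w (v : ℤ) → (if does ((x + w) ≟ 0#) then v else + 0) ≡ (if does (x ≟ w) then v else + 0)
  [x+w≟0]≡[x≟w] x w v with (x + w) ≟ 0# | x ≟ w
  ... | yes _     | yes _    = refl
  ... | no _      | no _     = refl
  ... | yes x+w≡0 | no x≢w   = contradiction (x+y≡0⇒x≡y x w x+w≡0) x≢w
  ... | no x+x≢0  | yes refl = contradiction (x+x≡0 x) x+x≢0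

  bodyDiff : (F → Zk k) → Zk k → F → F → ℕ
  bodyDiff f c x y = bodyExp f c x ℕ.+ negExp (bodyExp f c y)

  twisted-exponent : ∀ f c z u x y →
    M ℕ.* Tr (u * z) ℕ.+ (summandExp 𝔽 k f c u x ℕ.+ negExp (summandExp 𝔽 k f c u y))
      ≡ₘ bodyDiff f c x y ℕ.+ M ℕ.* Tr (u * (x + (y + z)))
  twisted-exponent f c z u x y = begin
    (M ℕ.* Tr (u * z) ℕ.+ (summandExp 𝔽 k f c u x ℕ.+ negExp (summandExp 𝔽 k f c u y))) % N
      ≡⟨ +-congₘ {M ℕ.* Tr (u * z)} refl (summandExp-difference f c u x y) ⟩
    (M ℕ.* Tr (u * z) ℕ.+ (M ℕ.* Tr (u * (x + y)) ℕ.+ bodyDiff f c x y)) % N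
      ≡⟨ cong (_% N) (regroup (M ℕ.* Tr (u * z)) (M ℕ.* Tr (u * (x + y))) (bodyDiff f c x y)) ⟩
    (bodyDiff f c x y ℕ.+ (M ℕ.* Tr (u * (x + y)) ℕ.+ M ℕ.* Tr (u * z))) % N
      ≡⟨ +-congₘ {bodyDiff f c x y} refl (symₘ (M·Tr-+ (u * (x + y)) (u * z))) ⟩
    (bodyDiff f c x y ℕ.+ M ℕ.* Tr (u * (x + y) + u * z)) % N
      ≡⟨ cong (λ w → (bodyDiff f c x y ℕ.+ M ℕ.* Tr w) % N) (trans (sym (distribˡ u (x + y) z)) (cong (u *_) (+-assoc x y z))) ⟩
    (bodyDiff f c x y ℕ.+ M ℕ.* Tr (u * (x + (y + z)))) % N
      ∎
    where
    regroup : ∀ a t B → a ℕ.+ (t ℕ.+ B) ≡ B ℕ.+ (t ℕ.+ a)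
    regroup = solve-∀

  -- Averaging |𝒦 f c u|² against the character u ↦ (-1)^Tr(u z) picks out the pairs x = y + z.
  Σ-twisted-normSq : ∀ f c z t →
    ℤΣ.Σ elems (λ u → (ζ^ (M ℕ.* Tr (u * z)) ⊗ normSq (𝒦 𝔽 k f c u)) t) ≡ + q *ℤ ℤΣ.Σ elems (λ y → ζ^ (bodyDiff f c (y + z) y) t)
  Σ-twisted-normSq f c z t = begin
    ℤΣ.Σ elems (λ u → (ζ^ (a u) ⊗ normSq (𝒦 𝔽 k f c u)) t)
      ≡⟨ ℤΣ.Σ-cong elems (λ u → ⊗-cong {ζ^ (a u)} (λ _ → refl) (normSq-ζSum elems (E u)) t) ⟩
    ℤΣ.Σ elems (λ u → (ζ^ (a u) ⊗ sumC (map (λ x → ζSum elems (λ y → E u x ℕ.+ negExp (E u y))) elems)) t)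
      ≡⟨ ℤΣ.Σ-cong elems (λ u → trans (⊗-sumʳ (ζ^ (a u)) elems _ t) (sumC-apply elems _ t)) ⟩
    ℤΣ.Σ elems (λ u → ℤΣ.Σ elems (λ x → (ζ^ (a u) ⊗ ζSum elems (λ y → E u x ℕ.+ negExp (E u y))) t))
      ≡⟨ ℤΣ.Σ-cong elems (λ u → ℤΣ.Σ-cong elems (λ x → trans (ζ^⊗ζSum (a u) elems _ t) (ζSum-apply elems _ t))) ⟩
    ℤΣ.Σ elems (λ u → ℤΣ.Σ elems (λ x → ℤΣ.Σ elems (λ y → ζ^ (a u ℕ.+ (E u x ℕ.+ negExp (E u y))) t)))
      ≡⟨ ℤΣ.Σ-cong elems (λ u → ℤΣ.Σ-cong elems (λ x → ℤΣ.Σ-cong elems (λ y → ζ^-cong _ _ (twisted-exponent f c z u x y) t))) ⟩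
    ℤΣ.Σ elems (λ u → ℤΣ.Σ elems (λ x → ℤΣ.Σ elems (λ y → ζ^ (bodyDiff f c x y ℕ.+ M ℕ.* Tr (u * (x + (y + z)))) t)))
      ≡⟨ trans (ℤΣ.Σ-comm elems elems _) (ℤΣ.Σ-cong elems (λ x → ℤΣ.Σ-comm elems elems _)) ⟩
    ℤΣ.Σ elems (λ x → ℤΣ.Σ elems (λ y → ℤΣ.Σ elems (λ u → ζ^ (bodyDiff f c x y ℕ.+ M ℕ.* Tr (u * (x + (y + z)))) t)))
      ≡⟨ ℤΣ.Σ-cong elems (λ x → ℤΣ.Σ-cong elems (λ y →
           trans (trace-orthogonality (bodyDiff f c x y) (x + (y + z)) t) ([x+w≟0]≡[x≟w] x (y + z) _))) ⟩
    ℤΣ.Σ elems (λ x → ℤΣ.Σ elems (λ y → if does (x ≟ (y + z)) then + q *ℤ ζ^ (bodyDiff f c x y) t else + 0))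
      ≡⟨ ℤΣ.Σ-comm elems elems _ ⟩
    ℤΣ.Σ elems (λ y → ℤΣ.Σ elems (λ x → if does (x ≟ (y + z)) then + q *ℤ ζ^ (bodyDiff f c x y) t else + 0))
      ≡⟨ ℤΣ.Σ-cong elems (λ y → ℤΣ.Σ-select _≟_ elems (y + z) (λ x → + q *ℤ ζ^ (bodyDiff f c x y) t) elems-unique (∈-elems (y + z))) ⟩
    ℤΣ.Σ elems (λ y → + q *ℤ ζ^ (bodyDiff f c (y + z) y) t)
      ≡⟨ ℤΣ-*ˡ elems _ (+ q) ⟩
    + q *ℤ ℤΣ.Σ elems (λ y → ζ^ (bodyDiff f c (y + z) y) t)
      ∎
    where
    E : F → F → ℕ
    E u x = summandExp 𝔽 k f c u x
    a : F → ℕ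
    a u = M ℕ.* Tr (u * z)

  negaBent⇒Σ-derivative≡0 : ∀ f c → (∀ u t → normSq (𝒦 𝔽 k f c u) t ≡ const (+ q) t) → ∀ z → z ≢ 0# → ∀ t →
                              ℤΣ.Σ elems (λ y → ζ^ (negaExp c z ℕ.+ 4 ℕ.* (toℕ c ℕ.* deriv f z y)) t) ≡ + 0
  negaBent⇒Σ-derivative≡0 f c flat z z≢0 t =
    trans (ℤΣ.Σ-cong elems (λ y → ζ^-cong _ _ (symₘ (bodyExp-difference f c y z)) t))
          (ℤP.*-cancelˡ-≡ (+ q) _ (+ 0) (trans (sym (Σ-twisted-normSq f c z t)) flat-side))
    where
    flat-side : ℤΣ.Σ elems (λ u → (ζ^ (M ℕ.* Tr (u * z)) ⊗ normSq (𝒦 𝔽 k f c u)) t) ≡ + q *ℤ + 0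
    flat-side = begin
      ℤΣ.Σ elems (λ u → (ζ^ (M ℕ.* Tr (u * z)) ⊗ normSq (𝒦 𝔽 k f c u)) t)
        ≡⟨ ℤΣ.Σ-cong elems (λ u → trans (⊗-cong {ζ^ (M ℕ.* Tr (u * z))} (λ _ → refl) (flat u) t) (ζ^⊗const _ (+ q) t)) ⟩
      ℤΣ.Σ elems (λ u → + q *ℤ ζ^ (M ℕ.* Tr (u * z)) t)    ≡⟨ ℤΣ-*ˡ elems _ (+ q) ⟩
      + q *ℤ ℤΣ.Σ elems (λ u → ζ^ (0 ℕ.+ M ℕ.* Tr (u * z)) t) ≡⟨ cong (+ q *ℤ_) (trace-orthogonality-≢0 0 z z≢0 t) ⟩
      + q *ℤ + 0                                            ∎

  -- The character sums compared below are rational integers, so their constant coefficients suffice.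
  coeff₀ : Fin M
  coeff₀ = fromℕ< (ℕP.m^n>0 2 (suc k))

  ζ^0-coeff₀ : ζ^ 0 coeff₀ ≡ + 1
  ζ^0-coeff₀ = trans (ζ^0≈1 coeff₀) const1-coeff₀
    where
    const1-coeff₀ : const (+ 1) coeff₀ ≡ + 1
    const1-coeff₀ rewrite FinP.toℕ-fromℕ< (ℕP.m^n>0 2 (suc k)) = refl

  derivFibre : (F → Zk k) → F → Zk k → ℕ
  derivFibre f z = fibre elems (derivFun 𝔽 k f z)

  module _ (f : F → Zk k) (z : F) (b : Zk k) where

    -- deriv f z y - b, kept in ℕ by adding K.
    shiftedDeriv : F → ℕ
    shiftedDeriv y = deriv f z y ℕ.+ (K ∸ toℕ b)

    Σ-characters-indicator : ∀ y → ℤΣ.Σ (upTo K) (λ c → ζ^ (4 ℕ.* (c ℕ.* shiftedDeriv y)) coeff₀)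
                                   ≡ (if does (derivFun 𝔽 k f z y FinP.≟ b) then + K else + 0)
    Σ-characters-indicator y with derivFun 𝔽 k f z y FinP.≟ b
    ... | yes refl = begin
      ℤΣ.Σ (upTo K) (λ c → ζ^ (4 ℕ.* (c ℕ.* shiftedDeriv y)) coeff₀)
        ≡⟨ ℤΣ.Σ-cong (upTo K) (λ c → trans (ζ^-cong _ 0 (vanishes c) coeff₀) ζ^0-coeff₀) ⟩
      ℤΣ.Σ (upTo K) (λ _ → + 1)                                       ≡⟨ ℤΣ-const (upTo K) (+ 1) ⟩
      + length (upTo K) *ℤ + 1                                         ≡⟨ ℤP.*-identityʳ _ ⟩
      + length (upTo K)                                                ≡⟨ cong +_ (ListP.length-upTo K) ⟩
      + K                                                              ∎
      where
      shiftedDeriv≡K : shiftedDeriv y ≡ K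
      shiftedDeriv≡K = ℕP.m+[n∸m]≡n (ℕP.<⇒≤ (FinP.toℕ<n b))
      expand : ∀ c K → 4 ℕ.* (c ℕ.* K) ≡ 0 ℕ.+ c ℕ.* (2 ℕ.* (2 ℕ.* K))
      expand = solve-∀
      vanishes : ∀ c → 4 ℕ.* (c ℕ.* shiftedDeriv y) ≡ₘ 0
      vanishes c = transₘ (≡⇒≡ₘ (trans (cong (λ x → 4 ℕ.* (c ℕ.* x)) shiftedDeriv≡K) (expand c K))) (+-multipleₘ 0 c)
    ... | no deriv≢b = begin
      ℤΣ.Σ (upTo K) (λ c → ζ^ (4 ℕ.* (c ℕ.* shiftedDeriv y)) coeff₀)  ≡⟨ ℤΣ.Σ-cong (upTo K) (λ c → ζ^-cong _ _ (reduce c) coeff₀) ⟩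
      ℤΣ.Σ (upTo K) (λ c → ζ^ (0 ℕ.+ (4 ℕ.* r) ℕ.* c) coeff₀)          ≡⟨ Σ-ζ^[A+4cb]≡0 r 0<r (m%n<n (shiftedDeriv y) K) 0 coeff₀ ⟩
      + 0                                                              ∎
      where
      r : ℕ
      r = shiftedDeriv y % K
      r≡0⇒deriv≡b : r ≡ 0 → deriv f z y ≡ toℕ b
      r≡0⇒deriv≡b r≡0 = begin
        deriv f z y                                     ≡⟨ m<n⇒m%n≡m (FinP.toℕ<n (derivFun 𝔽 k f z y)) ⟨
        deriv f z y % K                                 ≡⟨ [m+n]%n≡m%n (deriv f z y) K ⟨
        (deriv f z y ℕ.+ K) % K                         ≡⟨ cong (λ x → (deriv f z y ℕ.+ x) % K) (ℕP.m∸n+n≡m (ℕP.<⇒≤ (FinP.toℕ<n b))) ⟨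
        (deriv f z y ℕ.+ ((K ∸ toℕ b) ℕ.+ toℕ b)) % K   ≡⟨ cong (_% K) (ℕP.+-assoc (deriv f z y) _ _) ⟨
        (shiftedDeriv y ℕ.+ toℕ b) % K                  ≡⟨ %-distribˡ-+ (shiftedDeriv y) (toℕ b) K ⟩
        (r ℕ.+ toℕ b % K) % K                           ≡⟨ cong (λ x → (x ℕ.+ toℕ b % K) % K) r≡0 ⟩
        (toℕ b % K) % K                                 ≡⟨ m%n%n≡m%n (toℕ b) K ⟩
        toℕ b % K                                       ≡⟨ m<n⇒m%n≡m (FinP.toℕ<n b) ⟩
        toℕ b                                           ∎
      0<r : 0 < r
      0<r with r | r≡0⇒deriv≡b
      ... | zero  | deriv≡b = ⊥-elim (deriv≢b (FinP.toℕ-injective (deriv≡b refl)))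
      ... | suc _ | _       = s≤s z≤n
      expand : ∀ c r q K → 4 ℕ.* (c ℕ.* (r ℕ.+ q ℕ.* K)) ≡ (0 ℕ.+ (4 ℕ.* r) ℕ.* c) ℕ.+ (c ℕ.* q) ℕ.* (2 ℕ.* (2 ℕ.* K))
      expand = solve-∀
      reduce : ∀ c → 4 ℕ.* (c ℕ.* shiftedDeriv y) ≡ₘ 0 ℕ.+ (4 ℕ.* r) ℕ.* c
      reduce c = transₘ (≡⇒≡ₘ (trans (cong (λ x → 4 ℕ.* (c ℕ.* x)) (m≡m%n+[m/n]*n (shiftedDeriv y) K))
                                     (expand c r (shiftedDeriv y / K) K)))
                        (+-multipleₘ _ (c ℕ.* (shiftedDeriv y / K)))

    Σ-characters-Σ-derivative : ℤΣ.Σ (upTo K) (λ c → ℤΣ.Σ elems (λ y → ζ^ (4 ℕ.* (c ℕ.* shiftedDeriv y)) coeff₀))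
                                ≡ + derivFibre f z b *ℤ + K
    Σ-characters-Σ-derivative =
      trans (ℤΣ.Σ-comm (upTo K) elems _) (trans (ℤΣ.Σ-cong elems Σ-characters-indicator) (ℤΣ-indicator elems _ (+ K)))

    Σ-derivative-shifted≡0 : IsNegaBent 𝔽 k f → z ≢ 0# → ∀ c → 0 < c → c < K →
                             ℤΣ.Σ elems (λ y → ζ^ (4 ℕ.* (c ℕ.* shiftedDeriv y)) coeff₀) ≡ + 0
    Σ-derivative-shifted≡0 negaBent z≢0 c 0<c c<K = begin
      ℤΣ.Σ elems (λ y → ζ^ (4 ℕ.* (c ℕ.* shiftedDeriv y)) coeff₀)
        ≡⟨ ℤΣ.Σ-cong elems (λ y → cong (λ x → ζ^ x coeff₀) (split y)) ⟩
      ℤΣ.Σ elems (λ y → ζ^ (4 ℕ.* (c ℕ.* (K ∸ toℕ b)) ℕ.+ 4 ℕ.* (toℕ c′ ℕ.* deriv f z y)) coeff₀)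
        ≡⟨ ζSum-apply elems _ coeff₀ ⟨
      ζSum elems (λ y → 4 ℕ.* (c ℕ.* (K ∸ toℕ b)) ℕ.+ 4 ℕ.* (toℕ c′ ℕ.* deriv f z y)) coeff₀
        ≡⟨ ζSum-vanish-shift elems (λ y → 4 ℕ.* (toℕ c′ ℕ.* deriv f z y)) (negaExp c′ z) vanish (4 ℕ.* (c ℕ.* (K ∸ toℕ b))) coeff₀ ⟩
      + 0
        ∎
      where
      c′ : Zk k
      c′ = fromℕ< c<K
      c′≢0 : toℕ c′ ≢ 0
      c′≢0 c′≡0 = ℕP.<⇒≢ 0<c (sym (trans (sym (FinP.toℕ-fromℕ< c<K)) c′≡0))
      vanish : ζSum elems (λ y → negaExp c′ z ℕ.+ 4 ℕ.* (toℕ c′ ℕ.* deriv f z y)) ≈ zeroC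
      vanish t = trans (ζSum-apply elems _ t) (negaBent⇒Σ-derivative≡0 f c′ (negaBent c′ c′≢0) z z≢0 t)
      distrib : ∀ c D Kb → 4 ℕ.* (c ℕ.* (D ℕ.+ Kb)) ≡ 4 ℕ.* (c ℕ.* Kb) ℕ.+ 4 ℕ.* (c ℕ.* D)
      distrib = solve-∀
      split : ∀ y → 4 ℕ.* (c ℕ.* shiftedDeriv y) ≡ 4 ℕ.* (c ℕ.* (K ∸ toℕ b)) ℕ.+ 4 ℕ.* (toℕ c′ ℕ.* deriv f z y)
      split y = trans (distrib c (deriv f z y) (K ∸ toℕ b))
                      (cong (λ x → 4 ℕ.* (c ℕ.* (K ∸ toℕ b)) ℕ.+ 4 ℕ.* (x ℕ.* deriv f z y)) (sym (FinP.toℕ-fromℕ< c<K)))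

    -- Only the trivial character c = 0 contributes.
    negaBent⇒Σ-characters-Σ-derivative≡q : IsNegaBent 𝔽 k f → z ≢ 0# →
      ℤΣ.Σ (upTo K) (λ c → ℤΣ.Σ elems (λ y → ζ^ (4 ℕ.* (c ℕ.* shiftedDeriv y)) coeff₀)) ≡ + q
    negaBent⇒Σ-characters-Σ-derivative≡q negaBent z≢0 = begin
      ℤΣ.Σ (upTo K) h                               ≡⟨ cong (λ X → ℤΣ.Σ (upTo X) h) (ℕP.suc-pred K) ⟨
      ℤΣ.Σ (upTo (suc K′)) h                        ≡⟨ ℤΣ.Σ-upTo-suc K′ h ⟩
      h 0 +ℤ ℤΣ.Σ (upTo K′) (λ i → h (suc i))       ≡⟨ cong₂ _+ℤ_ h0≡q (trans (ℤΣ.Σ-cong-∈ (upTo K′) h[1+i]≡0) (ℤΣ.Σ-ε (upTo K′))) ⟩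
      + q +ℤ + 0                                    ≡⟨ ℤP.+-identityʳ _ ⟩
      + q                                           ∎
      where
      h : ℕ → ℤ
      h c = ℤΣ.Σ elems (λ y → ζ^ (4 ℕ.* (c ℕ.* shiftedDeriv y)) coeff₀)
      K′ : ℕ
      K′ = ℕ.pred K
      h0≡q : h 0 ≡ + q
      h0≡q = trans (ℤΣ-const elems _) (trans (cong₂ (λ a b → + a *ℤ b) length-elems ζ^0-coeff₀) (ℤP.*-identityʳ (+ q)))
      h[1+i]≡0 : ∀ {i} → i ∈ upTo K′ → h (suc i) ≡ + 0
      h[1+i]≡0 {i} i∈ = Σ-derivative-shifted≡0 negaBent z≢0 (suc i) (s≤s z≤n) (subst (suc (suc i) ≤_) (ℕP.suc-pred K) (s≤s (∈P.∈-upTo⁻ i∈)))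

  negaBent⇒fibre-size : ∀ f → IsNegaBent 𝔽 k f → ∀ z → z ≢ 0# → ∀ b → derivFibre f z b ℕ.* K ≡ q
  negaBent⇒fibre-size f negaBent z z≢0 b = ℤP.+-injective (begin
    + (derivFibre f z b ℕ.* K)    ≡⟨ ℤP.pos-* (derivFibre f z b) K ⟩
    + derivFibre f z b *ℤ + K     ≡⟨ Σ-characters-Σ-derivative f z b ⟨
    _                             ≡⟨ negaBent⇒Σ-characters-Σ-derivative≡q f z b negaBent z≢0 ⟩
    + q                           ∎)

  negaBent⇒balanced : ∀ f → IsNegaBent 𝔽 k f → DerivativesBalanced f
  negaBent⇒balanced f negaBent z z≢0 a b = ℕP.*-cancelʳ-≡ (derivFibre f z a) (derivFibre f z b) K
    (trans (negaBent⇒fibre-size f negaBent z z≢0 a) (sym (negaBent⇒fibre-size f negaBent z z≢0 b)))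

  σ-0 : ∀ (c : Zk k) → σ 𝔽 k c 0# ≡ 0
  σ-0 c with parity (toℕ c)
  ... | inj₁ c-even = σ-even c 0# c-even
  ... | inj₂ c-odd  = trans (σ-odd c 0# c-odd) σ1-0

  M·Tr[u0]+negaExp-0≡0 : ∀ (c : Zk k) u → M ℕ.* Tr (u * 0#) ℕ.+ negaExp c 0# ≡ 0
  M·Tr[u0]+negaExp-0≡0 c u rewrite zeroʳ u | zeroʳ (c₀ 𝔽 k c) | Tr-0 | σ-0 c = vanish M K
    where
    vanish : ∀ M K → M ℕ.* 0 ℕ.+ (M ℕ.* 0 ℕ.+ K ℕ.* 0) ≡ 0
    vanish = solve-∀

  deriv-0 : ∀ f y → deriv f 0# y ≡ 0
  deriv-0 f y = trans (deriv≡ f 0# y) (trans (cong (_% K) f[y]+[K∸f[y]]+0≡K) (n%n≡0 K))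
    where
    f[y]+[K∸f[y]]+0≡K : toℕ (f (y + 0#)) ℕ.+ (K ∸ toℕ (f y)) ℕ.+ 2 ^ (k ∸ 1) ℕ.* Tr (0# * y) ≡ K
    f[y]+[K∸f[y]]+0≡K rewrite +-identityʳ y | zeroˡ y | Tr-0 =
      trans (cong (toℕ (f y) ℕ.+ (K ∸ toℕ (f y)) ℕ.+_) (ℕP.*-zeroʳ (2 ^ (k ∸ 1))))
            (trans (ℕP.+-identityʳ _) (ℕP.m+[n∸m]≡n (ℕP.<⇒≤ (FinP.toℕ<n (f y)))))

  -- Substituting x = w + y turns |𝒦|² into a sum over the derivatives in direction w.
  normSq-𝒦≡Σ-derivatives : ∀ f c u t →
    normSq (𝒦 𝔽 k f c u) t ≡ ℤΣ.Σ elems (λ w → ℤΣ.Σ elems (λ y →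
                               ζ^ (M ℕ.* Tr (u * w) ℕ.+ negaExp c w ℕ.+ 4 ℕ.* (toℕ c ℕ.* deriv f w y)) t))
  normSq-𝒦≡Σ-derivatives f c u t = begin
    normSq (ζSum elems E) t
      ≡⟨ normSq-ζSum elems E t ⟩
    sumC (map (λ x → ζSum elems (λ y → E x ℕ.+ negExp (E y))) elems) t
      ≡⟨ trans (sumC-apply elems _ t) (ℤΣ.Σ-cong elems (λ x → ζSum-apply elems _ t)) ⟩
    ℤΣ.Σ elems (λ x → ℤΣ.Σ elems (λ y → ζ^ (E x ℕ.+ negExp (E y)) t))
      ≡⟨ ℤΣ.Σ-comm elems elems _ ⟩
    ℤΣ.Σ elems (λ y → ℤΣ.Σ elems (λ x → ζ^ (E x ℕ.+ negExp (E y)) t))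
      ≡⟨ ℤΣ.Σ-cong elems (λ y → ElemsSum.Σ-elems-translate ℤP.+-0-isCommutativeMonoid y (λ x → ζ^ (E x ℕ.+ negExp (E y)) t)) ⟨
    ℤΣ.Σ elems (λ y → ℤΣ.Σ elems (λ w → ζ^ (E (w + y) ℕ.+ negExp (E y)) t))
      ≡⟨ ℤΣ.Σ-comm elems elems _ ⟩
    ℤΣ.Σ elems (λ w → ℤΣ.Σ elems (λ y → ζ^ (E (w + y) ℕ.+ negExp (E y)) t))
      ≡⟨ ℤΣ.Σ-cong elems (λ w → ℤΣ.Σ-cong elems (λ y → ζ^-cong _ _ (exponent w y) t)) ⟩
    ℤΣ.Σ elems (λ w → ℤΣ.Σ elems (λ y → ζ^ (M ℕ.* Tr (u * w) ℕ.+ negaExp c w ℕ.+ 4 ℕ.* (toℕ c ℕ.* deriv f w y)) t))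
      ∎
    where
    E : F → ℕ
    E x = summandExp 𝔽 k f c u x
    exponent : ∀ w y → E (w + y) ℕ.+ negExp (E y) ≡ₘ M ℕ.* Tr (u * w) ℕ.+ negaExp c w ℕ.+ 4 ℕ.* (toℕ c ℕ.* deriv f w y)
    exponent w y = begin
      (E (w + y) ℕ.+ negExp (E y)) % N
        ≡⟨ summandExp-difference f c u (w + y) y ⟩
      (M ℕ.* Tr (u * ((w + y) + y)) ℕ.+ bodyDiff f c (w + y) y) % N
        ≡⟨ cong₂ (λ a b → (M ℕ.* Tr (u * a) ℕ.+ bodyDiff f c b y) % N) ([x+a]+a≡x y w) (+-comm w y) ⟩
      (M ℕ.* Tr (u * w) ℕ.+ bodyDiff f c (y + w) y) % N
        ≡⟨ +-congₘ {M ℕ.* Tr (u * w)} refl (bodyExp-difference f c y w) ⟩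
      (M ℕ.* Tr (u * w) ℕ.+ (negaExp c w ℕ.+ 4 ℕ.* (toℕ c ℕ.* deriv f w y))) % N
        ≡⟨ cong (_% N) (ℕP.+-assoc (M ℕ.* Tr (u * w)) (negaExp c w) _) ⟨
      (M ℕ.* Tr (u * w) ℕ.+ negaExp c w ℕ.+ 4 ℕ.* (toℕ c ℕ.* deriv f w y)) % N
        ∎

  -- A balanced derivative takes each value b equally often, and Σ_b ζ^(4 c b) = 0 for c ≢ 0.
  balanced⇒Σ-derivative≡0 : ∀ f (c : Zk k) → toℕ c ≢ 0 → ∀ w → IsBalanced 𝔽 k (derivFun 𝔽 k f w) → ∀ A t →
                             ℤΣ.Σ elems (λ y → ζ^ (A ℕ.+ 4 ℕ.* (toℕ c ℕ.* deriv f w y)) t) ≡ + 0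
  balanced⇒Σ-derivative≡0 f c c≢0 w balanced A t = begin
    ℤΣ.Σ elems (λ y → h (derivFun 𝔽 k f w y))                  ≡⟨ ℤΣ-fibres elems (derivFun 𝔽 k f w) h ⟩
    ℤΣ.Σ (allFin K) (λ b → + derivFibre f w b *ℤ h b)          ≡⟨ ℤΣ.Σ-cong (allFin K) (λ b → cong (λ x → + x *ℤ h b) (balanced b 0ᴷ)) ⟩
    ℤΣ.Σ (allFin K) (λ b → + derivFibre f w 0ᴷ *ℤ h b)         ≡⟨ ℤΣ-*ˡ (allFin K) h (+ derivFibre f w 0ᴷ) ⟩
    + derivFibre f w 0ᴷ *ℤ ℤΣ.Σ (allFin K) h                   ≡⟨ cong (+ derivFibre f w 0ᴷ *ℤ_) Σh≡0 ⟩
    + derivFibre f w 0ᴷ *ℤ + 0                                 ≡⟨ ℤP.*-zeroʳ (+ derivFibre f w 0ᴷ) ⟩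
    + 0                                                        ∎
    where
    0ᴷ : Zk k
    0ᴷ = fromℕ< (ℕP.m^n>0 2 k)
    h : Zk k → ℤ
    h b = ζ^ (A ℕ.+ 4 ℕ.* (toℕ c ℕ.* toℕ b)) t
    Σh≡0 : ℤΣ.Σ (allFin K) h ≡ + 0
    Σh≡0 = begin
      ℤΣ.Σ (allFin K) h                                          ≡⟨ ℤΣ.Σ-allFin-toℕ K (λ b → ζ^ (A ℕ.+ 4 ℕ.* (toℕ c ℕ.* b)) t) ⟩
      ℤΣ.Σ (upTo K) (λ b → ζ^ (A ℕ.+ 4 ℕ.* (toℕ c ℕ.* b)) t)     ≡⟨ ℤΣ.Σ-cong (upTo K) (λ b → cong (λ x → ζ^ (A ℕ.+ x) t) (ℕP.*-assoc 4 (toℕ c) b)) ⟨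
      ℤΣ.Σ (upTo K) (λ b → ζ^ (A ℕ.+ 4 ℕ.* toℕ c ℕ.* b) t)       ≡⟨ Σ-ζ^[A+4cb]≡0 (toℕ c) (ℕP.n≢0⇒n>0 c≢0) (FinP.toℕ<n c) A t ⟩
      + 0                                                        ∎

  balanced⇒negaBent : ∀ f → DerivativesBalanced f → IsNegaBent 𝔽 k f
  balanced⇒negaBent f balanced c c≢0 u t = begin
    normSq (𝒦 𝔽 k f c u) t
      ≡⟨ normSq-𝒦≡Σ-derivatives f c u t ⟩
    ℤΣ.Σ elems (λ w → ℤΣ.Σ elems (λ y → ζ^ (M ℕ.* Tr (u * w) ℕ.+ negaExp c w ℕ.+ 4 ℕ.* (toℕ c ℕ.* deriv f w y)) t))
      ≡⟨ ℤΣ.Σ-cong elems only-w≡0 ⟩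
    ℤΣ.Σ elems (λ w → if does (w ≟ 0#) then + q *ℤ ζ^ 0 t else + 0)
      ≡⟨ ℤΣ.Σ-select _≟_ elems 0# (λ _ → + q *ℤ ζ^ 0 t) elems-unique (∈-elems 0#) ⟩
    + q *ℤ ζ^ 0 t
      ≡⟨ cong (+ q *ℤ_) (ζ^0≈1 t) ⟩
    + q *ℤ const (+ 1) t
      ≡⟨ q*const1≡const-q ⟩
    const (+ q) t
      ∎
    where
    q*const1≡const-q : + q *ℤ const (+ 1) t ≡ const (+ q) t
    q*const1≡const-q with toℕ t
    ... | zero  = ℤP.*-identityʳ (+ q)
    ... | suc _ = ℤP.*-zeroʳ (+ q)
    vanish : ∀ c x → 0 ℕ.+ 4 ℕ.* (c ℕ.* 0) ≡ x ℕ.* 0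
    vanish = solve-∀
    only-w≡0 : ∀ w → ℤΣ.Σ elems (λ y → ζ^ (M ℕ.* Tr (u * w) ℕ.+ negaExp c w ℕ.+ 4 ℕ.* (toℕ c ℕ.* deriv f w y)) t)
                   ≡ (if does (w ≟ 0#) then + q *ℤ ζ^ 0 t else + 0)
    only-w≡0 w with w ≟ 0#
    ... | no w≢0   = balanced⇒Σ-derivative≡0 f c c≢0 w (balanced w w≢0) (M ℕ.* Tr (u * w) ℕ.+ negaExp c w) t
    ... | yes refl = begin
      ℤΣ.Σ elems (λ y → ζ^ (M ℕ.* Tr (u * 0#) ℕ.+ negaExp c 0# ℕ.+ 4 ℕ.* (toℕ c ℕ.* deriv f 0# y)) t)
        ≡⟨ ℤΣ.Σ-cong elems (λ y → cong (λ x → ζ^ x t)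
             (trans (cong₂ (λ a b → a ℕ.+ 4 ℕ.* (toℕ c ℕ.* b)) (M·Tr[u0]+negaExp-0≡0 c u) (deriv-0 f y)) (vanish (toℕ c) 0))) ⟩
      ℤΣ.Σ elems (λ _ → ζ^ 0 t)         ≡⟨ ℤΣ-const elems _ ⟩
      + length elems *ℤ ζ^ 0 t          ≡⟨ cong (λ a → + a *ℤ ζ^ 0 t) length-elems ⟩
      + q *ℤ ζ^ 0 t                     ∎

module RelativeDifferenceSet {n : ℕ} (𝔽 : GF n) (k : ℕ) (k≥1 : 1 ≤ k) where
  open FiniteField 𝔽
  open CharacterSums k using (K)
  open NegaBentExponents 𝔽 k k≥1 using (K≢0; deriv≡; Tr-0)
  open NegaBentCharacterisation 𝔽 k k≥1 using (DerivativesBalanced; derivFibre; deriv-0)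
  open Congruence K
  open ≡-Reasoning

  h : ℕ
  h = 2 ^ (k ∸ 1)

  2h≡K : 2 ℕ.* h ≡ K
  2h≡K = cong (2 ^_) (ℕP.m+[n∸m]≡n k≥1)

  graphDifference : (F → Zk k) → F → F → Zk k
  graphDifference f x₁ x₂ = proj₂ ((_+⋆_ 𝔽 k) (x₁ , f x₁) ((-⋆_ 𝔽 k) (x₂ , f x₂)))

  toZk-cong : ∀ X Y → X ≡ₘ Y → toZk k X ≡ toZk k Y
  toZk-cong X Y X≡Y = FinP.toℕ-injective (trans (FinP.toℕ-fromℕ< _) (trans X≡Y (sym (FinP.toℕ-fromℕ< _))))

  -- For x₁ = y + z and x₂ = y the cocycle term h · Tr((y + z) y) = h · Tr(y²) + h · Tr(z y)
  -- cancels the h · Tr(y²) in -⋆ (y , f y).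
  graphDifference≡derivFun : ∀ f y z → graphDifference f (y + z) y ≡ derivFun 𝔽 k f z y
  graphDifference≡derivFun f y z = toZk-cong _ _ (begin
    (fyz ℕ.+ toℕ (toZk k Y) ℕ.+ h ℕ.* Tr ((y + z) * (- y))) % K
      ≡⟨ +-congₘ {fyz ℕ.+ toℕ (toZk k Y)} (+-congₘ {fyz} refl (transₘ (≡⇒≡ₘ (FinP.toℕ-fromℕ< _)) (%-≡ₘ Y)))
                                          (≡⇒≡ₘ Tr[[y+z][-y]]≡bit[s+t]) ⟩
    (fyz ℕ.+ (K∸fy ℕ.+ K∸hTy²) ℕ.+ h ℕ.* bit (s + t)) % K
      ≡⟨ +-multipleₘ _ (bs ℕ.* bt) ⟨
    (fyz ℕ.+ (K∸fy ℕ.+ K∸hTy²) ℕ.+ h ℕ.* bit (s + t) ℕ.+ bs ℕ.* bt ℕ.* K) % K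
      ≡⟨ cong (_% K) (r₁ fyz K∸fy K∸hTy² (h ℕ.* bit (s + t)) K (bs ℕ.* bt)) ⟩
    (fyz ℕ.+ K∸fy ℕ.+ K∸hTy² ℕ.+ (h ℕ.* bit (s + t) ℕ.+ K ℕ.* (bs ℕ.* bt))) % K
      ≡⟨ cong (λ x → (fyz ℕ.+ K∸fy ℕ.+ K∸hTy² ℕ.+ x) % K) carry ⟩
    (fyz ℕ.+ K∸fy ℕ.+ K∸hTy² ℕ.+ (h ℕ.* Ty² ℕ.+ h ℕ.* bt)) % K
      ≡⟨ cong (_% K) (r₂ fyz K∸fy K∸hTy² (h ℕ.* Ty²) (h ℕ.* bt)) ⟩
    (fyz ℕ.+ K∸fy ℕ.+ h ℕ.* bt ℕ.+ (K∸hTy² ℕ.+ h ℕ.* Ty²)) % K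
      ≡⟨ cong (λ x → (fyz ℕ.+ K∸fy ℕ.+ h ℕ.* bt ℕ.+ x) % K) (trans (ℕP.m∸n+n≡m hTy²≤K) (sym (ℕP.*-identityˡ K))) ⟩
    (fyz ℕ.+ K∸fy ℕ.+ h ℕ.* bt ℕ.+ 1 ℕ.* K) % K
      ≡⟨ +-multipleₘ _ 1 ⟩
    (fyz ℕ.+ K∸fy ℕ.+ h ℕ.* Tr (z * y)) % K
      ∎)
    where
    fyz : ℕ
    fyz = toℕ (f (y + z))
    K∸fy : ℕ
    K∸fy = K ∸ toℕ (f y)
    s : F
    s = TrF (y * y)
    t : F
    t = TrF (z * y)
    bs : ℕ
    bs = bit s
    bt : ℕ
    bt = bit t
    Ty² : ℕ
    Ty² = Tr ((- y) * y)
    K∸hTy² : ℕ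
    K∸hTy² = K ∸ h ℕ.* Ty²
    Y : ℕ
    Y = K∸fy ℕ.+ K∸hTy²
    Tr[[y+z][-y]]≡bit[s+t] : h ℕ.* Tr ((y + z) * (- y)) ≡ h ℕ.* bit (s + t)
    Tr[[y+z][-y]]≡bit[s+t] = cong (λ w → h ℕ.* bit w)
      (trans (cong (λ w → TrF ((y + z) * w)) (-x≡x y)) (trans (cong TrF (distribʳ y y z)) (TrF-+ (y * y) (z * y))))
    hTy²≤K : h ℕ.* Ty² ≤ K
    hTy²≤K = ℕP.≤-trans (ℕP.*-monoʳ-≤ h (bit≤1 (TrF ((- y) * y))))
                       (subst (h ℕ.* 1 ≤_) 2h≡K (ℕP.≤-trans (ℕP.≤-reflexive (ℕP.*-identityʳ h)) (ℕP.m≤n*m h 2)))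
    carry : h ℕ.* bit (s + t) ℕ.+ K ℕ.* (bs ℕ.* bt) ≡ h ℕ.* Ty² ℕ.+ h ℕ.* bt
    carry = trans (cong (λ w → h ℕ.* bit (s + t) ℕ.+ w ℕ.* (bs ℕ.* bt)) (sym 2h≡K))
      (trans (m·bit-+ h s t (TrF-IsBit (y * y)) (TrF-IsBit (z * y))) (cong (λ w → h ℕ.* w ℕ.+ h ℕ.* bt) (sym (cong (λ w → Tr (w * y)) (-x≡x y)))))
    r₁ : ∀ a b c d K p → a ℕ.+ (b ℕ.+ c) ℕ.+ d ℕ.+ p ℕ.* K ≡ a ℕ.+ b ℕ.+ c ℕ.+ (d ℕ.+ K ℕ.* p)
    r₁ = solve-∀
    r₂ : ∀ a b c d e → a ℕ.+ b ℕ.+ c ℕ.+ (d ℕ.+ e) ≡ a ℕ.+ b ℕ.+ e ℕ.+ (c ℕ.+ d)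
    r₂ = solve-∀

  indicator-pair : ∀ (_≟ᴳ_ : DecidableEquality (F × Zk k)) (p z : F) (s a : Zk k) →
    indicator (does ((p , s) ≟ᴳ (z , a))) ≡ (if does (p ≟ z) then indicator (does (s FinP.≟ a)) else 0)
  indicator-pair _≟ᴳ_ p z s a with (p , s) ≟ᴳ (z , a) | p ≟ z | s FinP.≟ a
  ... | yes _    | yes _    | yes _    = refl
  ... | yes refl | no p≢p   | _        = contradiction refl p≢p
  ... | yes refl | yes _    | no s≢s   = contradiction refl s≢s
  ... | no _     | no _     | _        = refl
  ... | no _     | yes _    | no _     = refl
  ... | no ps≢ps | yes refl | yes refl = contradiction refl ps≢ps

  [x₁-x₂≟z]≡[x₂≟x₁+z] : ∀ x₁ x₂ z (v : ℕ) → (if does ((x₁ + - x₂) ≟ z) then v else 0) ≡ (if does (x₂ ≟ (x₁ + z)) then v else 0)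
  [x₁-x₂≟z]≡[x₂≟x₁+z] x₁ x₂ z v with (x₁ + - x₂) ≟ z | x₂ ≟ (x₁ + z)
  ... | yes _ | yes _ = refl
  ... | no _  | no _  = refl
  ... | yes x₁-x₂≡z | no x₂≢x₁+z = contradiction (+-cancelˡ x₁ x₂ (x₁ + z) (begin
    x₁ + x₂          ≡⟨ cong (_+_ x₁) (-x≡x x₂) ⟨
    x₁ + - x₂        ≡⟨ x₁-x₂≡z ⟩
    z                ≡⟨ x+[x+z]≡z x₁ z ⟨
    x₁ + (x₁ + z)    ∎)) x₂≢x₁+z
  ... | no x₁-x₂≢z | yes refl = contradiction (trans (cong (_+_ x₁) (-x≡x (x₁ + z))) (x+[x+z]≡z x₁ z)) x₁-x₂≢z

  diffCount-graph≡derivFibre : ∀ f z a →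
    diffCount (_≟G_ 𝔽 k) (_+⋆_ 𝔽 k) (-⋆_ 𝔽 k) (0G 𝔽 k) (graph 𝔽 k f) (z , a) ≡ derivFibre f z a
  diffCount-graph≡derivFibre f z a = begin
    count P (cartesianProduct R R)
      ≡⟨ count≡Σ-indicator P (cartesianProduct R R) ⟩
    ℕΣ.Σ (cartesianProduct R R) (λ p → indicator (P p))
      ≡⟨ ℕΣ.Σ-cartesianProduct R R _ ⟩
    ℕΣ.Σ R (λ r₁ → ℕΣ.Σ R (λ r₂ → indicator (P (r₁ , r₂))))
      ≡⟨ trans (ℕΣ.Σ-map _ elems _) (ℕΣ.Σ-cong elems (λ x₁ → ℕΣ.Σ-map _ elems _)) ⟩
    ℕΣ.Σ elems (λ x₁ → ℕΣ.Σ elems (λ x₂ → indicator (does ((_≟G_ 𝔽 k) (x₁ + - x₂ , graphDifference f x₁ x₂) (z , a)))))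
      ≡⟨ ℕΣ.Σ-cong elems (λ x₁ → ℕΣ.Σ-cong elems (λ x₂ →
           trans (indicator-pair (_≟G_ 𝔽 k) _ z _ a) ([x₁-x₂≟z]≡[x₂≟x₁+z] x₁ x₂ z _))) ⟩
    ℕΣ.Σ elems (λ x₁ → ℕΣ.Σ elems (λ x₂ → if does (x₂ ≟ (x₁ + z)) then indicator (does (graphDifference f x₁ x₂ FinP.≟ a)) else 0))
      ≡⟨ ℕΣ.Σ-cong elems (λ x₁ → ℕΣ.Σ-select _≟_ elems (x₁ + z) _ elems-unique (∈-elems _)) ⟩
    ℕΣ.Σ elems (λ x₁ → indicator (does (graphDifference f x₁ (x₁ + z) FinP.≟ a)))
      ≡⟨ ElemsSum.Σ-elems-translate ℕP.+-0-isCommutativeMonoid z (λ x₁ → indicator (does (graphDifference f x₁ (x₁ + z) FinP.≟ a))) ⟨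
    ℕΣ.Σ elems (λ y → indicator (does (graphDifference f (y + z) ((y + z) + z) FinP.≟ a)))
      ≡⟨ ℕΣ.Σ-cong elems (λ y → cong (λ w → indicator (does (w FinP.≟ a)))
           (trans (cong (graphDifference f (y + z)) ([x+a]+a≡x z y)) (graphDifference≡derivFun f y z))) ⟩
    ℕΣ.Σ elems (λ y → indicator (does (derivFun 𝔽 k f z y FinP.≟ a)))
      ≡⟨ count≡Σ-indicator _ elems ⟨
    derivFibre f z a
      ∎
    where
    R : List (F × Zk k)
    R = graph 𝔽 k f
    P : (F × Zk k) × (F × Zk k) → Bool
    P p = does ((_≟G_ 𝔽 k) ((_+⋆_ 𝔽 k) (proj₁ p) ((-⋆_ 𝔽 k) (proj₂ p))) (z , a))

  inN-≢0 : ∀ z a → z ≢ 0# → inN 𝔽 k (z , a) ≡ false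
  inN-≢0 z a z≢0 with z ≟ 0#
  ... | yes z≡0 = contradiction z≡0 z≢0
  ... | no _    = refl

  inN-true⇒≡0 : ∀ z a → inN 𝔽 k (z , a) ≡ true → z ≡ 0#
  inN-true⇒≡0 z a inN≡true with z ≟ 0#
  ... | yes z≡0 = z≡0
  inN-true⇒≡0 z a () | no _

  inN-false⇒≢0 : ∀ z a → inN 𝔽 k (z , a) ≡ false → z ≢ 0#
  inN-false⇒≢0 z a inN≡false z≡0 with z ≟ 0#
  inN-false⇒≢0 z a () z≡0 | yes _
  ... | no z≢0 = z≢0 z≡0

  K*c≡q⇒c≡2^[n∸k] : ∀ c → K ℕ.* c ≡ q → c ≡ 2 ^ (n ∸ k)
  K*c≡q⇒c≡2^[n∸k] c Kc≡q with k ℕP.≤? n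
  ... | yes k≤n = ℕP.*-cancelˡ-≡ c (2 ^ (n ∸ k)) K
                    (trans Kc≡q (trans (cong (2 ^_) (sym (ℕP.m+[n∸m]≡n k≤n))) (ℕP.^-distribˡ-+-* 2 k (n ∸ k))))
  ... | no k≰n with c
  ...   | zero   = ⊥-elim (ℕP.<⇒≢ (ℕP.m^n>0 2 n) (trans (sym (ℕP.*-zeroʳ K)) Kc≡q))
  ...   | suc c′ = ⊥-elim (ℕP.<⇒≱ (ℕP.^-monoʳ-< 2 (s≤s (s≤s z≤n)) (ℕP.≰⇒> k≰n)) (subst (K ≤_) Kc≡q (ℕP.m≤m*n K (suc c′))))

  balanced⇒K*fibre≡q : ∀ f z a → (∀ b → derivFibre f z b ≡ derivFibre f z a) → K ℕ.* derivFibre f z a ≡ q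
  balanced⇒K*fibre≡q f z a all≡ = begin
    K ℕ.* derivFibre f z a                      ≡⟨ cong (ℕ._* derivFibre f z a) (ListP.length-tabulate {n = K} (λ i → i)) ⟨
    length (allFin K) ℕ.* derivFibre f z a      ≡⟨ ℕΣ-const (allFin K) _ ⟨
    ℕΣ.Σ (allFin K) (λ _ → derivFibre f z a)    ≡⟨ ℕΣ.Σ-cong (allFin K) all≡ ⟨
    ℕΣ.Σ (allFin K) (derivFibre f z)            ≡⟨ Σ-fibre-sizes elems (derivFun 𝔽 k f z) ⟩
    length elems                                ≡⟨ length-elems ⟩
    q                                           ∎

  derivFun-0 : ∀ f y → derivFun 𝔽 k f 0# y ≡ toZk k 0
  derivFun-0 f y = FinP.toℕ-injective (trans (deriv-0 f y) (sym (trans (FinP.toℕ-fromℕ< _) (m<n⇒m%n≡m (ℕP.m^n>0 2 k)))))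

  ℕΣ-allFin-indicator : ∀ (b : Bool) → ℕΣ.Σ (allFin K) (λ _ → indicator b) ≡ (if b then K else 0)
  ℕΣ-allFin-indicator b = trans (ℕΣ-const (allFin K) (indicator b))
    (trans (cong (ℕ._* indicator b) (ListP.length-tabulate {n = K} (λ i → i))) (K*indicator b))
    where
    K*indicator : ∀ b → K ℕ.* indicator b ≡ (if b then K else 0)
    K*indicator true  = ℕP.*-identityʳ K
    K*indicator false = ℕP.*-zeroʳ K

  elemsG-enumerates-G : Unique (elemsG 𝔽 k) × (∀ g → g ∈ elemsG 𝔽 k) × length (elemsG 𝔽 k) ≡ 2 ^ n ℕ.* 2 ^ k
                        × count (inN 𝔽 k) (elemsG 𝔽 k) ≡ 2 ^ k
  elemsG-enumerates-G = UniqueP.cartesianProduct⁺ elems-unique (UniqueP.allFin⁺ K)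
                      , (λ (x , y) → ∈P.∈-cartesianProduct⁺ (∈-elems x) (∈P.∈-allFin y))
                      , length-elemsG
                      , count-inN
    where
    length-elemsG : length (elemsG 𝔽 k) ≡ q ℕ.* K
    length-elemsG = begin
      length (elemsG 𝔽 k)                               ≡⟨ length≡Σ1 (elemsG 𝔽 k) ⟩
      ℕΣ.Σ (elemsG 𝔽 k) (λ _ → 1)                       ≡⟨ ℕΣ.Σ-cartesianProduct elems (allFin K) _ ⟩
      ℕΣ.Σ elems (λ x → ℕΣ.Σ (allFin K) (λ _ → 1))      ≡⟨ ℕΣ.Σ-cong elems (λ x → ℕΣ-allFin-indicator true) ⟩
      ℕΣ.Σ elems (λ x → K)                              ≡⟨ ℕΣ-const elems K ⟩
      length elems ℕ.* K                                ≡⟨ cong (ℕ._* K) length-elems ⟩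
      q ℕ.* K                                           ∎
    count-inN : count (inN 𝔽 k) (elemsG 𝔽 k) ≡ K
    count-inN = begin
      count (inN 𝔽 k) (elemsG 𝔽 k)                                        ≡⟨ count≡Σ-indicator _ (elemsG 𝔽 k) ⟩
      ℕΣ.Σ (elemsG 𝔽 k) (λ g → indicator (inN 𝔽 k g))                     ≡⟨ ℕΣ.Σ-cartesianProduct elems (allFin K) _ ⟩
      ℕΣ.Σ elems (λ x → ℕΣ.Σ (allFin K) (λ _ → indicator (does (x ≟ 0#))))  ≡⟨ ℕΣ.Σ-cong elems (λ x → ℕΣ-allFin-indicator (does (x ≟ 0#))) ⟩
      ℕΣ.Σ elems (λ x → if does (x ≟ 0#) then K else 0)                    ≡⟨ ℕΣ.Σ-select _≟_ elems 0# (λ _ → K) elems-unique (∈-elems 0#) ⟩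
      K                                                                   ∎

  GraphIsRDS : (F → Zk k) → Set
  GraphIsRDS f =
    IsRDS (_≟G_ 𝔽 k) (_+⋆_ 𝔽 k) (-⋆_ 𝔽 k) (0G 𝔽 k) (elemsG 𝔽 k) (inN 𝔽 k) (graph 𝔽 k f) (2 ^ n) (2 ^ k) (2 ^ n) (2 ^ (n ∸ k))

  balanced⇔RDS : ∀ f → DerivativesBalanced f ⇔ GraphIsRDS f
  balanced⇔RDS f = mk⇔ balanced⇒RDS RDS⇒balanced
    where
    no-difference-in-N : ∀ z a → z ≡ 0# → (z , a) ≢ 0G 𝔽 k → derivFibre f z a ≡ 0
    no-difference-in-N z a refl za≢0 = count-none _ elems derivFun≢a
      where
      derivFun≢a : ∀ y → does (derivFun 𝔽 k f 0# y FinP.≟ a) ≡ false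
      derivFun≢a y with derivFun 𝔽 k f 0# y FinP.≟ a
      ... | yes deriv≡a = ⊥-elim (za≢0 (cong (0# ,_) (trans (sym deriv≡a) (derivFun-0 f y))))
      ... | no _        = refl
    balanced⇒RDS : DerivativesBalanced f → GraphIsRDS f
    balanced⇒RDS balanced =
      let (uniqueG , completeG , lengthG , countN) = elemsG-enumerates-G in
        uniqueG , completeG , lengthG , countN
      , UniqueP.map⁺ (cong proj₁) elems-unique
      , trans (ListP.length-map _ elems) length-elems
      , (λ (z , a) inN≡false → trans (diffCount-graph≡derivFibre f z a)
           (K*c≡q⇒c≡2^[n∸k] _ (balanced⇒K*fibre≡q f z a (λ b → balanced z (inN-false⇒≢0 z a inN≡false) b a))))
      , (λ (z , a) inN≡true za≢0 → trans (diffCount-graph≡derivFibre f z a) (no-difference-in-N z a (inN-true⇒≡0 z a inN≡true) za≢0))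
    RDS⇒balanced : GraphIsRDS f → DerivativesBalanced f
    RDS⇒balanced (_ , _ , _ , _ , _ , _ , λ-outside-N , _) z z≢0 a b = begin
      derivFibre f z a                                                        ≡⟨ diffCount-graph≡derivFibre f z a ⟨
      diffCount (_≟G_ 𝔽 k) (_+⋆_ 𝔽 k) (-⋆_ 𝔽 k) (0G 𝔽 k) (graph 𝔽 k f) (z , a) ≡⟨ λ-outside-N (z , a) (inN-≢0 z a z≢0) ⟩
      2 ^ (n ∸ k)                                                             ≡⟨ λ-outside-N (z , b) (inN-≢0 z b z≢0) ⟨
      diffCount (_≟G_ 𝔽 k) (_+⋆_ 𝔽 k) (-⋆_ 𝔽 k) (0G 𝔽 k) (graph 𝔽 k f) (z , b) ≡⟨ diffCount-graph≡derivFibre f z b ⟩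
      derivFibre f z b                                                        ∎

theorem3p14 : ∀ (n k : ℕ) → 1 ≤ k → (𝔽 : GF n) → (f : GF.F 𝔽 → Zk k) →
    (IsNegaBent 𝔽 k f ⇔ (∀ z → z ≢ GF.0# 𝔽 → IsBalanced 𝔽 k (derivFun 𝔽 k f z)))
    × (IsNegaBent 𝔽 k f ⇔ IsRDS (_≟G_ 𝔽 k) (_+⋆_ 𝔽 k) (-⋆_ 𝔽 k) (0G 𝔽 k) (elemsG 𝔽 k) (inN 𝔽 k) (graph 𝔽 k f) (2 ^ n) (2 ^ k) (2 ^ n) (2 ^ (n ∸ k)))
theorem3p14 n k k≥1 𝔽 f = i⇔ii , RelativeDifferenceSet.balanced⇔RDS 𝔽 k k≥1 f ⇔-∘ i⇔ii
  where
  open NegaBentCharacterisation 𝔽 k k≥1 using (DerivativesBalanced; negaBent⇒balanced; balanced⇒negaBent)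
  i⇔ii : IsNegaBent 𝔽 k f ⇔ DerivativesBalanced f
  i⇔ii = mk⇔ (negaBent⇒balanced f) (balanced⇒negaBent f)
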